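{- Let $F=\langle f_1,\ldots,f_k\rangle$ be a normalized solution to an instance $(\mathcal{T}_{initial},\mathcal{T}_{final},k)$ of Flip Distance, and let $C$ be a component of $\mathcal{D}_F$. Let $f_i,f_h$ be flips in $C$ with $i<h$ and $\epsilon(f_i)\neq\epsilon(f_h)$, such that $\phi(f_h)$ crosses $\epsilon(f_i)$ and there is no $p$ with $i<p<h$ and $\epsilon(f_p)=\epsilon(f_i)$. Then there is a directed path from $f_i$ to $f_h$ in $C$.
   Context: A triangulation of a finite point set $\mathcal{P}$ in the plane is a partition of the convex hull of $\mathcal{P}$ into triangles whose vertex set is $\mathcal{P}$. For an interior edge $e$ of a triangulation $\mathcal{T}$, the quadrilateral associated with $e$ is the union of the two triangles of $\mathcal{T}$ sharing $e$. A flip of $e$ is admissible in $\mathcal{T}$ if $e\in\mathcal{T}$ and its associated quadrilateral $Q$ is convex; performing it replaces $e$ by the other diagonal of $Q$. For a flip $f$, $\epsilon(f)$ is the edge removed and $\phi(f)$ the edge created. Two distinct edges share a triangle in $\mathcal{T}$ if they are edges of a common triangle of $\mathcal{T}$; two segments between points of $\mathcal{P}$ cross if they intersect in their interiors. A sequence $F=\langle f_1,\ldots,f_r\rangle$ is valid with respect to $\mathcal{T}$ if there are triangulations $\mathcal{T}_0=\mathcal{T},\ldots,\mathcal{T}_r$ with $f_i$ admissible in $\mathcal{T}_{i-1}$ and yielding $\mathcal{T}_i$. The flip distance between two triangulations is the minimum length of a valid sequence transforming one into the other. For an instance $(\mathcal{T}_{initial},\mathcal{T}_{final},k)$ of Flip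 Distance (is the flip distance equal to $k$?), a solution is a valid sequence of $k$ flips transforming $\mathcal{T}_{initial}$ into $\mathcal{T}_{final}$ with $k$ the flip distance; a changed edge is an edge of $\mathcal{T}_{initial}$ not in $\mathcal{T}_{final}$. For $i<j$, $f_i\to f_j$ if (1) $\phi(f_i)=\epsilon(f_j)$ or $\phi(f_i)$ and $\epsilon(f_j)$ share a triangle in $\mathcal{T}_{j-1}$, and (2) no $p$ with $i<p<j$ has $\epsilon(f_p)=\phi(f_i)$. $\mathcal{D}_F$ is the DAG on the flips of $F$ with these arcs; components are weakly connected components. A component is essential if it contains a flip whose underlying edge is a changed edge. A normalized solution is a solution $F$ such that every component of $\mathcal{D}_F$ is essential and the flips of each component form a consecutive block of $F$. Here $\mathcal{T}_j$ denotes the outcome of applying $\langle f_1,\ldots,f_j\rangle$ to $\mathcal{T}_{initial}$. -}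

module Defs where

open import Level using (0ℓ)
open import Data.Nat as ℕ using (ℕ; zero; suc)
open import Data.Fin as Fin using (Fin; toℕ)
open import Data.Bool using (Bool; true; false; _∨_; _∧_; if_then_else_)
open import Data.List using (List; []; _∷_; length; lookup; take; foldl)
open import Data.Product using (Σ; ∃; _×_; _,_; proj₁; proj₂)
open import Data.Sum using (_⊎_)
open import Data.Unit using (⊤)
open import Relation.Nullary using (¬_)
open import Relation.Nullary.Decidable using (⌊_⌋)
open import Relation.Binary.PropositionalEquality using (_≡_)
open import Relation.Binary.Structures using (IsStrictTotalOrder)
open import Relation.Binary.Construct.Closure.ReflexiveTransitive using (Star)
open import Algebra.Structures using (IsCommutativeRing)
open import Function.Bundles using (_⇔_)

-- An (abstract) ordered field.  The plane is K × K.

record OrderedField : Set₁ where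
  infix  4 _≈_ _<_
  infixl 6 _+_
  infixl 7 _*_
  field
    Carrier : Set
    _≈_     : Carrier → Carrier → Set
    _+_ _*_ : Carrier → Carrier → Carrier
    -_      : Carrier → Carrier
    0# 1#   : Carrier
    _<_     : Carrier → Carrier → Set
    isCommutativeRing   : IsCommutativeRing _≈_ _+_ _*_ -_ 0# 1#
    <-isStrictTotalOrder : IsStrictTotalOrder _≈_ _<_
    0<1      : 0# < 1#
    +-mono-< : ∀ {a b} c → a < b → a + c < b + c
    *-pos    : ∀ {a b} → 0# < a → 0# < b → 0# < a * b
    inverse  : ∀ x → ¬ (x ≈ 0#) → ∃ λ y → x * y ≈ 1#

  _-_ : Carrier → Carrier → Carrier
  a - b = a + (- b)

  _≤_ : Carrier → Carrier → Set
  a ≤ b = a < b ⊎ a ≈ b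

module Geometry (K : OrderedField) where
  open OrderedField K

  Point : Set
  Point = Carrier × Carrier

  _≈ₚ_ : Point → Point → Set
  (x , y) ≈ₚ (x' , y') = x ≈ x' × y ≈ y'

  orient : Point → Point → Point → Carrier
  orient (px , py) (qx , qy) (rx , ry) =
    ((qx - px) * (ry - py)) - ((qy - py) * (rx - px))

  InClosedTriangle : Point → Point → Point → Point → Set
  InClosedTriangle x p q r =
      (0# ≤ orient p q x × 0# ≤ orient q r x × 0# ≤ orient r p x)
    ⊎ (orient p q x ≤ 0# × orient q r x ≤ 0# × orient r p x ≤ 0#)

  InOpenTriangle : Point → Point → Point → Point → Set
  InOpenTriangle x p q r =
      (0# < orient p q x × 0# < orient q r x × 0# < orient r p x)
    ⊎ (orient p q x < 0# × orient q r x < 0# × orient r p x < 0#)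

  InOpenSegment : Point → Point → Point → Set
  InOpenSegment x (px , py) (qx , qy) =
    ∃ λ t → 0# < t × t < 1# ×
      ((px + t * (qx - px)) , (py + t * (qy - py))) ≈ₚ x

  SegmentsCross : Point → Point → Point → Point → Set
  SegmentsCross p q r s = ∃ λ x → InOpenSegment x p q × InOpenSegment x r s

  ConvexQuadrilateral : Point → Point → Point → Point → Set
  ConvexQuadrilateral p1 p2 p3 p4 =
      (0# < orient p1 p2 p3 × 0# < orient p2 p3 p4 × 0# < orient p3 p4 p1 × 0# < orient p4 p1 p2)
    ⊎ (orient p1 p2 p3 < 0# × orient p2 p3 p4 < 0# × orient p3 p4 p1 < 0# × orient p4 p1 p2 < 0#)

  ∑ : ∀ {m} → (Fin m → Carrier) → Carrier
  ∑ {zero}  f = 0#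
  ∑ {suc m} f = f Fin.zero + ∑ (λ i → f (Fin.suc i))

  module PointSet {n : ℕ} (P : Fin n → Point) where

    Distinct : Set
    Distinct = ∀ i j → P i ≈ₚ P j → i ≡ j

    InConvexHull : Point → Set
    InConvexHull x = ∃ λ (w : Fin n → Carrier) →
        (∀ i → 0# ≤ w i) × ∑ w ≈ 1#
      × (∑ (λ i → w i * proj₁ (P i)) , ∑ (λ i → w i * proj₂ (P i))) ≈ₚ x

    -- triangles are (unordered) triples of indices; a candidate
    -- triangulation is a Boolean indicator on triples.
    TriSet : Set
    TriSet = Fin n → Fin n → Fin n → Bool

    _==_ : Fin n → Fin n → Bool
    a == b = ⌊ a Fin.≟ b ⌋

    memᵇ : Fin n → Fin n → Fin n → Fin n → Bool
    memᵇ v a b c = (v == a) ∨ (v == b) ∨ (v == c)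

    sameTriᵇ : Fin n → Fin n → Fin n → Fin n → Fin n → Fin n → Bool
    sameTriᵇ a b c a' b' c' =
      memᵇ a a' b' c' ∧ memᵇ b a' b' c' ∧ memᵇ c a' b' c'
      ∧ memᵇ a' a b c ∧ memᵇ b' a b c ∧ memᵇ c' a b c

    record IsTriangulation (T : TriSet) : Set where
      field
        sym₁₂     : ∀ a b c → T a b c ≡ T b a c
        sym₂₃     : ∀ a b c → T a b c ≡ T a c b
        nondeg    : ∀ a b c → T a b c ≡ true → ¬ (orient (P a) (P b) (P c) ≈ 0#)
        disjoint  : ∀ a b c a' b' c' → T a b c ≡ true → T a' b' c' ≡ true →
                    sameTriᵇ a b c a' b' c' ≡ false →
                    ¬ (∃ λ x → InOpenTriangle x (P a) (P b) (P c)
                             × InOpenTriangle x (P a') (P b') (P c'))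
        cover     : ∀ x → InConvexHull x ⇔
                    (∃ λ a → ∃ λ b → ∃ λ c → T a b c ≡ true
                       × InClosedTriangle x (P a) (P b) (P c))
        onlyVerts : ∀ a b c → T a b c ≡ true → ∀ v →
                    InClosedTriangle (P v) (P a) (P b) (P c) →
                    v ≡ a ⊎ v ≡ b ⊎ v ≡ c
        allVerts  : ∀ v → ∃ λ b → ∃ λ c → T v b c ≡ true

    Edge : Set
    Edge = Fin n × Fin n

    SameEdge : Edge → Edge → Set
    SameEdge (a , b) (c , d) = (a ≡ c × b ≡ d) ⊎ (a ≡ d × b ≡ c)

    SideOf : Edge → Fin n → Fin n → Fin n → Set
    SideOf e x y z = SameEdge e (x , y) ⊎ SameEdge e (y , z) ⊎ SameEdge e (x , z)

    IsEdgeOf : TriSet → Edge → Set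
    IsEdgeOf T e = ∃ λ x → ∃ λ y → ∃ λ z → T x y z ≡ true × SideOf e x y z

    ShareTriangle : TriSet → Edge → Edge → Set
    ShareTriangle T e e' = ¬ SameEdge e e' ×
      (∃ λ x → ∃ λ y → ∃ λ z → T x y z ≡ true × SideOf e x y z × SideOf e' x y z)

    Cross : Edge → Edge → Set
    Cross (a , b) (c , d) = SegmentsCross (P a) (P b) (P c) (P d)

    -- Flips.  The flip (a,b,c,d) removes edge ab, whose two incident
    -- triangles are abc and abd, and creates edge cd.

    record Flip : Set where
      constructor mkFlip
      field a b c d : Fin n

    ε : Flip → Edge
    ε f = Flip.a f , Flip.b f

    φ : Flip → Edge
    φ f = Flip.c f , Flip.d f

    Admissible : TriSet → Flip → Set
    Admissible T (mkFlip a b c d) =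
      T a b c ≡ true × T a b d ≡ true × ConvexQuadrilateral (P a) (P c) (P b) (P d)

    doFlip : TriSet → Flip → TriSet
    doFlip T (mkFlip a b c d) x y z =
      if sameTriᵇ x y z a b c ∨ sameTriᵇ x y z a b d then false
      else if sameTriᵇ x y z c d a ∨ sameTriᵇ x y z c d b then true
      else T x y z

    applyAll : TriSet → List Flip → TriSet
    applyAll = foldl doFlip

    Valid : TriSet → List Flip → Set
    Valid T []      = ⊤
    Valid T (f ∷ F) = Admissible T f × Valid (doFlip T f) F

    SameTriSet : TriSet → TriSet → Set
    SameTriSet T T' = ∀ x y z → T x y z ≡ T' x y z

    Transforms : TriSet → List Flip → TriSet → Set
    Transforms T F T' = Valid T F × SameTriSet (applyAll T F) T'

    IsSolution : TriSet → TriSet → List Flip → Set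
    IsSolution Ti Tf F = Transforms Ti F Tf ×
      (∀ G → Transforms Ti G Tf → length F ℕ.≤ length G)

    -- The DAG D_F for a flip sequence F (flips indexed 0 .. length F - 1;
    -- index j here corresponds to f_{j+1} in the paper).

    module FlipDAG (Ti Tf : TriSet) (F : List Flip) where

      Idx : Set
      Idx = Fin (length F)

      fl : Idx → Flip
      fl = lookup F

      Tbefore : Idx → TriSet
      Tbefore j = applyAll Ti (take (toℕ j) F)

      Arc : Idx → Idx → Set
      Arc i j = toℕ i ℕ.< toℕ j
        × (SameEdge (φ (fl i)) (ε (fl j)) ⊎ ShareTriangle (Tbefore j) (φ (fl i)) (ε (fl j)))
        × (∀ p → toℕ i ℕ.< toℕ p → toℕ p ℕ.< toℕ j → ¬ SameEdge (ε (fl p)) (φ (fl i)))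

      Link : Idx → Idx → Set
      Link i j = Arc i j ⊎ Arc j i

      SameComponent : Idx → Idx → Set
      SameComponent = Star Link

      DirectedPath : Idx → Idx → Set
      DirectedPath = Star Arc

      ChangedEdge : Edge → Set
      ChangedEdge e = IsEdgeOf Ti e × ¬ IsEdgeOf Tf e

      IsNormalizedSolution : Set
      IsNormalizedSolution = IsSolution Ti Tf F
        × (∀ i → ∃ λ j → SameComponent i j × ChangedEdge (ε (fl j)))
        × (∀ i j p → toℕ i ℕ.< toℕ p → toℕ p ℕ.< toℕ j →
             SameComponent i j → SameComponent i p)

-- Let e = ε(f_i).  For i < m ≤ h, every edge of the triangulation
-- T_m that properly crosses e was created by a flip f_q (q < m) reachable
-- from f_i and not removed since; we call such an edge witnessed.  Right
-- after f_i the only edge crossing e is φ(f_i), since T_i contained e.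
-- When f_m creates an edge crossing e, the crossing lemma (exits-flipQuad)
-- shows that e leaves the convex flip quadrilateral through one of its
-- sides; that side is an older edge crossing e and shares a triangle with
-- ε(f_m), so its witness has an arc into f_m.  At the end, φ(f_h) crossing
-- e means crossing it properly or being e itself (crossing⇒proper-or-same),
-- and the same step at f_h yields the path.

module Submission where

open import Level using (Level)
open import Data.Nat using (ℕ)
open import Data.Fin using (Fin)
open import Data.List using (List; length)
open import Algebra.Bundles using (CommutativeRing)
open import Defs

-- The ring solver of the library needs a coefficient ring mapped
-- homomorphically into the target ring.  For an arbitrary commutative
-- ring the integers serve: n ↦ n·1 is a ring homomorphism ℤ → R.
module IntegerCoefficientSolver {c ℓ : Level} (R : CommutativeRing c ℓ) where
  open import Data.Nat as ℕ using (ℕ; zero; suc)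
  import Data.Nat.Properties as ℕ
  open import Data.Integer as ℤ using (ℤ; +_; -[1+_])
  import Data.Integer.Properties as ℤ
  open import Data.Sign as Sign using (Sign)
  open import Data.Maybe using (Maybe; just; nothing)
  open import Relation.Nullary using (yes; no)
  import Relation.Binary.PropositionalEquality as ≡
  open import Algebra.Solver.Ring.AlmostCommutativeRing using (AlmostCommutativeRing; fromCommutativeRing; _-Raw-AlmostCommutative⟶_)
  open CommutativeRing R
  open import Algebra.Properties.Ring ring using (-‿involutive; -‿+-comm; -‿distribˡ-*; -‿distribʳ-*; -0#≈0#)
  open import Algebra.Properties.Semiring.Mult.TCOptimised semiring using (_×_; 1+×; ×-homo-+; ×1-homo-*)
  open import Relation.Binary.Reasoning.Setoid setoid

  ℕ⟦_⟧ : ℕ → Carrier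
  ℕ⟦ n ⟧ = n × 1#

  ℤ⟦_⟧ : ℤ → Carrier
  ℤ⟦ + n ⟧     = ℕ⟦ n ⟧
  ℤ⟦ -[1+ n ] ⟧ = - ℕ⟦ suc n ⟧

  cancel-1+ : ∀ a b → (1# + a) + - (1# + b) ≈ a + - b
  cancel-1+ a b = begin
    (1# + a) + - (1# + b)     ≈⟨ +-congˡ (sym (-‿+-comm 1# b)) ⟩
    (1# + a) + (- 1# + - b)   ≈⟨ +-assoc 1# a _ ⟩
    1# + (a + (- 1# + - b))   ≈⟨ +-congˡ (sym (+-assoc a (- 1#) (- b))) ⟩
    1# + ((a + - 1#) + - b)   ≈⟨ +-congˡ (+-congʳ (+-comm a (- 1#))) ⟩
    1# + ((- 1# + a) + - b)   ≈⟨ +-congˡ (+-assoc (- 1#) a (- b)) ⟩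
    1# + (- 1# + (a + - b))   ≈⟨ sym (+-assoc 1# (- 1#) _) ⟩
    (1# + - 1#) + (a + - b)   ≈⟨ +-congʳ (-‿inverseʳ 1#) ⟩
    0# + (a + - b)            ≈⟨ +-identityˡ _ ⟩
    a + - b                   ∎

  ⊖-homo : ∀ m n → ℤ⟦ m ℤ.⊖ n ⟧ ≈ ℕ⟦ m ⟧ + - ℕ⟦ n ⟧
  ⊖-homo m zero = begin
    ℤ⟦ m ℤ.⊖ 0 ⟧     ≡⟨ ≡.cong ℤ⟦_⟧ (ℤ.⊖-≥ {m} ℕ.z≤n) ⟩
    ℕ⟦ m ⟧           ≈⟨ sym (+-identityʳ _) ⟩
    ℕ⟦ m ⟧ + 0#      ≈⟨ +-congˡ (sym -0#≈0#) ⟩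
    ℕ⟦ m ⟧ + - 0#    ∎
  ⊖-homo zero (suc n) = sym (+-identityˡ _)
  ⊖-homo (suc m) (suc n) = begin
    ℤ⟦ suc m ℤ.⊖ suc n ⟧          ≡⟨ ≡.cong ℤ⟦_⟧ (ℤ.[1+m]⊖[1+n]≡m⊖n m n) ⟩
    ℤ⟦ m ℤ.⊖ n ⟧                  ≈⟨ ⊖-homo m n ⟩
    ℕ⟦ m ⟧ + - ℕ⟦ n ⟧             ≈⟨ sym (cancel-1+ ℕ⟦ m ⟧ ℕ⟦ n ⟧) ⟩
    (1# + ℕ⟦ m ⟧) + - (1# + ℕ⟦ n ⟧) ≈⟨ sym (+-cong (1+× m 1#) (-‿cong (1+× n 1#))) ⟩
    ℕ⟦ suc m ⟧ + - ℕ⟦ suc n ⟧     ∎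

  +-homo : ∀ i j → ℤ⟦ i ℤ.+ j ⟧ ≈ ℤ⟦ i ⟧ + ℤ⟦ j ⟧
  +-homo (+ m)     (+ n)     = ×-homo-+ 1# m n
  +-homo (+ m)     -[1+ n ]  = ⊖-homo m (suc n)
  +-homo -[1+ m ]  (+ n)     = trans (⊖-homo n (suc m)) (+-comm _ _)
  +-homo -[1+ m ]  -[1+ n ]  = begin
    - ℕ⟦ suc (suc (m ℕ.+ n)) ⟧            ≡⟨ ≡.cong (λ k → - ℕ⟦ suc k ⟧) (≡.sym (ℕ.+-suc m n)) ⟩
    - ℕ⟦ suc m ℕ.+ suc n ⟧                ≈⟨ -‿cong (×-homo-+ 1# (suc m) (suc n)) ⟩
    - (ℕ⟦ suc m ⟧ + ℕ⟦ suc n ⟧)           ≈⟨ sym (-‿+-comm _ _) ⟩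
    - ℕ⟦ suc m ⟧ + - ℕ⟦ suc n ⟧           ∎

  neg-homo : ∀ i → ℤ⟦ ℤ.- i ⟧ ≈ - ℤ⟦ i ⟧
  neg-homo (+ zero)  = sym -0#≈0#
  neg-homo (+ suc n) = refl
  neg-homo -[1+ n ]  = sym (-‿involutive _)

  -- integer multiplication is defined through signs and magnitudes
  +◃-homo : ∀ n → ℤ⟦ Sign.+ ℤ.◃ n ⟧ ≈ ℕ⟦ n ⟧
  +◃-homo zero    = refl
  +◃-homo (suc n) = refl

  -◃-homo : ∀ n → ℤ⟦ Sign.- ℤ.◃ n ⟧ ≈ - ℕ⟦ n ⟧
  -◃-homo zero    = sym -0#≈0#
  -◃-homo (suc n) = refl

  *-homo : ∀ i j → ℤ⟦ i ℤ.* j ⟧ ≈ ℤ⟦ i ⟧ * ℤ⟦ j ⟧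
  *-homo (+ m)     (+ n)     = trans (+◃-homo (m ℕ.* n)) (×1-homo-* m n)
  *-homo (+ m)     -[1+ n ]  =
    trans (-◃-homo (m ℕ.* suc n)) (trans (-‿cong (×1-homo-* m (suc n))) (-‿distribʳ-* _ _))
  *-homo -[1+ m ]  (+ n)     =
    trans (-◃-homo (suc m ℕ.* n)) (trans (-‿cong (×1-homo-* (suc m) n)) (-‿distribˡ-* _ _))
  *-homo -[1+ m ]  -[1+ n ]  = begin
    ℤ⟦ Sign.+ ℤ.◃ (suc m ℕ.* suc n) ⟧   ≈⟨ +◃-homo (suc m ℕ.* suc n) ⟩
    ℕ⟦ suc m ℕ.* suc n ⟧                ≈⟨ ×1-homo-* (suc m) (suc n) ⟩
    ℕ⟦ suc m ⟧ * ℕ⟦ suc n ⟧             ≈⟨ sym (-‿involutive _) ⟩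
    - - (ℕ⟦ suc m ⟧ * ℕ⟦ suc n ⟧)       ≈⟨ -‿cong (-‿distribˡ-* _ _) ⟩
    - ((- ℕ⟦ suc m ⟧) * ℕ⟦ suc n ⟧)     ≈⟨ -‿distribʳ-* _ _ ⟩
    (- ℕ⟦ suc m ⟧) * (- ℕ⟦ suc n ⟧)     ∎

  almostCommutativeRing : AlmostCommutativeRing c ℓ
  almostCommutativeRing = fromCommutativeRing R

  ℤ-homomorphism : ℤ.+-*-rawRing -Raw-AlmostCommutative⟶ almostCommutativeRing
  ℤ-homomorphism = record
    { ⟦_⟧    = ℤ⟦_⟧
    ; +-homo = +-homo
    ; *-homo = *-homo
    ; -‿homo = neg-homo
    ; 0-homo = refl
    ; 1-homo = refl
    }

  coefficient≈? : ∀ i j → Maybe (ℤ⟦ i ⟧ ≈ ℤ⟦ j ⟧)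
  coefficient≈? i j with i ℤ.≟ j
  ... | yes ≡.refl = just refl
  ... | no _     = nothing

  open import Algebra.Solver.Ring ℤ.+-*-rawRing almostCommutativeRing ℤ-homomorphism coefficient≈? public

-- Elementary algebra of an ordered field: the ring laws, and the sign
-- calculus used to reason about orientation determinants.
module OrderedFieldProperties (K : OrderedField) where
  import Data.Integer as ℤ
  open import Data.Product using (_×_; _,_; proj₁; proj₂; Σ)
  open import Data.Sum using (_⊎_; inj₁; inj₂)
  open import Data.Empty using (⊥; ⊥-elim)
  open import Relation.Nullary using (¬_)
  open import Relation.Binary.Definitions using (tri<; tri≈; tri>)
  open import Relation.Binary.Structures using (IsStrictTotalOrder)
  open OrderedField K public

  commutativeRing : CommutativeRing _ _
  commutativeRing = record { isCommutativeRing = isCommutativeRing }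

  open IntegerCoefficientSolver commutativeRing using (solve; _:+_; _:*_; :-_; _:-_; _:=_; con)
  open CommutativeRing commutativeRing public using (setoid; +-cong; *-cong; -‿cong; +-assoc; +-comm; +-identityˡ; +-identityʳ; *-identityˡ; *-identityʳ; zeroˡ; zeroʳ; distribˡ; distribʳ; -‿inverseʳ; -‿inverseˡ; *-comm; *-assoc; refl; sym; trans; reflexive; +-congˡ; +-congʳ; *-congˡ; *-congʳ)
  open import Algebra.Properties.Ring (CommutativeRing.ring commutativeRing) public using (-‿involutive; -‿distribˡ-*; -‿distribʳ-*; -0#≈0#)
  private module STO = IsStrictTotalOrder <-isStrictTotalOrder

  StrictlyBetween : Carrier → Carrier → Carrier → Set
  StrictlyBetween a x b = (a < x × x < b) ⊎ (b < x × x < a)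

  <-resp : ∀ {a a' b b'} → a ≈ a' → b ≈ b' → a < b → a' < b'
  <-resp e1 e2 p = STO.<-respˡ-≈ e1 (STO.<-respʳ-≈ e2 p)

  <-trans : ∀ {a b c} → a < b → b < c → a < c
  <-trans = STO.trans

  <≈⊥ : ∀ {a b} → a < b → a ≈ b → ⊥
  <≈⊥ p e = STO.irrefl e p

  <-asym : ∀ {a b} → a < b → b < a → ⊥
  <-asym p q = STO.irrefl refl (<-trans p q)

  tri : ∀ x → x < 0# ⊎ x ≈ 0# ⊎ 0# < x
  tri x with STO.compare x 0#
  ... | tri< a _ _ = inj₁ a
  ... | tri≈ _ b _ = inj₂ (inj₁ b)
  ... | tri> _ _ c = inj₂ (inj₂ c)

  cmp : ∀ x y → x < y ⊎ x ≈ y ⊎ y < x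
  cmp x y with STO.compare x y
  ... | tri< a _ _ = inj₁ a
  ... | tri≈ _ b _ = inj₂ (inj₁ b)
  ... | tri> _ _ c = inj₂ (inj₂ c)

  ≤or> : ∀ x → x ≤ 0# ⊎ 0# < x
  ≤or> x with tri x
  ... | inj₁ n = inj₁ (inj₁ n)
  ... | inj₂ (inj₁ e) = inj₁ (inj₂ e)
  ... | inj₂ (inj₂ p) = inj₂ p

  <or≥ : ∀ x → x < 0# ⊎ 0# ≤ x
  <or≥ x with tri x
  ... | inj₁ n = inj₁ n
  ... | inj₂ (inj₁ e) = inj₂ (inj₂ (sym e))
  ... | inj₂ (inj₂ p) = inj₂ (inj₁ p)

  ≤-<-trans : ∀ {a b c} → a ≤ b → b < c → a < c
  ≤-<-trans (inj₁ p) q = <-trans p q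
  ≤-<-trans (inj₂ e) q = <-resp (sym e) refl q

  <-≤-trans : ∀ {a b c} → a < b → b ≤ c → a < c
  <-≤-trans p (inj₁ q) = <-trans p q
  <-≤-trans p (inj₂ e) = <-resp refl e p

  ≤-resp : ∀ {x y} → x ≈ y → 0# ≤ x → 0# ≤ y
  ≤-resp e (inj₁ r) = inj₁ (<-resp refl e r)
  ≤-resp e (inj₂ e2) = inj₂ (trans e2 e)

  ≤-resp' : ∀ {x y} → x ≈ y → x ≤ 0# → y ≤ 0#
  ≤-resp' e (inj₁ r) = inj₁ (<-resp e refl r)
  ≤-resp' e (inj₂ e2) = inj₂ (trans (sym e) e2)

  pos≉0 : ∀ {a} → 0# < a → ¬ (a ≈ 0#)
  pos≉0 p e = <≈⊥ p (sym e)

  neg≉0 : ∀ {a} → a < 0# → ¬ (a ≈ 0#)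
  neg≉0 p e = <≈⊥ p e

  -- Sign rules.  In the names, p, n, w stand for an argument that is positive,
  -- negative, or weakly signed (≥ 0, or ≤ 0 in the primed variants).
  pos→neg : ∀ {a} → 0# < a → - a < 0#
  pos→neg {a} p = <-resp (+-identityˡ (- a)) (-‿inverseʳ a) (+-mono-< (- a) p)

  neg→pos : ∀ {a} → a < 0# → 0# < - a
  neg→pos {a} p = <-resp (-‿inverseʳ a) (+-identityˡ (- a)) (+-mono-< (- a) p)

  negpos→neg : ∀ {a} → 0# < - a → a < 0#
  negpos→neg {a} p = <-resp (-‿involutive a) refl (pos→neg p)

  negneg→pos : ∀ {a} → - a < 0# → 0# < a
  negneg→pos {a} p = <-resp refl (-‿involutive a) (neg→pos p)

  lt⇒diff>0 : ∀ {a b} → a < b → 0# < b + - a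
  lt⇒diff>0 {a} {b} p = <-resp (-‿inverseʳ a) refl (+-mono-< (- a) p)

  diff>0⇒lt : ∀ {a b} → 0# < b + - a → a < b
  diff>0⇒lt {a} {b} p = <-resp (+-identityˡ a) e (+-mono-< a p)
    where
    e : (b + - a) + a ≈ b
    e = trans (+-assoc _ _ _) (trans (+-congˡ (-‿inverseˡ a)) (+-identityʳ b))

  lt⇒diff<0 : ∀ {a b} → a < b → a - b < 0#
  lt⇒diff<0 {a} {b} p = <-resp (solve 2 (λ a b → :- (b :- a) := a :- b) refl a b) refl (pos→neg (lt⇒diff>0 p))

  ≈neg-nonpos : ∀ {a b} → 0# ≤ a → b ≈ - a → b ≤ 0#
  ≈neg-nonpos (inj₁ p) e = inj₁ (<-resp (sym e) refl (pos→neg p))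
  ≈neg-nonpos {a} {b} (inj₂ z) e = inj₂ (trans e (trans (-‿cong (sym z)) -0#≈0#))

  ≈neg-nonneg : ∀ {a b} → a ≤ 0# → b ≈ - a → 0# ≤ b
  ≈neg-nonneg (inj₁ p) e = inj₁ (<-resp refl (sym e) (neg→pos p))
  ≈neg-nonneg {a} {b} (inj₂ z) e = inj₂ (sym (trans e (trans (-‿cong z) -0#≈0#)))

  +pp : ∀ {a b} → 0# < a → 0# < b → 0# < a + b
  +pp {a} {b} p q = <-trans q (<-resp (+-identityˡ b) refl (+-mono-< b p))

  +nn : ∀ {a b} → a < 0# → b < 0# → a + b < 0#
  +nn {a} {b} p q = <-trans (<-resp refl (+-identityˡ b) (+-mono-< b p)) q

  +wp : ∀ {a b} → 0# ≤ a → 0# < b → 0# < a + b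
  +wp (inj₁ p) q = +pp p q
  +wp {a} {b} (inj₂ e) q = <-resp refl (trans (sym (+-identityˡ b)) (+-congʳ e)) q

  +pw : ∀ {a b} → 0# < a → 0# ≤ b → 0# < a + b
  +pw {a} {b} p q = <-resp refl (+-comm b a) (+wp q p)

  +ww : ∀ {a b} → 0# ≤ a → 0# ≤ b → 0# ≤ (a + b)
  +ww p (inj₁ q) = inj₁ (+wp p q)
  +ww {a} {b} (inj₁ p) (inj₂ e) = inj₁ (<-resp refl (trans (sym (+-identityʳ a)) (+-congˡ e)) p)
  +ww {a} {b} (inj₂ e1) (inj₂ e2) = inj₂ (trans (sym (+-identityʳ 0#)) (+-cong e1 e2))

  +wn : ∀ {a b} → a ≤ 0# → b < 0# → a + b < 0#
  +wn (inj₁ p) q = +nn p q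
  +wn {a} {b} (inj₂ e) q = <-resp (trans (sym (+-identityˡ b)) (+-congʳ (sym e))) refl q

  +nw : ∀ {a b} → a < 0# → b ≤ 0# → a + b < 0#
  +nw {a} {b} p q = <-resp (+-comm b a) refl (+wn q p)

  +ww' : ∀ {a b} → a ≤ 0# → b ≤ 0# → (a + b) ≤ 0#
  +ww' p (inj₁ q) = inj₁ (+wn p q)
  +ww' {a} {b} (inj₁ p) (inj₂ e) = inj₁ (<-resp (trans (sym (+-identityʳ a)) (+-congˡ (sym e))) refl p)
  +ww' {a} {b} (inj₂ e1) (inj₂ e2) = inj₂ (trans (+-cong e1 e2) (+-identityʳ 0#))

  *z : ∀ {a b} → b ≈ 0# → a * b ≈ 0#
  *z {a} e = trans (*-congˡ e) (zeroʳ a)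

  z* : ∀ {a b} → a ≈ 0# → a * b ≈ 0#
  z* {b = b} e = trans (*-congʳ e) (zeroˡ b)

  *pp : ∀ {a b} → 0# < a → 0# < b → 0# < a * b
  *pp = *-pos

  *pn : ∀ {a b} → 0# < a → b < 0# → a * b < 0#
  *pn {a} {b} p q = negpos→neg (<-resp refl (sym (-‿distribʳ-* a b)) (*pp p (neg→pos q)))

  *np : ∀ {a b} → a < 0# → 0# < b → a * b < 0#
  *np {a} {b} p q = <-resp (*-comm b a) refl (*pn q p)

  *nn : ∀ {a b} → a < 0# → b < 0# → 0# < a * b
  *nn {a} {b} p q = <-resp refl e (*pp (neg→pos p) (neg→pos q))
    where
    e : (- a) * (- b) ≈ a * b
    e = trans (sym (-‿distribˡ-* a (- b))) (trans (-‿cong (sym (-‿distribʳ-* a b))) (-‿involutive _))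

  *pw : ∀ {a b} → 0# < a → 0# ≤ b → 0# ≤ (a * b)
  *pw p (inj₁ q) = inj₁ (*pp p q)
  *pw p (inj₂ e) = inj₂ (sym (*z (sym e)))

  *ww : ∀ {a b} → 0# ≤ a → 0# ≤ b → 0# ≤ (a * b)
  *ww (inj₁ p) q = *pw p q
  *ww (inj₂ e) q = inj₂ (sym (z* (sym e)))

  *nw : ∀ {a b} → a < 0# → b ≤ 0# → 0# ≤ (a * b)
  *nw p (inj₁ q) = inj₁ (*nn p q)
  *nw p (inj₂ e) = inj₂ (sym (*z e))

  *wn : ∀ {a b} → a ≤ 0# → b < 0# → 0# ≤ (a * b)
  *wn {a} {b} p q = <-resp-w (*-comm b a) (*nw q p)
    where
    <-resp-w : ∀ {x y} → x ≈ y → 0# ≤ x → 0# ≤ y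
    <-resp-w e (inj₁ r) = inj₁ (<-resp refl e r)
    <-resp-w e (inj₂ e2) = inj₂ (trans e2 e)

  *pw' : ∀ {a b} → 0# < a → b ≤ 0# → (a * b) ≤ 0#
  *pw' p (inj₁ q) = inj₁ (*pn p q)
  *pw' p (inj₂ e) = inj₂ (*z e)

  *nw' : ∀ {a b} → a < 0# → 0# ≤ b → (a * b) ≤ 0#
  *nw' p (inj₁ q) = inj₁ (*np p q)
  *nw' p (inj₂ e) = inj₂ (*z (sym e))

  *wn' : ∀ {a y} → 0# ≤ a → y < 0# → (a * y) ≤ 0#
  *wn' {a} {y} p q = ≤-resp' (*-comm y a) (*nw' q p)

  sq-pos : ∀ {a} → ¬ (a ≈ 0#) → 0# < a * a
  sq-pos {a} ne with tri a
  ... | inj₁ n = *nn n n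
  ... | inj₂ (inj₁ e) = ⊥-elim (ne e)
  ... | inj₂ (inj₂ p) = *pp p p

  sq-nonneg : ∀ x → 0# ≤ (x * x)
  sq-nonneg x with tri x
  ... | inj₁ n = inj₁ (*nn n n)
  ... | inj₂ (inj₁ e) = inj₂ (sym (z* e))
  ... | inj₂ (inj₂ p) = inj₁ (*pp p p)

  zero-prod : ∀ {a b} → a * b ≈ 0# → a ≈ 0# ⊎ b ≈ 0#
  zero-prod {a} {b} e with tri a | tri b
  ... | inj₂ (inj₁ x) | _ = inj₁ x
  ... | _ | inj₂ (inj₁ y) = inj₂ y
  ... | inj₁ x | inj₁ y = ⊥-elim (<≈⊥ (*nn x y) (sym e))
  ... | inj₁ x | inj₂ (inj₂ y) = ⊥-elim (<≈⊥ (*np x y) e)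
  ... | inj₂ (inj₂ x) | inj₁ y = ⊥-elim (<≈⊥ (*pn x y) e)
  ... | inj₂ (inj₂ x) | inj₂ (inj₂ y) = ⊥-elim (<≈⊥ (*pp x y) (sym e))

  square≈0 : ∀ {x} → x * x ≈ 0# → x ≈ 0#
  square≈0 e with zero-prod e
  ... | inj₁ x = x
  ... | inj₂ x = x

  cancel-p : ∀ {a b} → 0# < a → 0# < a * b → 0# < b
  cancel-p {a} {b} p q with tri b
  ... | inj₁ n = ⊥-elim (<-asym q (*pn p n))
  ... | inj₂ (inj₁ e) = ⊥-elim (<≈⊥ q (sym (*z e)))
  ... | inj₂ (inj₂ r) = r

  cancel-w : ∀ {a b} → 0# < a → 0# ≤ (a * b) → 0# ≤ b
  cancel-w {a} {b} p q with tri b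
  ... | inj₁ n = ⊥-elim (h q)
    where
    h : 0# ≤ (a * b) → ⊥
    h (inj₁ r) = <-asym r (*pn p n)
    h (inj₂ e) = <≈⊥ (*pn p n) (sym e)
  ... | inj₂ (inj₁ e) = inj₂ (sym e)
  ... | inj₂ (inj₂ r) = inj₁ r

  cancel-n : ∀ {a b} → 0# < a → a * b < 0# → b < 0#
  cancel-n {a} {b} p q with tri b
  ... | inj₁ n = n
  ... | inj₂ (inj₁ e) = ⊥-elim (<≈⊥ q (*z e))
  ... | inj₂ (inj₂ r) = ⊥-elim (<-asym q (*pp p r))

  cancel-neg-nonneg : ∀ {a b} → a < 0# → 0# ≤ (a * b) → b ≤ 0#
  cancel-neg-nonneg {a} {b} n w with tri b
  ... | inj₁ r = inj₁ r
  ... | inj₂ (inj₁ e) = inj₂ e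
  ... | inj₂ (inj₂ r) = ⊥-elim (h w)
    where
    h : 0# ≤ (a * b) → ⊥
    h (inj₁ q) = <-asym q (*np n r)
    h (inj₂ e) = <≈⊥ (*np n r) (sym e)

  cancel-nonpos : ∀ {a b} → 0# < a → (a * b) ≤ 0# → b ≤ 0#
  cancel-nonpos {a} {b} p q with tri b
  ... | inj₁ r = inj₁ r
  ... | inj₂ (inj₁ e) = inj₂ e
  ... | inj₂ (inj₂ r) = ⊥-elim (h q)
    where
    h : (a * b) ≤ 0# → ⊥
    h (inj₁ s) = <-asym s (*pp p r)
    h (inj₂ e) = <≈⊥ (*pp p r) (sym e)

  sgn-p-p : ∀ {x s} → 0# < s → 0# < x * s → 0# < x
  sgn-p-p {x} {s} p q = cancel-p p (<-resp refl (*-comm x s) q)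

  sgn-n-p : ∀ {x s} → 0# < s → x * s < 0# → x < 0#
  sgn-n-p {x} {s} p q = cancel-n p (<-resp (*-comm x s) refl q)

  sgn-p-n : ∀ {x s} → s < 0# → 0# < x * s → x < 0#
  sgn-p-n {x} {s} p q with tri x
  ... | inj₁ r = r
  ... | inj₂ (inj₁ e) = ⊥-elim (<≈⊥ q (sym (z* e)))
  ... | inj₂ (inj₂ r) = ⊥-elim (<-asym q (*pn r p))

  sgn-n-n : ∀ {x s} → s < 0# → x * s < 0# → 0# < x
  sgn-n-n {x} {s} p q with tri x
  ... | inj₂ (inj₂ r) = r
  ... | inj₂ (inj₁ e) = ⊥-elim (<≈⊥ q (z* e))
  ... | inj₁ r = ⊥-elim (<-asym q (*nn r p))

  prod-neg-split : ∀ {a b} → a * b < 0# → (0# < a × b < 0#) ⊎ (a < 0# × 0# < b)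
  prod-neg-split {a} {b} p with tri a | tri b
  ... | inj₁ x | inj₁ y = ⊥-elim (<-asym p (*nn x y))
  ... | inj₁ x | inj₂ (inj₂ y) = inj₂ (x , y)
  ... | inj₂ (inj₂ x) | inj₁ y = inj₁ (x , y)
  ... | inj₂ (inj₂ x) | inj₂ (inj₂ y) = ⊥-elim (<-asym p (*pp x y))
  ... | _ | inj₂ (inj₁ y) = ⊥-elim (<≈⊥ p (*z y))
  ... | inj₂ (inj₁ x) | _ = ⊥-elim (<≈⊥ p (z* x))

  prod-neg-≉l : ∀ {a b} → a * b < 0# → ¬ (a ≈ 0#)
  prod-neg-≉l p e = <≈⊥ p (z* e)

  prod-neg-≉r : ∀ {a b} → a * b < 0# → ¬ (b ≈ 0#)
  prod-neg-≉r p e = <≈⊥ p (*z e)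

  eq-prod-neg : ∀ {x y} → x ≈ y → x * y < 0# → ⊥
  eq-prod-neg {x} {y} e p with sq-nonneg y
  ... | inj₁ q = <-asym q (<-resp (*-congʳ e) refl p)
  ... | inj₂ q = <≈⊥ (<-resp (*-congʳ e) refl p) (sym q)

  positive-factor : ∀ {R a b} → ¬ (R ≈ 0#) → a * b < 0# → (0# < R * a) ⊎ (0# < R * b)
  positive-factor {R} {a} {b} R≉0 ab with tri R | prod-neg-split ab
  ... | inj₂ (inj₁ e) | _ = ⊥-elim (R≉0 e)
  ... | inj₂ (inj₂ R>0) | inj₁ (a>0 , _) = inj₁ (*pp R>0 a>0)
  ... | inj₂ (inj₂ R>0) | inj₂ (_ , b>0) = inj₂ (*pp R>0 b>0)
  ... | inj₁ R<0 | inj₁ (_ , b<0) = inj₂ (*nn R<0 b<0)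
  ... | inj₁ R<0 | inj₂ (a<0 , _) = inj₁ (*nn R<0 a<0)

  positive-scaled : ∀ {A X c Y} → 0# < c → X ≈ c * Y → Y ≈ A → ¬ (A ≈ 0#) → 0# < A * X
  positive-scaled {A} {X} {c} {Y} c>0 ex ey A≉0 = <-resp refl (sym eq) (*pp c>0 (sq-pos A≉0))
    where
    eq : A * X ≈ c * (A * A)
    eq = trans (*-congˡ (trans ex (*-congˡ ey))) (solve 2 (λ A c → A :* (c :* A) := c :* (A :* A)) refl A c)

  sign-transfer : ∀ {D F E W} → D * F ≈ E * W → 0# < D * E → ¬ (W ≈ 0#) → 0# < W * F
  sign-transfer {D} {F} {E} {W} e de w≉0 = cancel-p de (<-resp refl (sym eq) (sq-pos ew≉0))
    where
    eq : (D * E) * (W * F) ≈ (E * W) * (E * W)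
    eq = trans (solve 4 (λ d e w f → (d :* e) :* (w :* f) := (d :* f) :* (e :* w)) refl D E W F) (*-congʳ e)
    ew≉0 : ¬ ((E * W) ≈ 0#)
    ew≉0 x with zero-prod x
    ... | inj₂ y = w≉0 y
    ... | inj₁ y = <≈⊥ de (sym (*z y))

  three-negative-products : ∀ {x y w} → x * y < 0# → x * w < 0# → y * w < 0# → ⊥
  three-negative-products {x} {y} {w} xy<0 xw<0 yw<0 = <-asym (*nn xy<0 xw<0) (<-resp (sym eq) refl negative)
    where
    eq : (x * y) * (x * w) ≈ (x * x) * (y * w)
    eq = solve 3 (λ x y w → (x :* y) :* (x :* w) := (x :* x) :* (y :* w)) refl x y w
    negative : (x * x) * (y * w) < 0#
    negative = *pn (sq-pos (prod-neg-≉l xy<0)) yw<0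

  sign-combine : ∀ {u v w} → u * w < 0# → 0# < v * w → u * v < 0#
  sign-combine {u} {v} {w} uw<0 vw>0 = sgn-n-p (sq-pos (prod-neg-≉r uw<0)) (<-resp (sym eq) refl (*np uw<0 vw>0))
    where
    eq : (u * v) * (w * w) ≈ (u * w) * (v * w)
    eq = solve 3 (λ u v w → (u :* v) :* (w :* w) := (u :* w) :* (v :* w)) refl u v w

  sum≈0⇒≈neg : ∀ {a b c} → (a + b) + c ≈ 0# → a + b ≈ - c
  sum≈0⇒≈neg {a} {b} {c} e = trans (sym (solve 3 (λ a b c → ((a :+ b) :+ c) :- c := a :+ b) refl a b c)) (trans (+-congʳ e) (+-identityˡ (- c)))

  sum<0⇒left<0 : ∀ {x y} → x + y < 0# → 0# ≤ y → x < 0#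
  sum<0⇒left<0 {x} {y} p (inj₂ e) = <-resp (trans (+-congˡ (sym e)) (+-identityʳ x)) refl p
  sum<0⇒left<0 {x} {y} p (inj₁ y>0) with tri x
  ... | inj₁ n = n
  ... | inj₂ (inj₁ e) = ⊥-elim (<-asym p (+wp (inj₂ (sym e)) y>0))
  ... | inj₂ (inj₂ r) = ⊥-elim (<-asym p (+pp r y>0))

  sum>0⇒left>0 : ∀ {x y} → 0# < x + y → y ≤ 0# → 0# < x
  sum>0⇒left>0 {x} {y} p q with tri x
  ... | inj₂ (inj₂ r) = r
  ... | inj₁ n = ⊥-elim (<-asym p (+nw n q))
  ... | inj₂ (inj₁ e) = ⊥-elim (h q)
    where
    h : y ≤ 0# → ⊥
    h (inj₁ r) = <-asym p (<-resp (+-congʳ (sym e)) refl (<-resp (sym (+-identityˡ y)) refl r))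
    h (inj₂ e2) = <≈⊥ p (sym (trans (+-cong e e2) (+-identityʳ 0#)))

  sum0-n→p : ∀ {x y} → x + y ≈ 0# → x < 0# → 0# < y
  sum0-n→p {x} {y} e n with tri y
  ... | inj₂ (inj₂ r) = r
  ... | inj₁ r = ⊥-elim (<≈⊥ (+nn n r) e)
  ... | inj₂ (inj₁ e2) = ⊥-elim (<≈⊥ (+nw n (inj₂ e2)) e)

  sum0-p→n : ∀ {x y} → x + y ≈ 0# → 0# < y → x < 0#
  sum0-p→n {x} {y} e p with tri x
  ... | inj₁ r = r
  ... | inj₂ (inj₂ r) = ⊥-elim (<≈⊥ (+pp r p) (sym e))
  ... | inj₂ (inj₁ e2) = ⊥-elim (<≈⊥ (+wp (inj₂ (sym e2)) p) (sym e))

  sum3-sign-contra : ∀ {a b c D} → 0# < D → (a + b) + c ≈ D → a < 0# → b ≤ 0# → c ≤ 0# → ⊥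
  sum3-sign-contra {a} {b} {c} D>0 e a<0 b≤0 c≤0 = <-asym D>0 (<-resp e refl (+nw (+nw a<0 b≤0) c≤0))

  sum-le : ∀ {a b c Z y z} → 0# ≤ a → 0# ≤ b → 0# ≤ c → Z ≈ 0# → y < 0# → z < 0# → ((a * Z + b * y) + c * z) ≤ 0#
  sum-le {a} p q r e y z = +ww' (+ww' (inj₂ (*z e)) (*wn' q y)) (*wn' r z)

  sum-ge : ∀ {a b c Z y z} → 0# ≤ a → 0# ≤ b → 0# ≤ c → 0# < y → Z ≈ 0# → 0# < z → 0# ≤ ((a * y + b * Z) + c * z)
  sum-ge {a} p q r y e z = +ww (+ww (*ww p (inj₁ y)) (inj₂ (sym (*z e)))) (*ww r (inj₁ z))

  nonneg-sum≈0 : ∀ {a b} → 0# ≤ a → 0# ≤ b → a + b ≈ 0# → a ≈ 0#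
  nonneg-sum≈0 {a} {b} (inj₂ e) q s = sym e
  nonneg-sum≈0 {a} {b} (inj₁ p) q s = ⊥-elim (<≈⊥ (+pw p q) (sym s))

  nn-prod : ∀ a b → (- a) * (- b) ≈ a * b
  nn-prod = solve 2 (λ a b → (:- a) :* (:- b) := a :* b) refl

  negate-sum3 : ∀ a b c x y z → (a * (- x) + b * (- y)) + c * (- z) ≈ - ((a * x + b * y) + c * z)
  negate-sum3 = solve 6 (λ a b c x y z → (a :* (:- x) :+ b :* (:- y)) :+ c :* (:- z) := :- ((a :* x :+ b :* y) :+ c :* z)) refl

  drop-vanishing₁ : ∀ {X A B C Z k Y} → X ≈ (A * B + C * Z) - (k * Y) → Z ≈ 0# → Y ≈ 0# → X ≈ A * B
  drop-vanishing₁ {X} {A} {B} {C} {Z} {k} {Y} e z y = trans e (trans (+-cong (+-congˡ (*z z)) (-‿cong (*z y))) (solve 2 (λ a b → (a :* b :+ con (ℤ.+ 0)) :- con (ℤ.+ 0) := a :* b) refl A B))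

  drop-vanishing₂ : ∀ {X A B C Z k Y} → X ≈ (A * Z + C * B) - (k * Y) → Z ≈ 0# → Y ≈ 0# → X ≈ C * B
  drop-vanishing₂ {X} {A} {B} {C} {Z} {k} {Y} e z y = trans e (trans (+-cong (+-congʳ (*z z)) (-‿cong (*z y))) (solve 2 (λ c b → (con (ℤ.+ 0) :+ c :* b) :- con (ℤ.+ 0) := c :* b) refl C B))

  diff≈0⇒≈ : ∀ {x y} → x - y ≈ 0# → x ≈ y
  diff≈0⇒≈ {x} {y} e = trans (solve 2 (λ x y → x := (x :- y) :+ y) refl x y) (trans (+-congʳ e) (+-identityˡ y))

  diff-of-zeros : ∀ {x y} → x ≈ 0# → y ≈ 0# → x - y ≈ 0#
  diff-of-zeros e1 e2 = trans (+-cong e1 (-‿cong e2)) (trans (+-congˡ -0#≈0#) (+-identityʳ 0#))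

  affine-weights : ∀ A B s → A + s * (B - A) ≈ (1# - s) * A + s * B
  affine-weights = solve 3 (λ A B s → A :+ s :* (B :- A) := (con (ℤ.+ 1) :- s) :* A :+ s :* B) refl

  affine-zeros : ∀ {A B} t → A ≈ 0# → B ≈ 0# → A + t * (B - A) ≈ 0#
  affine-zeros {A} {B} t a b = trans (+-cong a (*-congˡ (+-cong b (-‿cong a)))) (solve 1 (λ t → con (ℤ.+ 0) :+ t :* (con (ℤ.+ 0) :- con (ℤ.+ 0)) := con (ℤ.+ 0)) refl t)

  affine-from-zero : ∀ {A B} h → A ≈ 0# → A + h * (B - A) ≈ h * B
  affine-from-zero {A} {B} h e = trans (+-cong e (*-congˡ (+-congˡ (-‿cong e)))) (solve 2 (λ h B → con (ℤ.+ 0) :+ h :* (B :- con (ℤ.+ 0)) := h :* B) refl h B)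

  affine-to-zero : ∀ {A B} h → B ≈ 0# → A + h * (B - A) ≈ (1# - h) * A
  affine-to-zero {A} {B} h e = trans (+-congˡ (*-congˡ (+-congʳ e))) (solve 2 (λ h A → A :+ h :* (con (ℤ.+ 0) :- A) := (con (ℤ.+ 1) :- h) :* A) refl h A)

  affine-root : ∀ {A B s} → 0# < s → s < 1# → A + s * (B - A) ≈ 0# → (A * B < 0#) ⊎ (A ≈ 0# × B ≈ 0#)
  affine-root {A} {B} {s} s>0 s<1 e with tri A
  ... | inj₂ (inj₂ A>0) = inj₁ (*pn A>0 (cancel-n s>0 (sum0-p→n (trans (+-comm _ _) e') (*pp α>0 A>0))))
    where
    α>0 : 0# < 1# - s
    α>0 = lt⇒diff>0 s<1
    e' : (1# - s) * A + s * B ≈ 0#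
    e' = trans (sym (affine-weights A B s)) e
  ... | inj₁ A<0 = inj₁ (*np A<0 (cancel-p s>0 (sum0-n→p e' (*pn α>0 A<0))))
    where
    α>0 : 0# < 1# - s
    α>0 = lt⇒diff>0 s<1
    e' : (1# - s) * A + s * B ≈ 0#
    e' = trans (sym (affine-weights A B s)) e
  ... | inj₂ (inj₁ A≈0) = inj₂ (A≈0 , B≈0)
    where
    sB : s * B ≈ 0#
    sB = trans (sym (+-identityˡ _)) (trans (+-congʳ (sym (*z A≈0))) (trans (sym (affine-weights A B s)) e))
    B≈0 : B ≈ 0#
    B≈0 with zero-prod sB
    ... | inj₁ s≈0 = ⊥-elim (<≈⊥ s>0 (sym s≈0))
    ... | inj₂ b = b

  fraction< : ∀ {t L} → 0# < L → t < 1# → t * L < L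
  fraction< {t} {L} L>0 t<1 = diff>0⇒lt (<-resp refl (solve 2 (λ t L → (con (ℤ.+ 1) :- t) :* L := L :- t :* L) refl t L) (*pp (lt⇒diff>0 t<1) L>0))

  -- Statements holding for every sufficiently small positive parameter;
  -- finitely many of them hold simultaneously.
  ForSmall : (Carrier → Set) → Set
  ForSmall F = Σ Carrier (λ ε → 0# < ε × (∀ e → 0# < e → e ≤ ε → F e))

  forSmall-× : ∀ {F G} → ForSmall F → ForSmall G → ForSmall (λ e → F e × G e)
  forSmall-× (ε1 , p1 , f) (ε2 , p2 , g) with cmp ε1 ε2
  ... | inj₁ lt = ε1 , p1 , λ e e>0 e≤ → f e e>0 e≤ , g e e>0 (inj₁ (≤-<-trans e≤ lt))
  ... | inj₂ (inj₁ eq) = ε1 , p1 , λ e e>0 e≤ → f e e>0 e≤ , g e e>0 (tr e≤ eq)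
    where
    tr : ∀ {x y z} → x ≤ y → y ≈ z → x ≤ z
    tr (inj₁ a) b = inj₁ (<-resp refl b a)
    tr (inj₂ a) b = inj₂ (trans a b)
  ... | inj₂ (inj₂ gt) = ε2 , p2 , λ e e>0 e≤ → f e e>0 (inj₁ (≤-<-trans e≤ gt)) , g e e>0 e≤

  forSmall-positive : ∀ {α} K → 0# < α → ForSmall (λ e → 0# < α + e * K)
  forSmall-positive {α} K α>0 with <or≥ K
  ... | inj₂ K≥0 = 1# , 0<1 , λ e e>0 _ → +pw α>0 (*pw e>0 K≥0)
  ... | inj₁ K<0 = ε , ε>0 , h
    where
    δ>0 : 0# < α - K
    δ>0 = <-resp refl (+-comm (- K) α) (+pp (neg→pos K<0) α>0)
    inv = inverse (α - K) (pos≉0 δ>0)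
    ι = proj₁ inv
    ι>0 : 0# < ι
    ι>0 = cancel-p δ>0 (<-resp refl (sym (proj₂ inv)) 0<1)
    ε = α * ι
    ε>0 : 0# < ε
    ε>0 = *pp α>0 ι>0
    base : 0# < α + ε * K
    base = cancel-p δ>0 (<-resp refl (sym eq) (*pp α>0 α>0))
      where
      eq : (α - K) * (α + ε * K) ≈ α * α
      eq = trans (solve 3 (λ a K i → (a :- K) :* (a :+ (a :* i) :* K) := a :* (a :- K) :+ (a :* K) :* ((a :- K) :* i)) refl α K ι)
           (trans (+-congˡ (*-congˡ (proj₂ inv))) (solve 2 (λ a K → a :* (a :- K) :+ (a :* K) :* con (ℤ.+ 1) := a :* a) refl α K))
    h : ∀ e → 0# < e → e ≤ ε → 0# < α + e * K
    h e e>0 (inj₂ eq) = <-resp refl (+-congˡ (*-congʳ (sym eq))) base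
    h e e>0 (inj₁ lt) = <-trans base (diff>0⇒lt (<-resp refl eq2 (*nn (lt⇒diff<0 lt) K<0)))
      where
      eq2 : (e - ε) * K ≈ (α + e * K) - (α + ε * K)
      eq2 = solve 4 (λ e ε a K → (e :- ε) :* K := (a :+ e :* K) :- (a :+ ε :* K)) refl e ε α K

  forSmall-always : ∀ {F : Carrier → Set} → (∀ e → 0# < e → F e) → ForSmall F
  forSmall-always f = 1# , 0<1 , λ e e>0 _ → f e e>0

  combination≈0⁻ : ∀ {a b l o} → l ≈ 0# → o ≈ 0# → (a * l) - (b * o) ≈ 0#
  combination≈0⁻ e1 e2 = trans (+-cong (*z e1) (-‿cong (*z e2))) (trans (+-congˡ -0#≈0#) (+-identityʳ 0#))

  combination≈0⁺ : ∀ {a b l o} → l ≈ 0# → o ≈ 0# → (a * l) + (b * o) ≈ 0#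
  combination≈0⁺ e1 e2 = trans (+-cong (*z e1) (*z e2)) (+-identityʳ 0#)

  cancel-≈0 : ∀ {a x} → 0# < a → a * x ≈ 0# → x ≈ 0#
  cancel-≈0 a>0 e with zero-prod e
  ... | inj₁ a≈0 = ⊥-elim (pos≉0 a>0 a≈0)
  ... | inj₂ x≈0 = x≈0

-- Polynomial identities satisfied by the orientation determinant, each
-- checked by the ring solver.
module OrientationIdentities (K : OrderedField) where
  import Data.Integer as ℤ
  open import Data.Product using (_×_; _,_; proj₁; proj₂)
  open OrderedFieldProperties K
  open Geometry K
  open IntegerCoefficientSolver commutativeRing using (solve; Polynomial; _:+_; _:*_; :-_; _:-_; _:=_; con)

  -- symbolic points, and the symbolic counterparts of orient, of the
  -- coordinate along a line and of the point p + t (q - p), so that the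
  -- polynomial identities below can be stated to the solver legibly
  private
    Pt : ℕ → Set
    Pt m = Polynomial m × Polynomial m

    :orient : ∀ {m} → Pt m → Pt m → Pt m → Polynomial m
    :orient (px , py) (qx , qy) (rx , ry) = ((qx :- px) :* (ry :- py)) :- ((qy :- py) :* (rx :- px))

    :along : ∀ {m} → Pt m → Pt m → Pt m → Polynomial m
    :along (cx , cy) (dx , dy) (yx , yy) = ((dx :- cx) :* (yx :- cx)) :+ ((dy :- cy) :* (yy :- cy))

    :seg : ∀ {m} → Pt m → Pt m → Polynomial m → Pt m
    :seg (px , py) (qx , qy) t = (px :+ (t :* (qx :- px))) , (py :+ (t :* (qy :- py)))

  -- coordinate of y along the directed line cd, scaled by |d - c|:
  -- the dot product (d - c)·(y - c)
  along : Point → Point → Point → Carrier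
  along (cx , cy) (dx , dy) (yx , yy) = ((dx - cx) * (yx - cx)) + ((dy - cy) * (yy - cy))

  seg : Point → Point → Carrier → Point
  seg (px , py) (qx , qy) t = (px + t * (qx - px) , py + t * (qy - py))

  orient-cyclic : ∀ p q r → orient p q r ≈ orient q r p
  orient-cyclic (px , py) (qx , qy) (rx , ry) =
    solve 6 (λ px py qx qy rx ry →
      :orient (px , py) (qx , qy) (rx , ry) := :orient (qx , qy) (rx , ry) (px , py)) refl px py qx qy rx ry

  orient-swap : ∀ p q r → orient q p r ≈ - orient p q r
  orient-swap (px , py) (qx , qy) (rx , ry) =
    solve 6 (λ px py qx qy rx ry →
      :orient (qx , qy) (px , py) (rx , ry) := :- :orient (px , py) (qx , qy) (rx , ry)) refl px py qx qy rx ry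

  orient-repeat₁₂ : ∀ p r → orient p p r ≈ 0#
  orient-repeat₁₂ (px , py) (rx , ry) =
    solve 4 (λ px py rx ry → :orient (px , py) (px , py) (rx , ry) := con (ℤ.+ 0)) refl px py rx ry

  orient-repeat₂₃ : ∀ p r → orient r p p ≈ 0#
  orient-repeat₂₃ p r = trans (orient-cyclic r p p) (orient-repeat₁₂ p r)

  orient-repeat₁₃ : ∀ p r → orient p r p ≈ 0#
  orient-repeat₁₃ p r = trans (orient-cyclic p r p) (orient-repeat₂₃ p r)

  orient-swap₂₃ : ∀ p q r → orient p r q ≈ - orient p q r
  orient-swap₂₃ p q r =
    trans (orient-cyclic p r q) (trans (orient-swap q r p) (-‿cong (sym (orient-cyclic p q r))))

  -- the triangle abc is cut by d into three triangles of the same total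
  -- signed area
  orient-area : ∀ a b c d → orient a b d + orient b c d + orient c a d ≈ orient a b c
  orient-area (ax , ay) (bx , by) (cx , cy) (dx , dy) =
    solve 8 (λ ax ay bx by cx cy dx dy →
      :orient (ax , ay) (bx , by) (dx , dy) :+ :orient (bx , by) (cx , cy) (dx , dy) :+ :orient (cx , cy) (ax , ay) (dx , dy)
        := :orient (ax , ay) (bx , by) (cx , cy)) refl ax ay bx by cx cy dx dy

  -- Cramer's rule: the side of the line pq on which v lies is the
  -- barycentric combination of the sides of a, b, c, with weights the
  -- barycentric coordinates of v in the triangle abc
  orient-cramer : ∀ a b c p q v → orient a b c * orient p q v ≈
    orient b c v * orient p q a + orient c a v * orient p q b + orient a b v * orient p q c
  orient-cramer (ax , ay) (bx , by) (cx , cy) (px , py) (qx , qy) (vx , vy) =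
    solve 12 (λ ax ay bx by cx cy px py qx qy vx vy →
      :orient (ax , ay) (bx , by) (cx , cy) :* :orient (px , py) (qx , qy) (vx , vy)
        := :orient (bx , by) (cx , cy) (vx , vy) :* :orient (px , py) (qx , qy) (ax , ay)
         :+ :orient (cx , cy) (ax , ay) (vx , vy) :* :orient (px , py) (qx , qy) (bx , by)
         :+ :orient (ax , ay) (bx , by) (vx , vy) :* :orient (px , py) (qx , qy) (cx , cy))
      refl ax ay bx by cx cy px py qx qy vx vy

  -- for r on the line uv, the linear function orient p q is interpolated
  -- between u and v with the weights given by the line st; the error term
  -- is a multiple of orient u v r
  orient-line : ∀ p q s t u v r →
    (orient p q u - orient p q v) * orient s t r ≈
      ((orient p q r - orient p q v) * orient s t u + (orient p q u - orient p q r) * orient s t v)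
      - ((((proj₁ q - proj₁ p) * (proj₂ t - proj₂ s)) - ((proj₂ q - proj₂ p) * (proj₁ t - proj₁ s))) * orient u v r)
  orient-line (px , py) (qx , qy) (sx , sy) (tx , ty) (ux , uy) (vx , vy) (rx , ry) =
    solve 14 (λ px py qx qy sx sy tx ty ux uy vx vy rx ry →
      (:orient (px , py) (qx , qy) (ux , uy) :- :orient (px , py) (qx , qy) (vx , vy)) :* :orient (sx , sy) (tx , ty) (rx , ry)
        := ((:orient (px , py) (qx , qy) (rx , ry) :- :orient (px , py) (qx , qy) (vx , vy)) :* :orient (sx , sy) (tx , ty) (ux , uy)
           :+ (:orient (px , py) (qx , qy) (ux , uy) :- :orient (px , py) (qx , qy) (rx , ry)) :* :orient (sx , sy) (tx , ty) (vx , vy))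
          :- (((qx :- px) :* (ty :- sy)) :- ((qy :- py) :* (tx :- sx))) :* :orient (ux , uy) (vx , vy) (rx , ry))
      refl px py qx qy sx sy tx ty ux uy vx vy rx ry

  along-line : ∀ c d s t u v r →
    (along c d u - along c d v) * orient s t r ≈
      ((along c d r - along c d v) * orient s t u + (along c d u - along c d r) * orient s t v)
      - ((((proj₁ d - proj₁ c) * (proj₁ t - proj₁ s)) + ((proj₂ d - proj₂ c) * (proj₂ t - proj₂ s))) * orient u v r)
  along-line (cx , cy) (dx , dy) (sx , sy) (tx , ty) (ux , uy) (vx , vy) (rx , ry) =
    solve 14 (λ cx cy dx dy sx sy tx ty ux uy vx vy rx ry →
      (:along (cx , cy) (dx , dy) (ux , uy) :- :along (cx , cy) (dx , dy) (vx , vy)) :* :orient (sx , sy) (tx , ty) (rx , ry)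
        := ((:along (cx , cy) (dx , dy) (rx , ry) :- :along (cx , cy) (dx , dy) (vx , vy)) :* :orient (sx , sy) (tx , ty) (ux , uy)
           :+ (:along (cx , cy) (dx , dy) (ux , uy) :- :along (cx , cy) (dx , dy) (rx , ry)) :* :orient (sx , sy) (tx , ty) (vx , vy))
          :- (((dx :- cx) :* (tx :- sx)) :+ ((dy :- cy) :* (ty :- sy))) :* :orient (ux , uy) (vx , vy) (rx , ry))
      refl cx cy dx dy sx sy tx ty ux uy vx vy rx ry

  orient-seg : ∀ p q x y t → orient p q (seg x y t) ≈ orient p q x + t * (orient p q y - orient p q x)
  orient-seg (px , py) (qx , qy) (xx , xy) (yx , yy) t =
    solve 9 (λ px py qx qy xx xy yx yy t →
      :orient (px , py) (qx , qy) (:seg (xx , xy) (yx , yy) t)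
        := :orient (px , py) (qx , qy) (xx , xy) :+ t :* (:orient (px , py) (qx , qy) (yx , yy) :- :orient (px , py) (qx , qy) (xx , xy)))
      refl px py qx qy xx xy yx yy t

  along-seg : ∀ c d x y t → along c d (seg x y t) ≈ along c d x + t * (along c d y - along c d x)
  along-seg (cx , cy) (dx , dy) (xx , xy) (yx , yy) t =
    solve 9 (λ cx cy dx dy xx xy yx yy t →
      :along (cx , cy) (dx , dy) (:seg (xx , xy) (yx , yy) t)
        := :along (cx , cy) (dx , dy) (xx , xy) :+ t :* (:along (cx , cy) (dx , dy) (yx , yy) :- :along (cx , cy) (dx , dy) (xx , xy)))
      refl cx cy dx dy xx xy yx yy t

  along-origin : ∀ c d → along c d c ≈ 0#
  along-origin (cx , cy) (dx , dy) =
    solve 4 (λ cx cy dx dy → :along (cx , cy) (dx , dy) (cx , cy) := con (ℤ.+ 0)) refl cx cy dx dy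

  -- a point is determined by its coordinate along cd and its side of cd:
  -- |d - c|² (u - c) = (coordinate, side) rotated back by d - c
  along-recover : ∀ c d u →
    (along c d d * (proj₁ u - proj₁ c) ≈ ((proj₁ d - proj₁ c) * along c d u) - ((proj₂ d - proj₂ c) * orient c d u))
    × (along c d d * (proj₂ u - proj₂ c) ≈ (proj₂ d - proj₂ c) * along c d u + (proj₁ d - proj₁ c) * orient c d u)
  along-recover (cx , cy) (dx , dy) (ux , uy) =
      solve 6 (λ cx cy dx dy ux uy →
        :along (cx , cy) (dx , dy) (dx , dy) :* (ux :- cx)
          := (dx :- cx) :* :along (cx , cy) (dx , dy) (ux , uy) :- (dy :- cy) :* :orient (cx , cy) (dx , dy) (ux , uy))
        refl cx cy dx dy ux uy
    , solve 6 (λ cx cy dx dy ux uy →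
        :along (cx , cy) (dx , dy) (dx , dy) :* (uy :- cy)
          := (dy :- cy) :* :along (cx , cy) (dx , dy) (ux , uy) :+ (dx :- cx) :* :orient (cx , cy) (dx , dy) (ux , uy))
        refl cx cy dx dy ux uy

  along-recover′ : ∀ c d u →
    (along c d d * (proj₁ u - proj₁ d) ≈ ((proj₁ d - proj₁ c) * (along c d u - along c d d)) - ((proj₂ d - proj₂ c) * orient c d u))
    × (along c d d * (proj₂ u - proj₂ d) ≈ (proj₂ d - proj₂ c) * (along c d u - along c d d) + (proj₁ d - proj₁ c) * orient c d u)
  along-recover′ (cx , cy) (dx , dy) (ux , uy) =
      solve 6 (λ cx cy dx dy ux uy →
        :along (cx , cy) (dx , dy) (dx , dy) :* (ux :- dx)
          := (dx :- cx) :* (:along (cx , cy) (dx , dy) (ux , uy) :- :along (cx , cy) (dx , dy) (dx , dy)) :- (dy :- cy) :* :orient (cx , cy) (dx , dy) (ux , uy))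
        refl cx cy dx dy ux uy
    , solve 6 (λ cx cy dx dy ux uy →
        :along (cx , cy) (dx , dy) (dx , dy) :* (uy :- dy)
          := (dy :- cy) :* (:along (cx , cy) (dx , dy) (ux , uy) :- :along (cx , cy) (dx , dy) (dx , dy)) :+ (dx :- cx) :* :orient (cx , cy) (dx , dy) (ux , uy))
        refl cx cy dx dy ux uy

  orient-exchange : ∀ u v c d → orient u v c - orient u v d ≈ orient c d v - orient c d u
  orient-exchange (ux , uy) (vx , vy) (cx , cy) (dx , dy) =
    solve 8 (λ ux uy vx vy cx cy dx dy →
      :orient (ux , uy) (vx , vy) (cx , cy) :- :orient (ux , uy) (vx , vy) (dx , dy)
        := :orient (cx , cy) (dx , dy) (vx , vy) :- :orient (cx , cy) (dx , dy) (ux , uy))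
      refl ux uy vx vy cx cy dx dy

  nudge : Point → Point → Point → Carrier → Point
  nudge (mx , my) (ax , ay) (bx , by) e = (mx + e * (ax - mx) + e * (bx - mx) , my + e * (ay - my) + e * (by - my))

  orient-nudge : ∀ p q m a b e → orient p q (nudge m a b e) ≈
    (orient p q m + e * (orient p q a - orient p q m)) + e * (orient p q b - orient p q m)
  orient-nudge (px , py) (qx , qy) (mx , my) (ax , ay) (bx , by) e =
    solve 11 (λ px py qx qy mx my ax ay bx by e →
      :orient (px , py) (qx , qy) ((mx :+ e :* (ax :- mx) :+ e :* (bx :- mx)) , (my :+ e :* (ay :- my) :+ e :* (by :- my)))
        := (:orient (px , py) (qx , qy) (mx , my) :+ e :* (:orient (px , py) (qx , qy) (ax , ay) :- :orient (px , py) (qx , qy) (mx , my)))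
           :+ e :* (:orient (px , py) (qx , qy) (bx , by) :- :orient (px , py) (qx , qy) (mx , my)))
      refl px py qx qy mx my ax ay bx by e

  orient-cong : ∀ {p q r r'} → r ≈ₚ r' → orient p q r ≈ orient p q r'
  orient-cong (e1 , e2) = +-cong (*-congˡ (+-congʳ e2)) (-‿cong (*-congˡ (+-congʳ e1)))

  along-cong : ∀ {c d r r'} → r ≈ₚ r' → along c d r ≈ along c d r'
  along-cong (e1 , e2) = +-cong (*-congˡ (+-congʳ e1)) (*-congˡ (+-congʳ e2))

-- Triangles, proper crossings and convex quadrilaterals in the plane K²,
-- described by signs of orientations.
module PlaneGeometry (K : OrderedField) where
  import Data.Integer as ℤ
  open import Data.Product using (_×_; _,_; proj₁; proj₂; Σ)
  open import Data.Sum using (_⊎_; inj₁; inj₂)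
  open import Data.Empty using (⊥; ⊥-elim)
  open import Relation.Nullary using (¬_)
  open OrderedFieldProperties K
  open Geometry K
  open OrientationIdentities K
  open IntegerCoefficientSolver commutativeRing using (solve; _:+_; _:*_; :-_; _:-_; _:=_; con)

  -- ℓ is affine on u, v, r up to a multiple of orient u v r; this is the
  -- identity that lets the side of r be interpolated from those of u, v
  AffineOn : (Point → Carrier) → Point → Point → Point → Set
  AffineOn ℓ u v r = ∀ s t → Σ Carrier (λ k →
    (ℓ u - ℓ v) * orient s t r ≈ ((ℓ r - ℓ v) * orient s t u + (ℓ u - ℓ r) * orient s t v) - (k * orient u v r))

  orient-affine : ∀ p q u v r → AffineOn (orient p q) u v r
  orient-affine p q u v r s t = _ , orient-line p q s t u v r

  along-affine : ∀ c d u v r → AffineOn (along c d) u v r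
  along-affine c d u v r s t = _ , along-line c d s t u v r

  ProperCrossₚ : Point → Point → Point → Point → Set
  ProperCrossₚ x y s t = (orient x y s * orient x y t < 0#) × (orient s t x * orient s t y < 0#)

  ConvexCCWₚ : Point → Point → Point → Point → Set
  ConvexCCWₚ a c b d = (0# < orient a c b) × (0# < orient c b d) × (0# < orient b d a) × (0# < orient d a c)

  closedTriangle-from-signs : ∀ {x p q r} → ¬ (orient p q r ≈ 0#) →
    0# ≤ (orient p q r * orient p q x) → 0# ≤ (orient p q r * orient q r x) → 0# ≤ (orient p q r * orient r p x) →
    InClosedTriangle x p q r
  closedTriangle-from-signs {x} {p} {q} {r} nz a b c with tri (orient p q r)
  ... | inj₂ (inj₁ e) = ⊥-elim (nz e)
  ... | inj₂ (inj₂ D>0) = inj₁ (cancel-w D>0 a , cancel-w D>0 b , cancel-w D>0 c)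
  ... | inj₁ D<0 = inj₂ (cancel-neg-nonneg D<0 a , cancel-neg-nonneg D<0 b , cancel-neg-nonneg D<0 c)

  openTriangle-from-signs : ∀ {x p q r} → ¬ (orient p q r ≈ 0#) →
    0# < orient p q r * orient p q x → 0# < orient p q r * orient q r x → 0# < orient p q r * orient r p x →
    InOpenTriangle x p q r
  openTriangle-from-signs {x} {p} {q} {r} nz a b c with tri (orient p q r)
  ... | inj₂ (inj₁ e) = ⊥-elim (nz e)
  ... | inj₂ (inj₂ D>0) = inj₁ (cancel-p D>0 a , cancel-p D>0 b , cancel-p D>0 c)
  ... | inj₁ D<0 = inj₂ (sgn-p-n D<0 (<-resp refl (*-comm _ _) a) , sgn-p-n D<0 (<-resp refl (*-comm _ _) b) , sgn-p-n D<0 (<-resp refl (*-comm _ _) c))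

  -- conversely the sub-triangles of a point of a closed triangle carry its
  -- orientation (they sum to it)
  closedTriangle-signs : ∀ {x p q r} → InClosedTriangle x p q r → ¬ (orient p q r ≈ 0#) →
    (0# ≤ (orient p q r * orient p q x)) × (0# ≤ (orient p q r * orient q r x)) × (0# ≤ (orient p q r * orient r p x))
  closedTriangle-signs {x} {p} {q} {r} (inj₁ (a , b , c)) nz with tri (orient p q r)
  ... | inj₂ (inj₁ e) = ⊥-elim (nz e)
  ... | inj₂ (inj₂ D>0) = *pw D>0 a , *pw D>0 b , *pw D>0 c
  ... | inj₁ D<0 = ⊥-elim (h (+ww (+ww a b) c))
    where
    h : 0# ≤ ((orient p q x + orient q r x) + orient r p x) → ⊥
    h (inj₁ s) = <-asym D<0 (<-resp refl (orient-area p q r x) s)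
    h (inj₂ e) = <≈⊥ D<0 (trans (sym (orient-area p q r x)) (sym e))
  closedTriangle-signs {x} {p} {q} {r} (inj₂ (a , b , c)) nz with tri (orient p q r)
  ... | inj₂ (inj₁ e) = ⊥-elim (nz e)
  ... | inj₁ D<0 = *nw D<0 a , *nw D<0 b , *nw D<0 c
  ... | inj₂ (inj₂ D>0) = ⊥-elim (h (+ww' (+ww' a b) c))
    where
    h : ((orient p q x + orient q r x) + orient r p x) ≤ 0# → ⊥
    h (inj₁ s) = <-asym D>0 (<-resp (orient-area p q r x) refl s)
    h (inj₂ e) = <≈⊥ D>0 (sym (trans (sym (orient-area p q r x)) e))

  closedTriangle-swap : ∀ {x p q r} → InClosedTriangle x p q r → InClosedTriangle x q p r
  closedTriangle-swap {x} {p} {q} {r} (inj₁ (a , b , c)) = inj₂ (≈neg-nonpos a (orient-swap p q x) , ≈neg-nonpos c (orient-swap r p x) , ≈neg-nonpos b (orient-swap q r x))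
  closedTriangle-swap {x} {p} {q} {r} (inj₂ (a , b , c)) = inj₁ (≈neg-nonneg a (orient-swap p q x) , ≈neg-nonneg c (orient-swap r p x) , ≈neg-nonneg b (orient-swap q r x))

  closedTriangle-rotate : ∀ {x p q r} → InClosedTriangle x p q r → InClosedTriangle x q r p
  closedTriangle-rotate (inj₁ (a , b , c)) = inj₁ (b , c , a)
  closedTriangle-rotate (inj₂ (a , b , c)) = inj₂ (b , c , a)

  properCross-swapˡ : ∀ {x y s t} → ProperCrossₚ x y s t → ProperCrossₚ y x s t
  properCross-swapˡ {x} {y} {s} {t} (p1 , p2) = <-resp (trans (sym (nn-prod _ _)) (sym (*-cong (orient-swap x y s) (orient-swap x y t)))) refl p1 , <-resp (*-comm _ _) refl p2

  properCross-sym : ∀ {x y s t} → ProperCrossₚ x y s t → ProperCrossₚ s t x y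
  properCross-sym (p1 , p2) = p2 , p1

  properCross-swapʳ : ∀ {x y s t} → ProperCrossₚ x y s t → ProperCrossₚ x y t s
  properCross-swapʳ p = properCross-sym (properCross-swapˡ (properCross-sym p))

  convexCCW-rotate : ∀ {a c b d} → ConvexCCWₚ a c b d → ConvexCCWₚ b d a c
  convexCCW-rotate (acb , cbd , bda , dac) = bda , dac , acb , cbd

  between⇒inTriangle : ∀ (ℓ : Point → Carrier) (u v w r : Point) →
    AffineOn ℓ u v r →
    orient u v r ≈ 0# → StrictlyBetween (ℓ u) (ℓ r) (ℓ v) → ¬ (orient u v w ≈ 0#) →
    InClosedTriangle r u v w
  between⇒inTriangle ℓ u v w r li ovr ord W≉0 = closedTriangle-from-signs W≉0 (inj₂ (sym (*z ovr))) (inj₁ (sign-transfer e2 (DE2 ord) W≉0)) (inj₁ (sign-transfer e3 (DE3 ord) W≉0))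
    where
    e2 : (ℓ u - ℓ v) * orient v w r ≈ (ℓ r - ℓ v) * orient u v w
    e2 = trans (drop-vanishing₁ (proj₂ (li v w)) (orient-repeat₁₃ v w) ovr) (*-congˡ (sym (orient-cyclic u v w)))
    e3 : (ℓ u - ℓ v) * orient w u r ≈ (ℓ u - ℓ r) * orient u v w
    e3 = trans (drop-vanishing₂ (proj₂ (li w u)) (orient-repeat₂₃ u w) ovr) (*-congˡ (sym (trans (orient-cyclic u v w) (orient-cyclic v w u))))
    DE2 : StrictlyBetween (ℓ u) (ℓ r) (ℓ v) → 0# < (ℓ u - ℓ v) * (ℓ r - ℓ v)
    DE2 (inj₁ (a , b)) = *nn (lt⇒diff<0 (<-trans a b)) (lt⇒diff<0 b)
    DE2 (inj₂ (a , b)) = *pp (lt⇒diff>0 (<-trans a b)) (lt⇒diff>0 a)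
    DE3 : StrictlyBetween (ℓ u) (ℓ r) (ℓ v) → 0# < (ℓ u - ℓ v) * (ℓ u - ℓ r)
    DE3 (inj₁ (a , b)) = *nn (lt⇒diff<0 (<-trans a b)) (lt⇒diff<0 a)
    DE3 (inj₂ (a , b)) = *pp (lt⇒diff>0 (<-trans a b)) (lt⇒diff>0 b)

  ExitSigns : (D bup buq bur bvp bvq sr : Carrier) → Set
  ExitSigns D bup buq bur bvp bvq sr =
    (sr < 0# × buq * bvq < 0#) ⊎ (0# < sr × bup * bvp < 0#) ⊎ (sr ≈ 0# × D < bur) ⊎ (0# ≤ bup × 0# ≤ buq)

  -- r strictly on the side of u: v must see q positively, and then either
  -- u sees q negatively, or u lies on the inner sides of pr and qr
  exit-signs-neg : ∀ {D bup buq bur bvp bvq bvr sp sq sr} → 0# < D → (bvr + bvp) + bvq ≈ D →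
    0# < bur → bvr < 0# → 0# < sp → sq < 0# →
    (bup * sp + buq * sq) + bur * sr ≈ 0# → (bvp * sp + bvq * sq) + bvr * sr ≈ 0# →
    sr < 0# → ExitSigns D bup buq bur bvp bvq sr
  exit-signs-neg {D} {bup} {buq} {bur} {bvp} {bvq} {bvr} {sp} {sq} {sr} D>0 av bur>0 bvr<0 sp>0 sq<0 xu xv sr<0
    with <or≥ buq
  ... | inj₁ buq<0 = inj₁ (sr<0 , *np buq<0 bvq>0)
    where
    v-sum : bvp * sp + bvq * sq < 0#
    v-sum = <-resp (sym (sum≈0⇒≈neg xv)) refl (pos→neg (*nn bvr<0 sr<0))
    bvq>0 : 0# < bvq
    bvq>0 with ≤or> bvq
    ... | inj₂ r = r
    ... | inj₁ bvq≤0 = ⊥-elim (sum3-sign-contra D>0 av bvr<0 (inj₁ bvp<0) bvq≤0)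
      where
      bvp<0 : bvp < 0#
      bvp<0 = sgn-n-p sp>0 (sum<0⇒left<0 v-sum (*wn bvq≤0 sq<0))
  ... | inj₂ buq≥0 = inj₂ (inj₂ (inj₂ (inj₁ bup>0 , buq≥0)))
    where
    u-sum : 0# < bup * sp + buq * sq
    u-sum = <-resp refl (sym (sum≈0⇒≈neg xu)) (neg→pos (*pn bur>0 sr<0))
    bup>0 : 0# < bup
    bup>0 = sgn-p-p sp>0 (sum>0⇒left>0 u-sum (≤-resp' (*-comm sq buq) (*nw' sq<0 buq≥0)))

  exit-signs-pos : ∀ {D bup buq bur bvp bvq bvr sp sq sr} → 0# < D → (bvr + bvp) + bvq ≈ D →
    0# < bur → bvr < 0# → 0# < sp → sq < 0# →
    (bup * sp + buq * sq) + bur * sr ≈ 0# → (bvp * sp + bvq * sq) + bvr * sr ≈ 0# →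
    0# < sr → ExitSigns D bup buq bur bvp bvq sr
  exit-signs-pos {D} {bup} {buq} {bur} {bvp} {bvq} {bvr} {sp} {sq} {sr} D>0 av bur>0 bvr<0 sp>0 sq<0 xu xv sr>0
    with <or≥ bup
  ... | inj₁ bup<0 = inj₂ (inj₁ (sr>0 , *np bup<0 bvp>0))
    where
    v-sum : 0# < bvp * sp + bvq * sq
    v-sum = <-resp refl (sym (sum≈0⇒≈neg xv)) (neg→pos (*np bvr<0 sr>0))
    bvp>0 : 0# < bvp
    bvp>0 with ≤or> bvp
    ... | inj₂ r = r
    ... | inj₁ bvp≤0 = ⊥-elim (sum3-sign-contra D>0 av bvr<0 bvp≤0 (inj₁ bvq<0))
      where
      bvq<0 : bvq < 0#
      bvq<0 = sgn-p-n sq<0 (sum>0⇒left>0 (<-resp refl (+-comm _ _) v-sum) (≤-resp' (*-comm sp bvp) (*pw' sp>0 bvp≤0)))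
  ... | inj₂ bup≥0 = inj₂ (inj₂ (inj₂ (bup≥0 , inj₁ buq>0)))
    where
    u-sum : bup * sp + buq * sq < 0#
    u-sum = <-resp (sym (sum≈0⇒≈neg xu)) refl (pos→neg (*pp bur>0 sr>0))
    buq>0 : 0# < buq
    buq>0 = sgn-n-n sq<0 (sum<0⇒left<0 (<-resp (+-comm _ _) refl u-sum) (≤-resp (*-comm sp bup) (*pw sp>0 bup≥0)))

  exit-signs-zero : ∀ {D bup buq bur sp sq sr} → (bur + bup) + buq ≈ D → 0# < sp → sq < 0# →
    (bup * sp + buq * sq) + bur * sr ≈ 0# → sr ≈ 0# → ∀ {bvp bvq} → ExitSigns D bup buq bur bvp bvq sr
  exit-signs-zero {D} {bup} {buq} {bur} {sp} {sq} {sr} au sp>0 sq<0 xu sr≈0 with cmp D bur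
  ... | inj₁ D<bur = inj₂ (inj₂ (inj₁ (sr≈0 , D<bur)))
  ... | inj₂ bur≤D = inj₂ (inj₂ (inj₂ (bup≥0 , buq≥0)))
    where
    u0 : bup * sp + buq * sq ≈ 0#
    u0 = trans (sum≈0⇒≈neg xu) (trans (-‿cong (*z sr≈0)) -0#≈0#)
    D-bur≥0 : D ≈ bur ⊎ bur < D → 0# ≤ (D + - bur)
    D-bur≥0 (inj₁ e) = inj₂ (sym (trans (+-congʳ e) (-‿inverseʳ bur)))
    D-bur≥0 (inj₂ r) = inj₁ (lt⇒diff>0 r)
    sum≥0 : 0# ≤ (bup + buq)
    sum≥0 = ≤-resp (sym (trans (solve 3 (λ a b c → a :+ b := ((c :+ a) :+ b) :- c) refl bup buq bur) (+-congʳ au))) (D-bur≥0 bur≤D)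
    contra : bup + buq < 0# → ⊥
    contra r with sum≥0
    ... | inj₁ q = <-asym r q
    ... | inj₂ e = <≈⊥ r (sym e)
    bup≥0 : 0# ≤ bup
    bup≥0 with <or≥ bup
    ... | inj₂ r = r
    ... | inj₁ bup<0 = ⊥-elim (contra (+nn bup<0 (sgn-p-n sq<0 (sum0-n→p u0 (*np bup<0 sp>0)))))
    buq≥0 : 0# ≤ buq
    buq≥0 with <or≥ buq
    ... | inj₂ r = r
    ... | inj₁ buq<0 = ⊥-elim (contra (+nn (sgn-n-p sp>0 (sum0-p→n u0 (*nn buq<0 sq<0))) buq<0))

  -- the sign bookkeeping behind segment-exits-triangle: bu, bv are the
  -- barycentric coordinates (times D) of u, v in a triangle pqr and s the
  -- sides of p, q, r of the line uv
  exit-signs : ∀ {D bup buq bur bvp bvq bvr sp sq sr} → 0# < D →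
    (bur + bup) + buq ≈ D → (bvr + bvp) + bvq ≈ D →
    0# < bur → bvr < 0# → 0# < sp → sq < 0# →
    (bup * sp + buq * sq) + bur * sr ≈ 0# →
    (bvp * sp + bvq * sq) + bvr * sr ≈ 0# →
    ExitSigns D bup buq bur bvp bvq sr
  exit-signs {sr = sr} D>0 au av bur>0 bvr<0 sp>0 sq<0 xu xv with tri sr
  ... | inj₁ sr<0        = exit-signs-neg D>0 av bur>0 bvr<0 sp>0 sq<0 xu xv sr<0
  ... | inj₂ (inj₂ sr>0) = exit-signs-pos D>0 av bur>0 bvr<0 sp>0 sq<0 xu xv sr>0
  ... | inj₂ (inj₁ sr≈0) = exit-signs-zero au sp>0 sq<0 xu sr≈0

  segment-exits-triangle : ∀ p q r u v → 0# < orient p q r → 0# < orient p q u → orient p q v < 0# → orient u v p * orient u v q < 0# →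
    ProperCrossₚ u v p r ⊎ ProperCrossₚ u v q r ⊎ (orient u v r ≈ 0# × orient p q r < orient p q u) ⊎ InClosedTriangle u p q r
  segment-exits-triangle p q r u v D>0 bur>0 bvr<0 σpq with prod-neg-split σpq
  ... | inj₁ (sp>0 , sq<0) = map1 (exit-signs D>0 au av bur>0 bvr<0 sp>0 sq<0 xu xv)
    where
    xu = trans (sym (orient-cramer p q r u v u)) (*z (orient-repeat₁₃ u v))
    xv = trans (sym (orient-cramer p q r u v v)) (*z (orient-repeat₂₃ v u))
    au = orient-area p q r u
    av = orient-area p q r v
    map1 : _ → _
    map1 (inj₁ (sr<0 , h)) = inj₁ (*pn sp>0 sr<0 , <-resp (trans (sym (nn-prod _ _)) (sym (*-cong (orient-swap r p u) (orient-swap r p v)))) refl h)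
    map1 (inj₂ (inj₁ (sr>0 , h))) = inj₂ (inj₁ (*np sq<0 sr>0 , h))
    map1 (inj₂ (inj₂ (inj₁ (e , lt)))) = inj₂ (inj₂ (inj₁ (e , lt)))
    map1 (inj₂ (inj₂ (inj₂ (a , b)))) = inj₂ (inj₂ (inj₂ (inj₁ (inj₁ bur>0 , a , b))))
  ... | inj₂ (sp<0 , sq>0) = map2 (exit-signs D>0 au av bur>0 bvr<0 (neg→pos sp<0) (pos→neg sq>0) xu xv)
    where
    xu = trans (negate-sum3 _ _ _ _ _ _) (trans (-‿cong (trans (sym (orient-cramer p q r u v u)) (*z (orient-repeat₁₃ u v)))) -0#≈0#)
    xv = trans (negate-sum3 _ _ _ _ _ _) (trans (-‿cong (trans (sym (orient-cramer p q r u v v)) (*z (orient-repeat₂₃ v u)))) -0#≈0#)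
    au = orient-area p q r u
    av = orient-area p q r v
    map2 : _ → _
    map2 (inj₁ (sr' , h)) = inj₁ (*np sp<0 (negneg→pos sr') , <-resp (trans (sym (nn-prod _ _)) (sym (*-cong (orient-swap r p u) (orient-swap r p v)))) refl h)
    map2 (inj₂ (inj₁ (sr' , h))) = inj₂ (inj₁ (*pn sq>0 (negpos→neg sr') , h))
    map2 (inj₂ (inj₂ (inj₁ (e , lt)))) = inj₂ (inj₂ (inj₁ (trans (sym (-‿involutive _)) (trans (-‿cong e) -0#≈0#) , lt)))
    map2 (inj₂ (inj₂ (inj₂ (a , b)))) = inj₂ (inj₂ (inj₂ (inj₁ (inj₁ bur>0 , a , b))))

  quad-covered-by-diagonal : ∀ {a c b d v} → ConvexCCWₚ a c b d → InClosedTriangle v c d a → InClosedTriangle v a b c ⊎ InClosedTriangle v a b d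
  quad-covered-by-diagonal {a} {c} {b} {d} {v} (acb , cbd , bda , dac) ict = result
    where
    D>0 : 0# < orient c d a
    D>0 = <-resp refl (sym (orient-cyclic c d a)) dac
    sg = closedTriangle-signs ict (pos≉0 D>0)
    s1 = cancel-w D>0 (proj₁ sg)
    s2 = cancel-w D>0 (proj₁ (proj₂ sg))
    s3 = cancel-w D>0 (proj₂ (proj₂ sg))
    bcv≤0 : orient b c v ≤ 0#
    bcv≤0 = cancel-nonpos D>0 (≤-resp' (sym (orient-cramer c d a b c v)) (sum-le s2 s3 s1 (orient-repeat₂₃ c b) (<-resp (sym (orient-swap c b d)) refl (pos→neg cbd)) (<-resp (trans (sym (orient-swap₂₃ a c b)) (orient-cyclic a b c)) refl (pos→neg acb))))
    bdv≥0 : 0# ≤ orient b d v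
    bdv≥0 = cancel-w D>0 (≤-resp (sym (orient-cramer c d a b d v)) (sum-ge s2 s3 s1 (<-resp refl (orient-cyclic c b d) cbd) (orient-repeat₂₃ d b) bda))
    result : InClosedTriangle v a b c ⊎ InClosedTriangle v a b d
    result with ≤or> (orient a b v)
    ... | inj₁ abv≤0 = inj₁ (inj₂ (abv≤0 , bcv≤0 , ≈neg-nonpos s3 (orient-swap a c v)))
    ... | inj₂ abv>0 = inj₂ (inj₁ (inj₁ abv>0 , bdv≥0 , s2))

  opposite-vertex-outside : ∀ {a c b d} → ConvexCCWₚ a c b d → InClosedTriangle b c d a → ⊥
  opposite-vertex-outside {a} {c} {b} {d} (acb , cbd , bda , dac) ict = h (cancel-w D>0 (proj₁ (closedTriangle-signs ict (pos≉0 D>0))))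
    where
    D>0 : 0# < orient c d a
    D>0 = <-resp refl (sym (orient-cyclic c d a)) dac
    cdb<0 : orient c d b < 0#
    cdb<0 = <-resp (sym (orient-swap₂₃ c b d)) refl (pos→neg cbd)
    h : 0# ≤ orient c d b → ⊥
    h (inj₁ x) = <-asym x cdb<0
    h (inj₂ e) = <≈⊥ cdb<0 (sym e)

  crossing-point : ∀ {p q s t} → orient s t p * orient s t q < 0# →
    Σ Carrier λ κ → 0# < κ × 0# < 1# - κ × orient s t (seg p q κ) ≈ 0#
  crossing-point {p} {q} {s} {t} σpq = κ , κ>0 , 1-κ>0 , on-st
    where
    σp = orient s t p
    σq = orient s t q
    δ = σp - σq
    δ≉0 : ¬ (δ ≈ 0#)
    δ≉0 e = eq-prod-neg (diff≈0⇒≈ e) σpq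
    inv = inverse δ δ≉0
    ι = proj₁ inv
    κ = σp * ι
    κδ : κ * δ ≈ σp
    κδ = trans (solve 3 (λ a i d → (a :* i) :* d := a :* (d :* i)) refl σp ι δ) (trans (*-congˡ (proj₂ inv)) (*-identityʳ σp))
    δ²>0 : 0# < δ * δ
    δ²>0 = sq-pos δ≉0
    κ>0 : 0# < κ
    κ>0 = cancel-p δ²>0 (<-resp refl eq (+pp (sq-pos (prod-neg-≉l σpq)) (neg→pos σpq)))
      where
      eq : σp * σp + - (σp * σq) ≈ (δ * δ) * κ
      eq = trans (solve 2 (λ a b → a :* a :+ :- (a :* b) := a :* (a :- b)) refl σp σq) (trans (*-congʳ (sym κδ)) (solve 2 (λ l d → (l :* d) :* d := (d :* d) :* l) refl κ δ))
    1-κ>0 : 0# < 1# - κ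
    1-κ>0 = cancel-p δ²>0 (<-resp refl eq (+pp (sq-pos (prod-neg-≉r σpq)) (neg→pos σpq)))
      where
      eq : σq * σq + - (σp * σq) ≈ (δ * δ) * (1# - κ)
      eq = trans (solve 2 (λ a b → b :* b :+ :- (a :* b) := (a :- b) :* (a :- b) :- a :* (a :- b)) refl σp σq)
           (trans (+-congˡ (-‿cong (*-congʳ (sym κδ)))) (solve 2 (λ l d → d :* d :- (l :* d) :* d := (d :* d) :* (con (ℤ.+ 1) :- l)) refl κ δ))
    on-st : orient s t (seg p q κ) ≈ 0#
    on-st = trans (orient-seg s t p q κ) (trans (solve 3 (λ a b l → a :+ l :* (b :- a) := a :- l :* (a :- b)) refl σp σq κ) (trans (+-congˡ (-‿cong κδ)) (-‿inverseʳ σp)))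

  along-self>0 : ∀ {p q} → ¬ (p ≈ₚ q) → 0# < along p q q
  along-self>0 {p} {q} p≉q = positive (+ww (sq-nonneg gx) (sq-nonneg gy))
    where
    gx = proj₁ q - proj₁ p
    gy = proj₂ q - proj₂ p
    positive : 0# ≤ (gx * gx + gy * gy) → 0# < along p q q
    positive (inj₁ L>0) = L>0
    positive (inj₂ 0≈L) = ⊥-elim (p≉q
      ( sym (diff≈0⇒≈ (square≈0 (nonneg-sum≈0 (sq-nonneg gx) (sq-nonneg gy) (sym 0≈L))))
      , sym (diff≈0⇒≈ (square≈0 (nonneg-sum≈0 (sq-nonneg gy) (sq-nonneg gx) (trans (+-comm _ _) (sym 0≈L)))))))

  collinear-at-start : ∀ {p q r} → 0# < along p q q → orient p q r ≈ 0# → along p q r ≈ 0# → r ≈ₚ p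
  collinear-at-start {p} {q} {r} L>0 on-line at-0 =
      diff≈0⇒≈ (cancel-≈0 L>0 (trans (proj₁ (along-recover p q r)) (combination≈0⁻ at-0 on-line)))
    , diff≈0⇒≈ (cancel-≈0 L>0 (trans (proj₂ (along-recover p q r)) (combination≈0⁺ at-0 on-line)))

  collinear-at-end : ∀ {p q r} → 0# < along p q q → orient p q r ≈ 0# → along p q r ≈ along p q q → r ≈ₚ q
  collinear-at-end {p} {q} {r} L>0 on-line at-L =
      diff≈0⇒≈ (cancel-≈0 L>0 (trans (proj₁ (along-recover′ p q r)) (combination≈0⁻ at-L′ on-line)))
    , diff≈0⇒≈ (cancel-≈0 L>0 (trans (proj₂ (along-recover′ p q r)) (combination≈0⁺ at-L′ on-line)))
    where
    at-L′ : along p q r - along p q q ≈ 0#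
    at-L′ = trans (+-congʳ at-L) (-‿inverseʳ _)

-- Geometry of the point set P, indexed by Fin n: empty triangles, and how
-- edges of empty triangles can cross a flip quadrilateral.
module PointSetGeometry (K : OrderedField) {n : ℕ} (P : Fin n → Geometry.Point K) where
  open import Relation.Binary.PropositionalEquality as ≡ using (_≡_)
  import Data.Integer as ℤ
  open import Data.Product using (_×_; _,_; proj₁; proj₂)
  open import Data.Sum using (_⊎_; inj₁; inj₂)
  open import Data.Empty using (⊥; ⊥-elim)
  open import Relation.Nullary using (¬_)
  open OrderedFieldProperties K
  open Geometry K
  open OrientationIdentities K
  open PlaneGeometry K
  open PointSet P using (Distinct; SameEdge; Cross)
  open IntegerCoefficientSolver commutativeRing using (solve; _:+_; _:*_; :-_; _:-_; _:=_; con)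

  O : Fin n → Fin n → Fin n → Carrier
  O x y z = orient (P x) (P y) (P z)

  ProperCross : Fin n → Fin n → Fin n → Fin n → Set
  ProperCross x y s t = ProperCrossₚ (P x) (P y) (P s) (P t)

  ConvexCCW : Fin n → Fin n → Fin n → Fin n → Set
  ConvexCCW a c b d = ConvexCCWₚ (P a) (P c) (P b) (P d)

  Empty : Fin n → Fin n → Fin n → Set
  Empty a b c = ∀ v → InClosedTriangle (P v) (P a) (P b) (P c) → v ≡ a ⊎ v ≡ b ⊎ v ≡ c

  -- no point of P lies strictly inside a side of an empty nondegenerate
  -- triangle: it would be a point of the closed triangle other than a vertex
  empty-side : ∀ {u v w r} → Empty u v w → ¬ (O u v w ≈ 0#) → (ℓ : Point → Carrier) →
    AffineOn ℓ (P u) (P v) (P r) → O u v r ≈ 0# → StrictlyBetween (ℓ (P u)) (ℓ (P r)) (ℓ (P v)) → ⊥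
  empty-side {u} {v} {w} {r} empty nondegenerate ℓ affine on-uv between =
    not-vertex between (empty r (between⇒inTriangle ℓ (P u) (P v) (P w) (P r) affine on-uv between nondegenerate))
    where
    not-vertex : StrictlyBetween (ℓ (P u)) (ℓ (P r)) (ℓ (P v)) → r ≡ u ⊎ r ≡ v ⊎ r ≡ w → ⊥
    not-vertex (inj₁ (u<r , _)) (inj₁ ≡.refl)        = <-asym u<r u<r
    not-vertex (inj₂ (_ , r<u)) (inj₁ ≡.refl)        = <-asym r<u r<u
    not-vertex (inj₁ (_ , r<v)) (inj₂ (inj₁ ≡.refl)) = <-asym r<v r<v
    not-vertex (inj₂ (v<r , _)) (inj₂ (inj₁ ≡.refl)) = <-asym v<r v<r
    not-vertex _                (inj₂ (inj₂ ≡.refl)) = nondegenerate on-uv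

  exits-flipQuad-oriented : ∀ {a b c d u v w} → ConvexCCW a c b d → Empty a b c → Empty a b d → Empty u v w → ¬ (O u v w ≈ 0#) →
    ProperCross c d u v → 0# < O c d u →
    ProperCross u v c a ⊎ ProperCross u v d a ⊎ ProperCross u v d b ⊎ ProperCross u v c b ⊎ (u ≡ a × v ≡ b)
  exits-flipQuad-oriented {a} {b} {c} {d} {u} {v} {w} pc ea eb ew W≉0 (px1 , px2) cdu>0 = leaving-cda (segment-exits-triangle (P c) (P d) (P a) (P u) (P v) cda>0 cdu>0 cdv<0 px2)
    where
    cdv<0 : O c d v < 0#
    cdv<0 = cancel-n cdu>0 px1
    cda>0 : 0# < O c d a
    cda>0 = <-resp refl (sym (orient-cyclic (P c) (P d) (P a))) (proj₂ (proj₂ (proj₂ pc)))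
    cdb<0 : O c d b < 0#
    cdb<0 = <-resp (sym (orient-swap₂₃ (P c) (P b) (P d))) refl (pos→neg (proj₁ (proj₂ pc)))
    cdc : O c d c ≈ 0#
    cdc = orient-repeat₁₃ (P c) (P d)
    cdd : O c d d ≈ 0#
    cdd = orient-repeat₂₃ (P d) (P c)
    -- once u is a, the segment vu leaves the triangle d c b of the quadrilateral
    dcb>0 : 0# < O d c b
    dcb>0 = <-resp refl (trans (orient-cyclic (P c) (P b) (P d)) (orient-cyclic (P b) (P d) (P c))) (proj₁ (proj₂ pc))
    dcv>0 : 0# < O d c v
    dcv>0 = <-resp refl (sym (orient-swap (P c) (P d) (P v))) (neg→pos cdv<0)
    dcu<0 : O d c u < 0#
    dcu<0 = <-resp (sym (orient-swap (P c) (P d) (P u))) refl (pos→neg cdu>0)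
    σ' : O v u d * O v u c < 0#
    σ' = <-resp (trans (*-comm _ _) (trans (sym (nn-prod _ _)) (sym (*-cong (orient-swap (P u) (P v) (P d)) (orient-swap (P u) (P v) (P c)))))) refl px2
    leaving-dcb : u ≡ a → _ → ProperCross u v c a ⊎ ProperCross u v d a ⊎ ProperCross u v d b ⊎ ProperCross u v c b ⊎ (u ≡ a × v ≡ b)
    leaving-dcb ua (inj₁ x) = inj₂ (inj₂ (inj₁ (properCross-swapˡ x)))
    leaving-dcb ua (inj₂ (inj₁ x)) = inj₂ (inj₂ (inj₂ (inj₁ (properCross-swapˡ x))))
    leaving-dcb ua (inj₂ (inj₂ (inj₁ (e , lt)))) =
      ⊥-elim (empty-side ew W≉0 (orient (P d) (P c)) (orient-affine (P d) (P c) (P u) (P v) (P b)) ouvb (inj₁ (<-trans dcu<0 dcb>0 , lt)))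
      where
      ouvb : O u v b ≈ 0#
      ouvb = trans (sym (-‿involutive _)) (trans (-‿cong (trans (sym (orient-swap (P u) (P v) (P b))) e)) -0#≈0#)
    leaving-dcb ua (inj₂ (inj₂ (inj₂ ict))) with quad-covered-by-diagonal (convexCCW-rotate pc) ict
    ... | inj₁ i1 = in-abd (eb v (closedTriangle-swap i1))
      where
      in-abd : v ≡ a ⊎ v ≡ b ⊎ v ≡ d → _
      in-abd (inj₁ ≡.refl) = ⊥-elim (<-asym cdv<0 cda>0)
      in-abd (inj₂ (inj₁ vb)) = inj₂ (inj₂ (inj₂ (inj₂ (ua , vb))))
      in-abd (inj₂ (inj₂ ≡.refl)) = ⊥-elim (<≈⊥ cdv<0 cdd)
    ... | inj₂ i2 = in-abc (ea v (closedTriangle-swap i2))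
      where
      in-abc : v ≡ a ⊎ v ≡ b ⊎ v ≡ c → _
      in-abc (inj₁ ≡.refl) = ⊥-elim (<-asym cdv<0 cda>0)
      in-abc (inj₂ (inj₁ vb)) = inj₂ (inj₂ (inj₂ (inj₂ (ua , vb))))
      in-abc (inj₂ (inj₂ ≡.refl)) = ⊥-elim (<≈⊥ cdv<0 cdc)
    -- uv leaves the triangle c d a; if u lies in it, u is a vertex, and then a
    leaving-cda : _ → ProperCross u v c a ⊎ ProperCross u v d a ⊎ ProperCross u v d b ⊎ ProperCross u v c b ⊎ (u ≡ a × v ≡ b)
    leaving-cda (inj₁ x) = inj₁ x
    leaving-cda (inj₂ (inj₁ x)) = inj₂ (inj₁ x)
    leaving-cda (inj₂ (inj₂ (inj₁ (e , lt)))) =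
      ⊥-elim (empty-side ew W≉0 (orient (P c) (P d)) (orient-affine (P c) (P d) (P u) (P v) (P a)) e (inj₂ (<-trans cdv<0 cda>0 , lt)))
    leaving-cda (inj₂ (inj₂ (inj₂ ict))) with quad-covered-by-diagonal pc ict
    ... | inj₁ i1 = in-abc (ea u i1)
      where
      in-abc : u ≡ a ⊎ u ≡ b ⊎ u ≡ c → _
      in-abc (inj₁ ua) = leaving-dcb ua (segment-exits-triangle (P d) (P c) (P b) (P v) (P u) dcb>0 dcv>0 dcu<0 σ')
      in-abc (inj₂ (inj₁ ≡.refl)) = ⊥-elim (<-asym cdu>0 cdb<0)
      in-abc (inj₂ (inj₂ ≡.refl)) = ⊥-elim (<≈⊥ cdu>0 (sym cdc))
    ... | inj₂ i2 = in-abd (eb u i2)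
      where
      in-abd : u ≡ a ⊎ u ≡ b ⊎ u ≡ d → _
      in-abd (inj₁ ua) = leaving-dcb ua (segment-exits-triangle (P d) (P c) (P b) (P v) (P u) dcb>0 dcv>0 dcu<0 σ')
      in-abd (inj₂ (inj₁ ≡.refl)) = ⊥-elim (<-asym cdu>0 cdb<0)
      in-abd (inj₂ (inj₂ ≡.refl)) = ⊥-elim (<≈⊥ cdu>0 (sym cdd))

  Convex : Fin n → Fin n → Fin n → Fin n → Set
  Convex a c b d = ConvexQuadrilateral (P a) (P c) (P b) (P d)

  convex⇒ccw : ∀ {a c b d} → Convex a c b d → ConvexCCW a c b d ⊎ ConvexCCW a d b c
  convex⇒ccw (inj₁ x) = inj₁ x
  convex⇒ccw {a} {c} {b} {d} (inj₂ (acb , cbd , bda , dac)) = inj₂ (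
      <-resp refl (sym (trans (orient-cyclic (P a) (P d) (P b)) (orient-swap (P b) (P d) (P a)))) (neg→pos bda)
    , <-resp refl (sym (trans (orient-cyclic (P d) (P b) (P c)) (orient-swap (P c) (P b) (P d)))) (neg→pos cbd)
    , <-resp refl (sym (trans (orient-cyclic (P b) (P c) (P a)) (trans (orient-cyclic (P c) (P a) (P b)) (orient-swap₂₃ (P a) (P c) (P b))))) (neg→pos acb)
    , <-resp refl (sym (trans (orient-cyclic (P c) (P a) (P d)) (orient-swap (P d) (P a) (P c)))) (neg→pos dac))

  empty-swap : ∀ {a b c} → Empty a b c → Empty b a c
  empty-swap e v ict with e v (closedTriangle-swap ict)
  ... | inj₁ x = inj₂ (inj₁ x)
  ... | inj₂ (inj₁ x) = inj₁ x
  ... | inj₂ (inj₂ x) = inj₂ (inj₂ x)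

  ExitsFlipQuad : Fin n → Fin n → Fin n → Fin n → Fin n → Fin n → Set
  ExitsFlipQuad a b c d u v = ProperCross u v c a ⊎ ProperCross u v d a ⊎ ProperCross u v d b ⊎ ProperCross u v c b ⊎ (u ≡ a × v ≡ b) ⊎ (u ≡ b × v ≡ a)

  exits-flipQuad-ccw : ∀ {a b c d u v w} → ConvexCCW a c b d → Empty a b c → Empty a b d → Empty u v w → ¬ (O u v w ≈ 0#) →
    ProperCross c d u v → ExitsFlipQuad a b c d u v
  exits-flipQuad-ccw {a} {b} {c} {d} {u} {v} {w} pc ea eb ew W≉0 px with tri (O c d u)
  ... | inj₂ (inj₁ e) = ⊥-elim (<≈⊥ (proj₁ px) (z* e))
  ... | inj₂ (inj₂ cdu>0) = as-exit (exits-flipQuad-oriented pc ea eb ew W≉0 px cdu>0)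
    where
    as-exit : _ → ExitsFlipQuad a b c d u v
    as-exit (inj₁ x) = inj₁ x
    as-exit (inj₂ (inj₁ x)) = inj₂ (inj₁ x)
    as-exit (inj₂ (inj₂ (inj₁ x))) = inj₂ (inj₂ (inj₁ x))
    as-exit (inj₂ (inj₂ (inj₂ (inj₁ x)))) = inj₂ (inj₂ (inj₂ (inj₁ x)))
    as-exit (inj₂ (inj₂ (inj₂ (inj₂ x)))) = inj₂ (inj₂ (inj₂ (inj₂ (inj₁ x))))
  ... | inj₁ cdu<0 = reversed-exit (exits-flipQuad-oriented pc ea eb (empty-swap ew) W'≉0 (properCross-swapʳ px) cdv>0)
    where
    W'≉0 : ¬ (O v u w ≈ 0#)
    W'≉0 e = W≉0 (trans (sym (-‿involutive _)) (trans (-‿cong (trans (sym (orient-swap (P u) (P v) (P w))) e)) -0#≈0#))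
    cdv>0 : 0# < O c d v
    cdv>0 = sgn-n-n cdu<0 (<-resp (*-comm _ _) refl (proj₁ px))
    reversed-exit : _ → ExitsFlipQuad a b c d u v
    reversed-exit (inj₁ x) = inj₁ (properCross-swapˡ x)
    reversed-exit (inj₂ (inj₁ x)) = inj₂ (inj₁ (properCross-swapˡ x))
    reversed-exit (inj₂ (inj₂ (inj₁ x))) = inj₂ (inj₂ (inj₁ (properCross-swapˡ x)))
    reversed-exit (inj₂ (inj₂ (inj₂ (inj₁ x)))) = inj₂ (inj₂ (inj₂ (inj₁ (properCross-swapˡ x))))
    reversed-exit (inj₂ (inj₂ (inj₂ (inj₂ (x , y))))) = inj₂ (inj₂ (inj₂ (inj₂ (inj₂ (y , x)))))

  exits-flipQuad : ∀ {a b c d u v w} → Convex a c b d → Empty a b c → Empty a b d → Empty u v w → ¬ (O u v w ≈ 0#) →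
    ProperCross c d u v → ExitsFlipQuad a b c d u v
  exits-flipQuad {a} {b} {c} {d} {u} {v} {w} cv ea eb ew W≉0 px with convex⇒ccw cv
  ... | inj₁ pc = exits-flipQuad-ccw pc ea eb ew W≉0 px
  ... | inj₂ pc = m (exits-flipQuad-ccw pc eb ea ew W≉0 (properCross-swapˡ px))
    where
    m : ExitsFlipQuad a b d c u v → ExitsFlipQuad a b c d u v
    m (inj₁ x) = inj₂ (inj₁ x)
    m (inj₂ (inj₁ x)) = inj₁ x
    m (inj₂ (inj₂ (inj₁ x))) = inj₂ (inj₂ (inj₂ (inj₁ x)))
    m (inj₂ (inj₂ (inj₂ (inj₁ x)))) = inj₂ (inj₂ (inj₁ x))
    m (inj₂ (inj₂ (inj₂ (inj₂ x)))) = inj₂ (inj₂ (inj₂ (inj₂ x)))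

  record FlipQuadSigns (a b c d : Fin n) : Set where
    field
      ca : 0# < O c a d * O c a b
      da : 0# < O d a c * O d a b
      cb : 0# < O c b d * O c b a
      db : 0# < O d b c * O d b a
      pxab : ProperCross a b c d
      cda : ¬ (O c d a ≈ 0#)
      cdb : ¬ (O c d b ≈ 0#)

  flipQuad-signs-ccw : ∀ {a c b d} → ConvexCCW a c b d → FlipQuadSigns a b c d
  flipQuad-signs-ccw {a} {c} {b} {d} (acb , cbd , bda , dac) = record
    { ca = *nn cad<0 cab<0
    ; da = *pp dac dab>0
    ; cb = *pp cbd cba>0
    ; db = *nn dbc<0 dba<0
    ; pxab = *np abc<0 abd>0 , *pn cda>0 cdb<0
    ; cda = pos≉0 cda>0
    ; cdb = neg≉0 cdb<0
    }
    where
    p = P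
    cad<0 : O c a d < 0#
    cad<0 = <-resp (sym (trans (orient-cyclic (P c) (P a) (P d)) (orient-swap (P d) (P a) (P c)))) refl (pos→neg dac)
    abc<0 : O a b c < 0#
    abc<0 = <-resp (sym (orient-swap₂₃ (P a) (P c) (P b))) refl (pos→neg acb)
    cab<0 : O c a b < 0#
    cab<0 = <-resp (trans (orient-cyclic (P a) (P b) (P c)) (orient-cyclic (P b) (P c) (P a))) refl abc<0
    dab>0 : 0# < O d a b
    dab>0 = <-resp refl (orient-cyclic (P b) (P d) (P a)) bda
    cba>0 : 0# < O c b a
    cba>0 = <-resp refl (orient-cyclic (P a) (P c) (P b)) acb
    dbc<0 : O d b c < 0#
    dbc<0 = <-resp (sym (trans (orient-cyclic (P d) (P b) (P c)) (orient-swap (P c) (P b) (P d)))) refl (pos→neg cbd)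
    dba<0 : O d b a < 0#
    dba<0 = <-resp (sym (orient-swap (P b) (P d) (P a))) refl (pos→neg bda)
    abd>0 : 0# < O a b d
    abd>0 = <-resp refl (trans (orient-cyclic (P b) (P d) (P a)) (orient-cyclic (P d) (P a) (P b))) bda
    cda>0 : 0# < O c d a
    cda>0 = <-resp refl (sym (orient-cyclic (P c) (P d) (P a))) dac
    cdb<0 : O c d b < 0#
    cdb<0 = <-resp (sym (orient-swap₂₃ (P c) (P b) (P d))) refl (pos→neg cbd)

  flipQuad-signs : ∀ {a c b d} → Convex a c b d → FlipQuadSigns a b c d
  flipQuad-signs {a} {c} {b} {d} cv with convex⇒ccw cv
  ... | inj₁ pc = flipQuad-signs-ccw pc
  ... | inj₂ pc = let q = flipQuad-signs-ccw pc in record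
    { ca = FlipQuadSigns.da q
    ; da = FlipQuadSigns.ca q
    ; cb = FlipQuadSigns.db q
    ; db = FlipQuadSigns.cb q
    ; pxab = properCross-swapʳ (FlipQuadSigns.pxab q)
    ; cda = λ e → FlipQuadSigns.cda q (trans (orient-swap (P c) (P d) (P a)) (trans (-‿cong e) -0#≈0#))
    ; cdb = λ e → FlipQuadSigns.cdb q (trans (orient-swap (P c) (P d) (P b)) (trans (-‿cong e) -0#≈0#))
    }

  flip-keeps-empty-ccw : ∀ {a c b d} → ConvexCCW a c b d → Empty a b c → Empty a b d → Empty c d a × Empty c d b
  flip-keeps-empty-ccw {a} {c} {b} {d} pc ea eb = e1 , e2
    where
    e1 : Empty c d a
    e1 v ict with quad-covered-by-diagonal pc ict
    ... | inj₁ i = f (ea v i)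
      where
      f : v ≡ a ⊎ v ≡ b ⊎ v ≡ c → v ≡ c ⊎ v ≡ d ⊎ v ≡ a
      f (inj₁ x) = inj₂ (inj₂ x)
      f (inj₂ (inj₁ ≡.refl)) = ⊥-elim (opposite-vertex-outside pc ict)
      f (inj₂ (inj₂ x)) = inj₁ x
    ... | inj₂ i = f (eb v i)
      where
      f : v ≡ a ⊎ v ≡ b ⊎ v ≡ d → v ≡ c ⊎ v ≡ d ⊎ v ≡ a
      f (inj₁ x) = inj₂ (inj₂ x)
      f (inj₂ (inj₁ ≡.refl)) = ⊥-elim (opposite-vertex-outside pc ict)
      f (inj₂ (inj₂ x)) = inj₂ (inj₁ x)
    e2 : Empty c d b
    e2 v ict with quad-covered-by-diagonal (convexCCW-rotate pc) (closedTriangle-swap ict)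
    ... | inj₁ i = f (eb v (closedTriangle-swap i))
      where
      f : v ≡ a ⊎ v ≡ b ⊎ v ≡ d → v ≡ c ⊎ v ≡ d ⊎ v ≡ b
      f (inj₁ ≡.refl) = ⊥-elim (opposite-vertex-outside (convexCCW-rotate pc) (closedTriangle-swap ict))
      f (inj₂ (inj₁ x)) = inj₂ (inj₂ x)
      f (inj₂ (inj₂ x)) = inj₂ (inj₁ x)
    ... | inj₂ i = f (ea v (closedTriangle-swap i))
      where
      f : v ≡ a ⊎ v ≡ b ⊎ v ≡ c → v ≡ c ⊎ v ≡ d ⊎ v ≡ b
      f (inj₁ ≡.refl) = ⊥-elim (opposite-vertex-outside (convexCCW-rotate pc) (closedTriangle-swap ict))
      f (inj₂ (inj₁ x)) = inj₂ (inj₂ x)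
      f (inj₂ (inj₂ x)) = inj₁ x

  flip-keeps-empty : ∀ {a c b d} → Convex a c b d → Empty a b c → Empty a b d → Empty c d a × Empty c d b
  flip-keeps-empty cv ea eb with convex⇒ccw cv
  ... | inj₁ pc = flip-keeps-empty-ccw pc ea eb
  ... | inj₂ pc = let r = flip-keeps-empty-ccw pc eb ea in empty-swap (proj₁ r) , empty-swap (proj₂ r)

  -- two crossing edges of empty triangles lying on a common line coincide:
  -- along cd neither u nor v lies strictly inside cd (it would lie in the
  -- empty triangle cda) and neither c nor d strictly between u and v (the
  -- empty triangle uvw); since the segments overlap, {u, v} = {c, d}
  collinear-crossing⇒sameEdge : Distinct → ∀ {c d a u v w} → Empty c d a → ¬ (O c d a ≈ 0#) → Empty u v w → ¬ (O u v w ≈ 0#) →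
    ¬ (c ≡ d) →
    O c d u ≈ 0# → O c d v ≈ 0# → O u v c ≈ 0# → O u v d ≈ 0# →
    ∀ {s t} → 0# < s → s < 1# → 0# < t → t < 1# →
    along (P c) (P d) (P u) + s * (along (P c) (P d) (P v) - along (P c) (P d) (P u)) ≈ t * along (P c) (P d) (P d) →
    SameEdge (c , d) (u , v)
  collinear-crossing⇒sameEdge dist {c} {d} {a} {u} {v} {w} ec A≉0 ew W≉0 c≢d πu πv σc σd {s} {t} s>0 s<1 t>0 t<1 X = main
    where
    ℓ = along (P c) (P d)
    L = ℓ (P d)
    L>0 : 0# < L
    L>0 = along-self>0 (λ c≈d → c≢d (dist c d c≈d))
    ℓc : ℓ (P c) ≈ 0#
    ℓc = along-origin (P c) (P d)
    X>0 : 0# < t * L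
    X>0 = *pp t>0 L>0
    X<L : t * L < L
    X<L = fraction< L>0 t<1
    Xrw : (1# - s) * ℓ (P u) + s * ℓ (P v) ≈ t * L
    Xrw = trans (sym (affine-weights _ _ s)) X
    α>0 : 0# < 1# - s
    α>0 = lt⇒diff>0 s<1
    inside : ∀ {r} → O c d r ≈ 0# → 0# < ℓ (P r) → ℓ (P r) < L → ⊥
    inside {r} on-cd 0<ℓr ℓr<L = empty-side ec A≉0 ℓ (along-affine (P c) (P d) (P c) (P d) (P r)) on-cd (inj₁ (<-resp (sym ℓc) refl 0<ℓr , ℓr<L))
    cls : ∀ {r} → O c d r ≈ 0# → ℓ (P r) ≤ 0# ⊎ L ≤ ℓ (P r)
    cls {r} πr with ≤or> (ℓ (P r))
    ... | inj₁ x = inj₁ x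
    ... | inj₂ p with cmp (ℓ (P r)) L
    ... | inj₁ q = ⊥-elim (inside πr p q)
    ... | inj₂ (inj₁ e) = inj₂ (inj₂ (sym e))
    ... | inj₂ (inj₂ q) = inj₂ (inj₁ q)
    not-between-uv : ∀ {r} → O u v r ≈ 0# → StrictlyBetween (ℓ (P u)) (ℓ (P r)) (ℓ (P v)) → ⊥
    not-between-uv {r} on-uv = empty-side ew W≉0 ℓ (along-affine (P c) (P d) (P u) (P v) (P r)) on-uv
    is0 : ∀ {r r'} → ℓ (P r) ≤ 0# → L ≤ ℓ (P r') → (ℓ (P r) < 0# → ⊥) → ℓ (P r) ≈ 0#
    is0 (inj₁ n) _ k = ⊥-elim (k n)
    is0 (inj₂ e) _ _ = e
    isL : ∀ {r} → L ≤ ℓ (P r) → (L < ℓ (P r) → ⊥) → ℓ (P r) ≈ L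
    isL (inj₁ p) k = ⊥-elim (k p)
    isL (inj₂ e) _ = sym e
    at-c : ∀ {r} → O c d r ≈ 0# → ℓ (P r) ≈ 0# → r ≡ c
    at-c on-line at-0 = dist _ c (collinear-at-start L>0 on-line at-0)
    at-d : ∀ {r} → O c d r ≈ 0# → ℓ (P r) ≈ L → r ≡ d
    at-d on-line at-L = dist _ d (collinear-at-end L>0 on-line at-L)
    -- the crossing point t L lies strictly inside cd, so u and v cannot
    -- both lie before c, nor both beyond d
    both-before : ℓ (P u) ≤ 0# → ℓ (P v) ≤ 0# → ⊥
    both-before lu lv with +ww' (*pw' α>0 lu) (*pw' s>0 lv)
    ... | inj₁ comb<0 = <-asym (<-resp refl (sym Xrw) X>0) comb<0
    ... | inj₂ comb≈0 = <≈⊥ X>0 (sym (trans (sym Xrw) comb≈0))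
    beyond : ∀ {x} → L ≤ x → 0# ≤ (x - L)
    beyond (inj₁ p) = inj₁ (lt⇒diff>0 p)
    beyond (inj₂ e) = inj₂ (sym (trans (+-congʳ (sym e)) (-‿inverseʳ L)))
    shift : (1# - s) * (ℓ (P u) - L) + s * (ℓ (P v) - L) ≈ ((1# - s) * ℓ (P u) + s * ℓ (P v)) - L
    shift = solve 4 (λ s lu lv L → (con (ℤ.+ 1) :- s) :* (lu :- L) :+ s :* (lv :- L) := ((con (ℤ.+ 1) :- s) :* lu :+ s :* lv) :- L) refl s (ℓ (P u)) (ℓ (P v)) L
    both-beyond : L ≤ ℓ (P u) → L ≤ ℓ (P v) → ⊥
    both-beyond lu lv with lt⇒diff<0 (<-resp (sym Xrw) refl X<L) | ≤-resp shift (+ww (*pw α>0 (beyond lu)) (*pw s>0 (beyond lv)))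
    ... | below | inj₁ above = <-asym above below
    ... | below | inj₂ zero  = <≈⊥ below (sym zero)
    main : SameEdge (c , d) (u , v)
    main with cls πu | cls πv
    ... | inj₁ lu | inj₁ lv = ⊥-elim (both-before lu lv)
    ... | inj₂ lu | inj₂ lv = ⊥-elim (both-beyond lu lv)
    ... | inj₁ lu | inj₂ lv = inj₁ (≡.sym (at-c πu (is0 lu lv (λ n → not-between-uv σc (inj₁ (<-resp refl (sym ℓc) n , <-resp (sym ℓc) refl (<-≤-trans L>0 lv))))))   , ≡.sym (at-d πv (isL lv (λ p → not-between-uv σd (inj₁ (≤-<-trans lu L>0 , p))))))
    ... | inj₂ lu | inj₁ lv = inj₂ (≡.sym (at-c πv (is0 lv lu (λ n → not-between-uv σc (inj₂ (<-resp refl (sym ℓc) n , <-resp (sym ℓc) refl (<-≤-trans L>0 lu)))))) , ≡.sym (at-d πu (isL lu (λ p → not-between-uv σd (inj₂ (≤-<-trans lv L>0 , p))))))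

  -- Crossing edges of empty nondegenerate triangles of P either cross
  -- properly or are equal: a common interior point forces strict opposite
  -- sides unless all four points are collinear.
  crossing⇒proper-or-same : Distinct → ∀ {c d a u v w} → Empty c d a → ¬ (O c d a ≈ 0#) → Empty u v w → ¬ (O u v w ≈ 0#) →
    Cross (c , d) (u , v) → ProperCross c d u v ⊎ SameEdge (c , d) (u , v)
  crossing⇒proper-or-same dist {c} {d} {a} {u} {v} {w} ec A≉0 ew W≉0 (x , (t , t>0 , t<1 , ex) , (s , s>0 , s<1 , ex')) = fin (affine-root s>0 s<1 E1) (affine-root t>0 t<1 E2)
    where
    symₚ : ∀ {p q} → p ≈ₚ q → q ≈ₚ p
    symₚ (e1 , e2) = sym e1 , sym e2
    E1 : O c d u + s * (O c d v - O c d u) ≈ 0#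
    E1 = trans (sym (orient-seg (P c) (P d) (P u) (P v) s)) (trans (orient-cong ex') (trans (orient-cong (symₚ ex)) (trans (orient-seg (P c) (P d) (P c) (P d) t) (affine-zeros t (orient-repeat₁₃ (P c) (P d)) (orient-repeat₂₃ (P d) (P c))))))
    E2 : O u v c + t * (O u v d - O u v c) ≈ 0#
    E2 = trans (sym (orient-seg (P u) (P v) (P c) (P d) t)) (trans (orient-cong ex) (trans (orient-cong (symₚ ex')) (trans (orient-seg (P u) (P v) (P u) (P v) s) (affine-zeros s (orient-repeat₁₃ (P u) (P v)) (orient-repeat₂₃ (P v) (P u))))))
    c≢d : ¬ (c ≡ d)
    c≢d ≡.refl = A≉0 (orient-repeat₁₂ (P c) (P a))
    ℓ = along (P c) (P d)
    E3 : ℓ (P u) + s * (ℓ (P v) - ℓ (P u)) ≈ t * ℓ (P d)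
    E3 = trans (sym (along-seg (P c) (P d) (P u) (P v) s)) (trans (along-cong ex') (trans (along-cong (symₚ ex)) (trans (along-seg (P c) (P d) (P c) (P d) t) (trans (+-cong (along-origin (P c) (P d)) (*-congˡ (+-congˡ (-‿cong (along-origin (P c) (P d)))))) (solve 2 (λ t L → con (ℤ.+ 0) :+ t :* (L :- con (ℤ.+ 0)) := t :* L) refl t (ℓ (P d)))))))
    fin : _ → _ → ProperCross c d u v ⊎ SameEdge (c , d) (u , v)
    fin (inj₁ π) (inj₁ σ) = inj₁ (π , σ)
    fin (inj₁ π) (inj₂ (σc , σd)) = ⊥-elim (eq-prod-neg (sym (diff≈0⇒≈ (trans (sym (orient-exchange (P u) (P v) (P c) (P d))) (diff-of-zeros σc σd)))) π)
    fin (inj₂ (πu , πv)) (inj₁ σ) = ⊥-elim (eq-prod-neg (diff≈0⇒≈ (trans (orient-exchange (P u) (P v) (P c) (P d)) (diff-of-zeros πv πu))) σ)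
    fin (inj₂ (πu , πv)) (inj₂ (σc , σd)) = inj₂ (collinear-crossing⇒sameEdge dist ec A≉0 ew W≉0 c≢d πu πv σc σd s>0 s<1 t>0 t<1 E3)

  properCross-resp-sameEdgeˡ : ∀ {x y x' y' s t} → SameEdge (x , y) (x' , y') → ProperCross x y s t → ProperCross x' y' s t
  properCross-resp-sameEdgeˡ (inj₁ (≡.refl , ≡.refl)) px = px
  properCross-resp-sameEdgeˡ (inj₂ (≡.refl , ≡.refl)) px = properCross-swapˡ px

  properCross-resp-sameEdgeʳ : ∀ {x y s t s' t'} → SameEdge (s , t) (s' , t') → ProperCross x y s t → ProperCross x y s' t'
  properCross-resp-sameEdgeʳ (inj₁ (≡.refl , ≡.refl)) px = px
  properCross-resp-sameEdgeʳ (inj₂ (≡.refl , ≡.refl)) px = properCross-swapʳ px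

-- This is how the
-- disjointness axiom of a triangulation is brought to bear: the witness is
-- a point nudged by a parameter ε small enough for all the finitely many
-- strict sign conditions at once.
module CommonInterior (K : OrderedField) {n : ℕ} (P : Fin n → Geometry.Point K) where
  import Data.Integer as ℤ
  open import Data.Product using (_×_; _,_; proj₁; proj₂; ∃)
  open import Data.Sum using (_⊎_; inj₁; inj₂)
  open import Relation.Nullary using (¬_)
  open OrderedFieldProperties K
  open Geometry K
  open OrientationIdentities K
  open PlaneGeometry K
  open PointSetGeometry K P
  open IntegerCoefficientSolver commutativeRing using (solve; _:+_; _:*_; :-_; _:-_; _:=_; con)

  side-for-small : ∀ D p1 p2 m a b → (0# < D * orient p1 p2 m) ⊎ (orient p1 p2 m ≈ 0# × 0# < D * (orient p1 p2 a + orient p1 p2 b)) →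
    ForSmall (λ e → 0# < D * orient p1 p2 (nudge m a b e))
  side-for-small D p1 p2 m a b (inj₁ pos) with forSmall-positive (D * ((orient p1 p2 a + orient p1 p2 b) - (orient p1 p2 m + orient p1 p2 m))) pos
  ... | (ε , ε>0 , f) = ε , ε>0 , λ e e>0 e≤ → <-resp refl (sym (eq e)) (f e e>0 e≤)
    where
    eq : ∀ e → D * orient p1 p2 (nudge m a b e) ≈ D * orient p1 p2 m + e * (D * ((orient p1 p2 a + orient p1 p2 b) - (orient p1 p2 m + orient p1 p2 m)))
    eq e = trans (*-congˡ (orient-nudge p1 p2 m a b e)) (solve 5 (λ D M A B e → D :* ((M :+ e :* (A :- M)) :+ e :* (B :- M)) := D :* M :+ e :* (D :* ((A :+ B) :- (M :+ M)))) refl D (orient p1 p2 m) (orient p1 p2 a) (orient p1 p2 b) e)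
  side-for-small D p1 p2 m a b (inj₂ (z , pos)) = forSmall-always (λ e e>0 → <-resp refl (sym (eq e)) (*pp e>0 pos))
    where
    eq : ∀ e → D * orient p1 p2 (nudge m a b e) ≈ e * (D * (orient p1 p2 a + orient p1 p2 b))
    eq e = trans (*-congˡ (trans (orient-nudge p1 p2 m a b e) (+-cong (+-cong z (*-congˡ (+-congˡ (-‿cong z)))) (*-congˡ (+-congˡ (-‿cong z)))))) (solve 4 (λ D A B e → D :* ((con (ℤ.+ 0) :+ e :* (A :- con (ℤ.+ 0))) :+ e :* (B :- con (ℤ.+ 0))) := e :* (D :* (A :+ B))) refl D (orient p1 p2 a) (orient p1 p2 b) e)


  nudged-common-interior : ∀ {x y z x' y' z'} → ¬ (O x y z ≈ 0#) → ¬ (O x' y' z' ≈ 0#) → ∀ m a b →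
    let inside = λ D p₁ p₂ → ForSmall (λ e → 0# < D * orient p₁ p₂ (nudge m a b e)) in
    inside (O x y z) (P x) (P y) → inside (O x y z) (P y) (P z) → inside (O x y z) (P z) (P x) →
    inside (O x' y' z') (P x') (P y') → inside (O x' y' z') (P y') (P z') → inside (O x' y' z') (P z') (P x') →
    ∃ λ q → InOpenTriangle q (P x) (P y) (P z) × InOpenTriangle q (P x') (P y') (P z')
  nudged-common-interior A≉0 B≉0 m a b g₁ g₂ g₃ g₄ g₅ g₆ =
    from-signs (proj₂ (proj₂ small) e (proj₁ (proj₂ small)) (inj₂ refl))
    where
    small = forSmall-× g₁ (forSmall-× g₂ (forSmall-× g₃ (forSmall-× g₄ (forSmall-× g₅ g₆))))
    e = proj₁ small
    from-signs : _ → ∃ λ q → _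
    from-signs (s₁ , s₂ , s₃ , s₄ , s₅ , s₆) =
      nudge m a b e , openTriangle-from-signs A≉0 s₁ s₂ s₃ , openTriangle-from-signs B≉0 s₄ s₅ s₆

  -- two nondegenerate triangles xyz, xyw on the same side of their common
  -- edge share an interior point: nudge the midpoint of xy towards z and w
  same-side⇒common-interior : ∀ {x y z w} → ¬ (O x y z ≈ 0#) → ¬ (O x y w ≈ 0#) → 0# < O x y z * O x y w →
    ∃ λ q → InOpenTriangle q (P x) (P y) (P z) × InOpenTriangle q (P x) (P y) (P w)
  same-side⇒common-interior {x} {y} {z} {w} A≉0 B≉0 AB>0 = nudged-common-interior A≉0 B≉0 m (P z) (P w) g1 g2 g3 g4 g5 g6
    where
    A = O x y z
    B = O x y w
    two>0 : 0# < 1# + 1#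
    two>0 = +pp 0<1 0<1
    inv = inverse (1# + 1#) (pos≉0 two>0)
    h = proj₁ inv
    h>0 : 0# < h
    h>0 = cancel-p two>0 (<-resp refl (sym (proj₂ inv)) 0<1)
    1-h>0 : 0# < 1# - h
    1-h>0 = <-resp refl (sym eq) h>0
      where
      eq : 1# - h ≈ h
      eq = trans (+-congʳ (sym (proj₂ inv))) (solve 1 (λ h → (con (ℤ.+ 1) :+ con (ℤ.+ 1)) :* h :- h := h) refl h)
    m = seg (P x) (P y) h
    πm : orient (P x) (P y) m ≈ 0#
    πm = trans (orient-seg (P x) (P y) (P x) (P y) h) (affine-zeros h (orient-repeat₁₃ (P x) (P y)) (orient-repeat₂₃ (P y) (P x)))
    g1 = side-for-small A (P x) (P y) m (P z) (P w) (inj₂ (πm , <-resp refl (sym (distribˡ A A B)) (+pp (sq-pos A≉0) AB>0)))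
    g2 = side-for-small A (P y) (P z) m (P z) (P w) (inj₁ (positive-scaled 1-h>0 (trans (orient-seg (P y) (P z) (P x) (P y) h) (affine-to-zero h (orient-repeat₁₃ (P y) (P z)))) (sym (orient-cyclic (P x) (P y) (P z))) A≉0))
    g3 = side-for-small A (P z) (P x) m (P z) (P w) (inj₁ (positive-scaled h>0 (trans (orient-seg (P z) (P x) (P x) (P y) h) (affine-from-zero h (orient-repeat₂₃ (P x) (P z)))) (sym (trans (orient-cyclic (P x) (P y) (P z)) (orient-cyclic (P y) (P z) (P x)))) A≉0))
    g4 = side-for-small B (P x) (P y) m (P z) (P w) (inj₂ (πm , <-resp refl (sym (distribˡ B A B)) (+pp (<-resp refl (*-comm A B) AB>0) (sq-pos B≉0))))
    g5 = side-for-small B (P y) (P w) m (P z) (P w) (inj₁ (positive-scaled 1-h>0 (trans (orient-seg (P y) (P w) (P x) (P y) h) (affine-to-zero h (orient-repeat₁₃ (P y) (P w)))) (sym (orient-cyclic (P x) (P y) (P w))) B≉0))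
    g6 = side-for-small B (P w) (P x) m (P z) (P w) (inj₁ (positive-scaled h>0 (trans (orient-seg (P w) (P x) (P x) (P y) h) (affine-from-zero h (orient-repeat₂₃ (P x) (P w)))) (sym (trans (orient-cyclic (P x) (P y) (P w)) (orient-cyclic (P y) (P w) (P x)))) B≉0))

  -- two nondegenerate triangles with properly crossing sides pq and st
  -- share an interior point: nudge the crossing point into both triangles
  proper-cross⇒common-interior : ∀ {p q r s t w} → ¬ (O p q r ≈ 0#) → ¬ (O s t w ≈ 0#) → ProperCross p q s t →
    ∃ λ q' → InOpenTriangle q' (P p) (P q) (P r) × InOpenTriangle q' (P s) (P t) (P w)
  proper-cross⇒common-interior {p} {q} {r} {s} {t} {w} R≉0 W≉0 (πst , σpq) =
    choose (positive-factor R≉0 πst) (positive-factor W≉0 σpq)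
    where
    crossing = crossing-point σpq
    λ' = proj₁ crossing
    λ>0 = proj₁ (proj₂ crossing)
    1-λ>0 = proj₁ (proj₂ (proj₂ crossing))
    σm = proj₂ (proj₂ (proj₂ crossing))
    R = O p q r
    W = O s t w
    π = orient (P p) (P q)
    σ = orient (P s) (P t)
    πs = π (P s)
    πt = π (P t)
    πs≉0 = prod-neg-≉l πst
    πt≉0 = prod-neg-≉r πst
    m = seg (P p) (P q) λ'
    πm : π m ≈ 0#
    πm = trans (orient-seg (P p) (P q) (P p) (P q) λ') (affine-zeros λ' (orient-repeat₁₃ (P p) (P q)) (orient-repeat₂₃ (P q) (P p)))
    inner : ∀ d1 d2 → 0# < R * π d1 → σ d1 ≈ 0# → 0# < W * σ d2 → π d2 ≈ 0# →
      ∃ λ q' → InOpenTriangle q' (P p) (P q) (P r) × InOpenTriangle q' (P s) (P t) (P w)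
    inner d1 d2 a1 b1 a2 b2 = nudged-common-interior R≉0 W≉0 m d1 d2 k1 k2 k3 k4 k5 k6
      where
      k1 = side-for-small R (P p) (P q) m d1 d2 (inj₂ (πm , <-resp refl (*-congˡ (trans (sym (+-identityʳ _)) (+-congˡ (sym b2)))) a1))
      k2 = side-for-small R (P q) (P r) m d1 d2 (inj₁ (positive-scaled 1-λ>0 (trans (orient-seg (P q) (P r) (P p) (P q) λ') (affine-to-zero λ' (orient-repeat₁₃ (P q) (P r)))) (sym (orient-cyclic (P p) (P q) (P r))) R≉0))
      k3 = side-for-small R (P r) (P p) m d1 d2 (inj₁ (positive-scaled λ>0 (trans (orient-seg (P r) (P p) (P p) (P q) λ') (affine-from-zero λ' (orient-repeat₂₃ (P p) (P r)))) (sym (trans (orient-cyclic (P p) (P q) (P r)) (orient-cyclic (P q) (P r) (P p)))) R≉0))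
      k4 = side-for-small W (P s) (P t) m d1 d2 (inj₂ (σm , <-resp refl (*-congˡ (trans (sym (+-identityˡ _)) (+-congʳ (sym b1)))) a2))
      e5 : (πs - πt) * orient (P t) (P w) m ≈ (π m - πt) * W
      e5 = trans (drop-vanishing₁ (proj₂ (orient-affine (P p) (P q) (P s) (P t) m (P t) (P w))) (orient-repeat₁₃ (P t) (P w)) σm) (*-congˡ (sym (orient-cyclic (P s) (P t) (P w))))
      d5 : 0# < (πs - πt) * (π m - πt)
      d5 = <-resp refl (sym (trans (*-congˡ (+-congʳ πm)) (solve 2 (λ a b → (a :- b) :* (con (ℤ.+ 0) :- b) := b :* b :+ :- (a :* b)) refl πs πt))) (+pp (sq-pos πt≉0) (neg→pos πst))
      k5 = side-for-small W (P t) (P w) m d1 d2 (inj₁ (sign-transfer e5 d5 W≉0))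
      e6 : (πs - πt) * orient (P w) (P s) m ≈ (πs - π m) * W
      e6 = trans (drop-vanishing₂ (proj₂ (orient-affine (P p) (P q) (P s) (P t) m (P w) (P s))) (orient-repeat₂₃ (P s) (P w)) σm) (*-congˡ (sym (trans (orient-cyclic (P s) (P t) (P w)) (orient-cyclic (P t) (P w) (P s)))))
      d6 : 0# < (πs - πt) * (πs - π m)
      d6 = <-resp refl (sym (trans (*-congˡ (+-congˡ (-‿cong πm))) (solve 2 (λ a b → (a :- b) :* (a :- con (ℤ.+ 0)) := a :* a :+ :- (a :* b)) refl πs πt))) (+pp (sq-pos πs≉0) (neg→pos πst))
      k6 = side-for-small W (P w) (P s) m d1 d2 (inj₁ (sign-transfer e6 d6 W≉0))
    choose : _ → _ → ∃ λ q' → InOpenTriangle q' (P p) (P q) (P r) × InOpenTriangle q' (P s) (P t) (P w)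
    choose (inj₁ a1) (inj₁ a2) = inner (P s) (P p) a1 (orient-repeat₁₃ (P s) (P t)) a2 (orient-repeat₁₃ (P p) (P q))
    choose (inj₁ a1) (inj₂ a2) = inner (P s) (P q) a1 (orient-repeat₁₃ (P s) (P t)) a2 (orient-repeat₂₃ (P q) (P p))
    choose (inj₂ a1) (inj₁ a2) = inner (P t) (P p) a1 (orient-repeat₂₃ (P t) (P s)) a2 (orient-repeat₁₃ (P p) (P q))
    choose (inj₂ a1) (inj₂ a2) = inner (P t) (P q) a1 (orient-repeat₂₃ (P t) (P s)) a2 (orient-repeat₂₃ (P q) (P p))

module BoolFacts where
  open import Data.Bool using (true; false; _∨_; _∧_; if_then_else_)
  open import Data.Product using (_×_; _,_)
  open import Data.Sum using (_⊎_; inj₁; inj₂)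
  open import Relation.Binary.PropositionalEquality as P using (_≡_; refl)
  ∨-split : ∀ {x y} → x ∨ y ≡ true → x ≡ true ⊎ y ≡ true
  ∨-split {true} e = inj₁ refl
  ∨-split {false} e = inj₂ e

  ∨-l : ∀ {x y} → x ≡ true → x ∨ y ≡ true
  ∨-l refl = refl

  ∨-r : ∀ {x y} → y ≡ true → x ∨ y ≡ true
  ∨-r {true} e = refl
  ∨-r {false} e = e

  ∨-false-l : ∀ {x y} → x ∨ y ≡ false → x ≡ false
  ∨-false-l {true} ()
  ∨-false-l {false} e = refl

  ∨-false-r : ∀ {x y} → x ∨ y ≡ false → y ≡ false
  ∨-false-r {true} ()
  ∨-false-r {false} e = e

  ∧-l : ∀ {x y} → x ∧ y ≡ true → x ≡ true
  ∧-l {true} e = refl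
  ∧-l {false} ()

  ∧-r : ∀ {x y} → x ∧ y ≡ true → y ≡ true
  ∧-r {true} e = e
  ∧-r {false} ()

  ∧-i : ∀ {x y} → x ≡ true → y ≡ true → x ∧ y ≡ true
  ∧-i refl e = e

  bool-ext : ∀ {b b'} → (b ≡ true → b' ≡ true) → (b' ≡ true → b ≡ true) → b ≡ b'
  bool-ext {true} {true} f g = refl
  bool-ext {true} {false} f g with f refl
  ... | ()
  bool-ext {false} {true} f g with g refl
  ... | ()
  bool-ext {false} {false} f g = refl

  if-outcome : ∀ b1 b2 t → (if b1 then false else (if b2 then true else t)) ≡ true → (b1 ≡ false × t ≡ true) ⊎ (b1 ≡ false × b2 ≡ true)
  if-outcome true b2 t ()
  if-outcome false true t e = inj₂ (refl , refl)
  if-outcome false false t e = inj₁ (refl , e)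

-- Triangle sets as boolean indicators, and the geometric invariant that
-- triangulations satisfy and flips preserve.
module FlipInvariant (K : OrderedField) {n : ℕ} (P : Fin n → Geometry.Point K) where
  open import Data.Fin as Fin using (Fin)
  open import Data.Bool using (true; false; _∨_; if_then_else_)
  open import Data.Bool.Properties using (¬-not)
  open import Data.Product using (_×_; _,_; proj₁; proj₂; ∃)
  open import Data.Sum using (_⊎_; inj₁; inj₂)
  open import Data.Empty using (⊥; ⊥-elim)
  open import Relation.Nullary using (¬_; yes; no)
  open import Relation.Binary.PropositionalEquality as P using (_≡_; refl)
  open Geometry K
  open PointSet P
  open BoolFacts
  open OrderedFieldProperties K renaming (refl to ≈-refl)
  open PlaneGeometry K
  open OrientationIdentities K
  open PointSetGeometry K P
  open CommonInterior K P

  OneOf3 : Fin n → Fin n → Fin n → Fin n → Set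
  OneOf3 v A B C = v ≡ A ⊎ v ≡ B ⊎ v ≡ C

  ==⇒≡ : ∀ {a b} → (a == b) ≡ true → a ≡ b
  ==⇒≡ {a} {b} e with a Fin.≟ b
  ... | yes p = p
  ... | no _ = ⊥-elim (h e)
    where
    h : false ≡ true → ⊥
    h ()

  ==-refl : ∀ a → (a == a) ≡ true
  ==-refl a with a Fin.≟ a
  ... | yes _ = refl
  ... | no k = ⊥-elim (k refl)

  memᵇ⇒ : ∀ {v A B C} → memᵇ v A B C ≡ true → OneOf3 v A B C
  memᵇ⇒ e with ∨-split e
  ... | inj₁ x = inj₁ (==⇒≡ x)
  ... | inj₂ y with ∨-split y
  ... | inj₁ x = inj₂ (inj₁ (==⇒≡ x))
  ... | inj₂ x = inj₂ (inj₂ (==⇒≡ x))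

  memᵇ⇐ : ∀ {v A B C} → OneOf3 v A B C → memᵇ v A B C ≡ true
  memᵇ⇐ {v} {A} {B} {C} (inj₁ refl) = ∨-l {v == v} {(v == B) ∨ (v == C)} (==-refl v)
  memᵇ⇐ {v} {A} {B} {C} (inj₂ (inj₁ refl)) = ∨-r {v == A} (∨-l {v == v} {v == C} (==-refl v))
  memᵇ⇐ {v} {A} {B} {C} (inj₂ (inj₂ refl)) = ∨-r {v == A} (∨-r {v == B} (==-refl v))

  SameTriangle : Fin n → Fin n → Fin n → Fin n → Fin n → Fin n → Set
  SameTriangle x y z A B C = OneOf3 x A B C × OneOf3 y A B C × OneOf3 z A B C × OneOf3 A x y z × OneOf3 B x y z × OneOf3 C x y z

  sameTri⇒ : ∀ {x y z A B C} → sameTriᵇ x y z A B C ≡ true → SameTriangle x y z A B C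
  sameTri⇒ {x} {y} {z} {A} {B} {C} e0 = memᵇ⇒ (∧-l {m1} e0) , memᵇ⇒ (∧-l {m2} e1) , memᵇ⇒ (∧-l {m3} e2) , memᵇ⇒ (∧-l {m4} e3) , memᵇ⇒ (∧-l {m5} e4) , memᵇ⇒ (∧-r {m5} e4)
    where
    m1 = memᵇ x A B C
    m2 = memᵇ y A B C
    m3 = memᵇ z A B C
    m4 = memᵇ A x y z
    m5 = memᵇ B x y z
    e1 = ∧-r {m1} e0
    e2 = ∧-r {m2} e1
    e3 = ∧-r {m3} e2
    e4 = ∧-r {m4} e3

  sameTri⇐ : ∀ {x y z A B C} → SameTriangle x y z A B C → sameTriᵇ x y z A B C ≡ true
  sameTri⇐ (a , b , c , d , e , f) = ∧-i (memᵇ⇐ a) (∧-i (memᵇ⇐ b) (∧-i (memᵇ⇐ c) (∧-i (memᵇ⇐ d) (∧-i (memᵇ⇐ e) (memᵇ⇐ f)))))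

  oneOf3-swap₁₂ : ∀ {v x y z} → OneOf3 v x y z → OneOf3 v y x z
  oneOf3-swap₁₂ (inj₁ e) = inj₂ (inj₁ e)
  oneOf3-swap₁₂ (inj₂ (inj₁ e)) = inj₁ e
  oneOf3-swap₁₂ (inj₂ (inj₂ e)) = inj₂ (inj₂ e)

  oneOf3-swap₂₃ : ∀ {v x y z} → OneOf3 v x y z → OneOf3 v x z y
  oneOf3-swap₂₃ (inj₁ e) = inj₁ e
  oneOf3-swap₂₃ (inj₂ (inj₁ e)) = inj₂ (inj₂ e)
  oneOf3-swap₂₃ (inj₂ (inj₂ e)) = inj₂ (inj₁ e)

  sameTriangle-swap₁₂ : ∀ {x y z A B C} → SameTriangle x y z A B C → SameTriangle y x z A B C
  sameTriangle-swap₁₂ (a , b , c , d , e , f) = b , a , c , oneOf3-swap₁₂ d , oneOf3-swap₁₂ e , oneOf3-swap₁₂ f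

  sameTriangle-swap₂₃ : ∀ {x y z A B C} → SameTriangle x y z A B C → SameTriangle x z y A B C
  sameTriangle-swap₂₃ (a , b , c , d , e , f) = a , c , b , oneOf3-swap₂₃ d , oneOf3-swap₂₃ e , oneOf3-swap₂₃ f

  sameTriᵇ-swap₁₂ : ∀ x y z A B C → sameTriᵇ y x z A B C ≡ sameTriᵇ x y z A B C
  sameTriᵇ-swap₁₂ x y z A B C = bool-ext (λ e → sameTri⇐ {x} {y} {z} (sameTriangle-swap₁₂ (sameTri⇒ {y} {x} {z} e))) (λ e → sameTri⇐ {y} {x} {z} (sameTriangle-swap₁₂ (sameTri⇒ {x} {y} {z} e)))

  sameTriᵇ-swap₂₃ : ∀ x y z A B C → sameTriᵇ x z y A B C ≡ sameTriᵇ x y z A B C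
  sameTriᵇ-swap₂₃ x y z A B C = bool-ext (λ e → sameTri⇐ {x} {y} {z} (sameTriangle-swap₂₃ (sameTri⇒ {x} {z} {y} e))) (λ e → sameTri⇐ {x} {z} {y} (sameTriangle-swap₂₃ (sameTri⇒ {x} {y} {z} e)))

  nondegenerate⇒distinct : ∀ {x y z} → ¬ (O x y z ≈ 0#) → ¬ (x ≡ y) × ¬ (y ≡ z) × ¬ (x ≡ z)
  nondegenerate⇒distinct {x} {y} {z} nondegenerate = (λ { refl → nondegenerate (orient-repeat₁₂ (P x) (P z)) }) , (λ { refl → nondegenerate (orient-repeat₂₃ (P y) (P x)) }) , (λ { refl → nondegenerate (orient-repeat₁₃ (P x) (P y)) })

  record Distinct4 (a b c d : Fin n) : Set where
    field
      ab : ¬ (a ≡ b)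
      ac : ¬ (a ≡ c)
      ad : ¬ (a ≡ d)
      bc : ¬ (b ≡ c)
      bd : ¬ (b ≡ d)
      cd : ¬ (c ≡ d)

  convex⇒nondegenerate : ∀ {a c b d} → Convex a c b d → ¬ (O a c b ≈ 0#) × ¬ (O b d a ≈ 0#)
  convex⇒nondegenerate (inj₁ (p1 , p2 , p3 , p4)) = pos≉0 p1 , pos≉0 p3
  convex⇒nondegenerate (inj₂ (p1 , p2 , p3 , p4)) = neg≉0 p1 , neg≉0 p3

  convex⇒distinct4 : ∀ {a b c d} → Convex a c b d → Distinct4 a b c d
  convex⇒distinct4 {a} {b} {c} {d} cv = record
    { ab = proj₂ (proj₂ n1)
    ; ac = proj₁ n1
    ; ad = λ e → proj₁ (proj₂ n2) (P.sym e)
    ; bc = λ e → proj₁ (proj₂ n1) (P.sym e)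
    ; bd = proj₁ n2
    ; cd = c≢d
    }
    where
    n1 = nondegenerate⇒distinct (proj₁ (convex⇒nondegenerate cv))
    n2 = nondegenerate⇒distinct (proj₂ (convex⇒nondegenerate cv))
    c≢d : ¬ (c ≡ d)
    c≢d = proj₁ (nondegenerate⇒distinct (FlipQuadSigns.cda (flipQuad-signs cv)))

  -- xyz is the triangle pqr, read from the apex z opposite to the side xy
  NewTriangle : Fin n → Fin n → Fin n → Fin n → Fin n → Fin n → Set
  NewTriangle p q r x y z = (z ≡ r × SameEdge (x , y) (p , q)) ⊎ (z ≡ p × SameEdge (x , y) (q , r)) ⊎ (z ≡ q × SameEdge (x , y) (r , p))

  oneOf3-not-third : ∀ {v x y z} → OneOf3 v x y z → ¬ (v ≡ z) → v ≡ x ⊎ v ≡ y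
  oneOf3-not-third (inj₁ e) k = inj₁ e
  oneOf3-not-third (inj₂ (inj₁ e)) k = inj₂ e
  oneOf3-not-third (inj₂ (inj₂ e)) k = ⊥-elim (k e)

  pair⇒sameEdge : ∀ {p q x y} → p ≡ x ⊎ p ≡ y → q ≡ x ⊎ q ≡ y → ¬ (p ≡ q) → SameEdge (x , y) (p , q)
  pair⇒sameEdge (inj₁ refl) (inj₁ refl) k = ⊥-elim (k refl)
  pair⇒sameEdge (inj₁ refl) (inj₂ refl) k = inj₁ (refl , refl)
  pair⇒sameEdge (inj₂ refl) (inj₁ refl) k = inj₂ (refl , refl)
  pair⇒sameEdge (inj₂ refl) (inj₂ refl) k = ⊥-elim (k refl)

  sameTri⇒newTriangle : ∀ {p q r x y z} → sameTriᵇ x y z p q r ≡ true → ¬ (p ≡ q) → ¬ (q ≡ r) → ¬ (p ≡ r) → NewTriangle p q r x y z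
  sameTri⇒newTriangle {p} {q} {r} {x} {y} {z} e pq qr pr with sameTri⇒ {x} {y} {z} {p} {q} {r} e
  ... | (_ , _ , inj₁ refl , ip , iq , ir) = inj₂ (inj₁ (refl , pair⇒sameEdge (oneOf3-not-third iq (λ e → pq (P.sym e))) (oneOf3-not-third ir (λ e → pr (P.sym e))) qr))
  ... | (_ , _ , inj₂ (inj₁ refl) , ip , iq , ir) = inj₂ (inj₂ (refl , pair⇒sameEdge (oneOf3-not-third ir (λ e → qr (P.sym e))) (oneOf3-not-third ip pq) (λ e → pr (P.sym e))))
  ... | (_ , _ , inj₂ (inj₂ refl) , ip , iq , ir) = inj₁ (refl , pair⇒sameEdge (oneOf3-not-third ip pr) (oneOf3-not-third iq qr) pq)

  newTriangle-transfer : ∀ (Q : Fin n → Fin n → Fin n → Set) → (∀ {a b c} → Q a b c → Q b a c) → (∀ {a b c} → Q a b c → Q b c a) →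
    ∀ {p q r x y z} → Q p q r → NewTriangle p q r x y z → Q x y z
  newTriangle-transfer Q sw rt q (inj₁ (refl , inj₁ (refl , refl))) = q
  newTriangle-transfer Q sw rt q (inj₁ (refl , inj₂ (refl , refl))) = sw q
  newTriangle-transfer Q sw rt q (inj₂ (inj₁ (refl , inj₁ (refl , refl)))) = rt q
  newTriangle-transfer Q sw rt q (inj₂ (inj₁ (refl , inj₂ (refl , refl)))) = sw (rt q)
  newTriangle-transfer Q sw rt q (inj₂ (inj₂ (refl , inj₁ (refl , refl)))) = rt (rt q)
  newTriangle-transfer Q sw rt q (inj₂ (inj₂ (refl , inj₂ (refl , refl)))) = sw (rt (rt q))

  FlipOutcome : TriSet → Fin n → Fin n → Fin n → Fin n → Fin n → Fin n → Fin n → Set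
  FlipOutcome T a b c d x y z = (T x y z ≡ true × sameTriᵇ x y z a b c ≡ false × sameTriᵇ x y z a b d ≡ false) ⊎ NewTriangle c d a x y z ⊎ NewTriangle c d b x y z

  flip-outcome : ∀ {T a b c d x y z} → Distinct4 a b c d → doFlip T (mkFlip a b c d) x y z ≡ true → FlipOutcome T a b c d x y z
  flip-outcome {T} {a} {b} {c} {d} {x} {y} {z} d4 e with if-outcome (sameTriᵇ x y z a b c ∨ sameTriᵇ x y z a b d) (sameTriᵇ x y z c d a ∨ sameTriᵇ x y z c d b) (T x y z) e
  ... | inj₁ (f , t) = inj₁ (t , ∨-false-l f , ∨-false-r f)
  ... | inj₂ (_ , nw) with ∨-split nw
  ... | inj₁ e1 = inj₂ (inj₁ (sameTri⇒newTriangle e1 (Distinct4.cd d4) (λ e → Distinct4.ad d4 (P.sym e)) (λ e → Distinct4.ac d4 (P.sym e))))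
  ... | inj₂ e2 = inj₂ (inj₂ (sameTri⇒newTriangle e2 (Distinct4.cd d4) (λ e → Distinct4.bd d4 (P.sym e)) (λ e → Distinct4.bc d4 (P.sym e))))

  if-cong : ∀ {b1 b1' b2 b2' t t'} → b1 ≡ b1' → b2 ≡ b2' → t ≡ t' → (if b1 then false else (if b2 then true else t)) ≡ (if b1' then false else (if b2' then true else t'))
  if-cong refl refl refl = refl

  empty-rotate : ∀ {a b c} → Empty a b c → Empty b c a
  empty-rotate e v ict with e v (closedTriangle-rotate (closedTriangle-rotate ict))
  ... | inj₁ x = inj₂ (inj₂ x)
  ... | inj₂ (inj₁ x) = inj₁ x
  ... | inj₂ (inj₂ x) = inj₂ (inj₁ x)

  nondegenerate-swap : ∀ {a b c} → ¬ (O a b c ≈ 0#) → ¬ (O b a c ≈ 0#)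
  nondegenerate-swap {a} {b} {c} k e = k (trans (sym (-‿involutive _)) (trans (-‿cong (trans (sym (orient-swap (P a) (P b) (P c))) e)) -0#≈0#))

  nondegenerate-rotate : ∀ {a b c} → ¬ (O a b c ≈ 0#) → ¬ (O b c a ≈ 0#)
  nondegenerate-rotate {a} {b} {c} k e = k (trans (orient-cyclic (P a) (P b) (P c)) e)

  -- The invariant kept along a flip sequence: T is a symmetric set of
  -- nondegenerate empty triangles, no two of which have properly crossing
  -- sides, and two triangles on a common edge lie on opposite sides of it.
  record Triangulated (T : TriSet) : Set where
    field
      sym₁₂ : ∀ a b c → T a b c ≡ T b a c
      sym₂₃ : ∀ a b c → T a b c ≡ T a c b
      nondegenerate : ∀ {a b c} → T a b c ≡ true → ¬ (O a b c ≈ 0#)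
      empty : ∀ {a b c} → T a b c ≡ true → Empty a b c
      no-proper-cross : ∀ {p q r s t w} → T p q r ≡ true → T s t w ≡ true → ProperCross p q s t → ⊥
      opposite-sides : ∀ {x y z z'} → T x y z ≡ true → T x y z' ≡ true → ¬ (z ≡ z') → O x y z * O x y z' < 0#

    swap₁₂ : ∀ {a b c} → T a b c ≡ true → T b a c ≡ true
    swap₁₂ {a} {b} {c} e = P.trans (P.sym (sym₁₂ a b c)) e
    swap₂₃ : ∀ {a b c} → T a b c ≡ true → T a c b ≡ true
    swap₂₃ {a} {b} {c} e = P.trans (P.sym (sym₂₃ a b c)) e
    rotate : ∀ {a b c} → T a b c ≡ true → T b c a ≡ true
    rotate e = swap₂₃ (swap₁₂ e)

  module FlipPreserves {T : TriSet} (inv : Triangulated T) {a b c d : Fin n} (adm : Admissible T (mkFlip a b c d)) where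
    open Triangulated inv
    T' = doFlip T (mkFlip a b c d)
    abc = proj₁ adm
    abd = proj₁ (proj₂ adm)
    cv = proj₂ (proj₂ adm)
    d4 = convex⇒distinct4 cv
    qs = flipQuad-signs cv
    open Distinct4 d4

    sym₁₂′ : ∀ x y z → T' x y z ≡ T' y x z
    sym₁₂′ x y z = if-cong (P.cong₂ _∨_ (P.sym (sameTriᵇ-swap₁₂ x y z a b c)) (P.sym (sameTriᵇ-swap₁₂ x y z a b d))) (P.cong₂ _∨_ (P.sym (sameTriᵇ-swap₁₂ x y z c d a)) (P.sym (sameTriᵇ-swap₁₂ x y z c d b))) (sym₁₂ x y z)

    sym₂₃′ : ∀ x y z → T' x y z ≡ T' x z y
    sym₂₃′ x y z = if-cong (P.cong₂ _∨_ (P.sym (sameTriᵇ-swap₂₃ x y z a b c)) (P.sym (sameTriᵇ-swap₂₃ x y z a b d))) (P.cong₂ _∨_ (P.sym (sameTriᵇ-swap₂₃ x y z c d a)) (P.sym (sameTriᵇ-swap₂₃ x y z c d b))) (sym₂₃ x y z)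

    outcome : ∀ {x y z} → T' x y z ≡ true → FlipOutcome T a b c d x y z
    outcome {x} {y} {z} e = flip-outcome {T} {a} {b} {c} {d} {x} {y} {z} d4 e

    nondegenerate′ : ∀ {x y z} → T' x y z ≡ true → ¬ (O x y z ≈ 0#)
    nondegenerate′ e with outcome e
    ... | inj₁ (t , _) = nondegenerate t
    ... | inj₂ (inj₁ nt) = newTriangle-transfer (λ x y z → ¬ (O x y z ≈ 0#)) nondegenerate-swap nondegenerate-rotate (FlipQuadSigns.cda qs) nt
    ... | inj₂ (inj₂ nt) = newTriangle-transfer (λ x y z → ¬ (O x y z ≈ 0#)) nondegenerate-swap nondegenerate-rotate (FlipQuadSigns.cdb qs) nt

    empN = flip-keeps-empty cv (empty abc) (empty abd)

    empty′ : ∀ {x y z} → T' x y z ≡ true → Empty x y z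
    empty′ e with outcome e
    ... | inj₁ (t , _) = empty t
    ... | inj₂ (inj₁ nt) = newTriangle-transfer Empty empty-swap empty-rotate (proj₁ empN) nt
    ... | inj₂ (inj₂ nt) = newTriangle-transfer Empty empty-swap empty-rotate (proj₂ empN) nt

    Tcab : T c a b ≡ true
    Tcab = rotate (rotate abc)
    Tacb : T a c b ≡ true
    Tacb = swap₂₃ abc
    Tdab : T d a b ≡ true
    Tdab = rotate (rotate abd)
    Tadb : T a d b ≡ true
    Tadb = swap₂₃ abd
    Tdba : T d b a ≡ true
    Tdba = swap₂₃ Tdab
    Tbda : T b d a ≡ true
    Tbda = rotate abd
    Tcba : T c b a ≡ true
    Tcba = swap₂₃ Tcab
    Tbca : T b c a ≡ true
    Tbca = rotate abc

    HasEdge : TriSet → Fin n → Fin n → Set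
    HasEdge T x y = ∃ λ w → T x y w ≡ true

    edge-after-flip : ∀ {x y z} → T' x y z ≡ true → HasEdge T x y ⊎ SameEdge (x , y) (c , d)
    edge-after-flip {x} {y} {z} e with outcome e
    ... | inj₁ (t , _) = inj₁ (z , t)
    ... | inj₂ (inj₁ (inj₁ (_ , se))) = inj₂ se
    ... | inj₂ (inj₁ (inj₂ (inj₁ (_ , inj₁ (refl , refl))))) = inj₁ (b , Tdab)
    ... | inj₂ (inj₁ (inj₂ (inj₁ (_ , inj₂ (refl , refl))))) = inj₁ (b , Tadb)
    ... | inj₂ (inj₁ (inj₂ (inj₂ (_ , inj₁ (refl , refl))))) = inj₁ (b , Tacb)
    ... | inj₂ (inj₁ (inj₂ (inj₂ (_ , inj₂ (refl , refl))))) = inj₁ (b , Tcab)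
    ... | inj₂ (inj₂ (inj₁ (_ , se))) = inj₂ se
    ... | inj₂ (inj₂ (inj₂ (inj₁ (_ , inj₁ (refl , refl))))) = inj₁ (a , Tdba)
    ... | inj₂ (inj₂ (inj₂ (inj₁ (_ , inj₂ (refl , refl))))) = inj₁ (a , Tbda)
    ... | inj₂ (inj₂ (inj₂ (inj₂ (_ , inj₁ (refl , refl))))) = inj₁ (a , Tbca)
    ... | inj₂ (inj₂ (inj₂ (inj₂ (_ , inj₂ (refl , refl))))) = inj₁ (a , Tcba)

    sameTriᵇ-refl : ∀ x y z → sameTriᵇ x y z x y z ≡ true
    sameTriᵇ-refl x y z = sameTri⇐ {x} {y} {z} {x} {y} {z} (inj₁ refl , inj₂ (inj₁ refl) , inj₂ (inj₂ refl) , inj₁ refl , inj₂ (inj₁ refl) , inj₂ (inj₂ refl))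

    false≢true : ∀ {b} → b ≡ false → b ≡ true → ⊥
    false≢true refl ()

    -- the removed edge ab is in no triangle after the flip: a third triangle
    -- on ab would be opposite to both c and d, which are opposite to each other
    removed-edge-gone : ∀ {z} → T' a b z ≡ true → ⊥
    removed-edge-gone {z} e with outcome e
    ... | inj₁ (t , f1 , f2) = three-negative-products (opposite-sides t abc z≢c) (opposite-sides t abd z≢d) (proj₁ (FlipQuadSigns.pxab qs))
      where
      z≢c : ¬ (z ≡ c)
      z≢c refl = false≢true f1 (sameTriᵇ-refl a b c)
      z≢d : ¬ (z ≡ d)
      z≢d refl = false≢true f2 (sameTriᵇ-refl a b d)
    ... | inj₂ (inj₁ (inj₁ (_ , inj₁ (x , _)))) = ac x
    ... | inj₂ (inj₁ (inj₁ (_ , inj₂ (x , _)))) = ad x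
    ... | inj₂ (inj₁ (inj₂ (inj₁ (_ , inj₁ (x , _))))) = ad x
    ... | inj₂ (inj₁ (inj₂ (inj₁ (_ , inj₂ (_ , x))))) = bd x
    ... | inj₂ (inj₁ (inj₂ (inj₂ (_ , inj₁ (_ , x))))) = bc x
    ... | inj₂ (inj₁ (inj₂ (inj₂ (_ , inj₂ (x , _))))) = ac x
    ... | inj₂ (inj₂ (inj₁ (_ , inj₁ (x , _)))) = ac x
    ... | inj₂ (inj₂ (inj₁ (_ , inj₂ (x , _)))) = ad x
    ... | inj₂ (inj₂ (inj₂ (inj₁ (_ , inj₁ (x , _))))) = ad x
    ... | inj₂ (inj₂ (inj₂ (inj₁ (_ , inj₂ (x , _))))) = ab x
    ... | inj₂ (inj₂ (inj₂ (inj₂ (_ , inj₁ (x , _))))) = ab x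
    ... | inj₂ (inj₂ (inj₂ (inj₂ (_ , inj₂ (x , _))))) = ac x

    sameTriᵇ-rotate : ∀ x y z A B C → sameTriᵇ y z x A B C ≡ sameTriᵇ x y z A B C
    sameTriᵇ-rotate x y z A B C = P.trans (sameTriᵇ-swap₂₃ y x z A B C) (sameTriᵇ-swap₁₂ x y z A B C)

    edge-resp : ∀ {x y p q w} → SameEdge (x , y) (p , q) → T p q w ≡ true → T x y w ≡ true
    edge-resp (inj₁ (refl , refl)) t = t
    edge-resp (inj₂ (refl , refl)) t = swap₁₂ t

    edge-resp⁻¹ : ∀ {x y p q w} → SameEdge (x , y) (p , q) → T x y w ≡ true → T p q w ≡ true
    edge-resp⁻¹ (inj₁ (refl , refl)) t = t
    edge-resp⁻¹ (inj₂ (refl , refl)) t = swap₁₂ t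

    sameSide-resp : ∀ {x y p q u v} → SameEdge (x , y) (p , q) → 0# < O p q u * O p q v → 0# < O x y u * O x y v
    sameSide-resp (inj₁ (refl , refl)) h = h
    sameSide-resp {x} {y} {p} {q} {u} {v} (inj₂ (refl , refl)) h = <-resp (≈-refl) (trans (sym (nn-prod _ _)) (sym (*-cong (orient-swap (P p) (P q) (P u)) (orient-swap (P p) (P q) (P v))))) h

    oppositeSide-resp : ∀ {x y p q u v} → SameEdge (x , y) (p , q) → O p q u * O p q v < 0# → O x y u * O x y v < 0#
    oppositeSide-resp (inj₁ (refl , refl)) h = h
    oppositeSide-resp {x} {y} {p} {q} {u} {v} (inj₂ (refl , refl)) h = <-resp (trans (sym (nn-prod _ _)) (sym (*-cong (orient-swap (P p) (P q) (P u)) (orient-swap (P p) (P q) (P v))))) (≈-refl) h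

    InNewTriangles : Fin n → Fin n → Fin n → Set
    InNewTriangles x y z = (z ≡ a × SameEdge (x , y) (c , d)) ⊎ (z ≡ c × SameEdge (x , y) (d , a)) ⊎ (z ≡ d × SameEdge (x , y) (a , c))
             ⊎ (z ≡ b × SameEdge (x , y) (c , d)) ⊎ (z ≡ c × SameEdge (x , y) (d , b)) ⊎ (z ≡ d × SameEdge (x , y) (b , c))

    toInNewTriangles : ∀ {x y z} → NewTriangle c d a x y z ⊎ NewTriangle c d b x y z → InNewTriangles x y z
    toInNewTriangles (inj₁ (inj₁ x)) = inj₁ x
    toInNewTriangles (inj₁ (inj₂ (inj₁ x))) = inj₂ (inj₁ x)
    toInNewTriangles (inj₁ (inj₂ (inj₂ x))) = inj₂ (inj₂ (inj₁ x))
    toInNewTriangles (inj₂ (inj₁ x)) = inj₂ (inj₂ (inj₂ (inj₁ x)))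
    toInNewTriangles (inj₂ (inj₂ (inj₁ x))) = inj₂ (inj₂ (inj₂ (inj₂ (inj₁ x))))
    toInNewTriangles (inj₂ (inj₂ (inj₂ x))) = inj₂ (inj₂ (inj₂ (inj₂ (inj₂ x))))

    cd×ab : ProperCross c d a b
    cd×ab = properCross-sym (FlipQuadSigns.pxab qs)

    -- an old triangle and a new triangle on a common edge lie on opposite
    -- sides: the common edge is a side of the quadrilateral, and the old
    -- triangle is opposite to the old triangle abc or abd through it
    old-new-opposite : ∀ {x y z z'} → T x y z ≡ true → sameTriᵇ x y z a b c ≡ false → sameTriᵇ x y z a b d ≡ false → InNewTriangles x y z' → O x y z * O x y z' < 0#
    old-new-opposite t f1 f2 (inj₁ (refl , se)) = ⊥-elim (no-proper-cross (edge-resp⁻¹ se t) abc cd×ab)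
    old-new-opposite {x} {y} {z} t f1 f2 (inj₂ (inj₁ (refl , se))) = sign-combine (opposite-sides t (edge-resp se Tdab) zb) (sameSide-resp se (FlipQuadSigns.da qs))
      where
      zb' : SameEdge (x , y) (d , a) → z ≡ b → ⊥
      zb' (inj₁ (refl , refl)) refl = false≢true f2 (P.trans (sameTriᵇ-rotate b d a a b d) (P.trans (sameTriᵇ-rotate a b d a b d) (sameTriᵇ-refl a b d)))
      zb' (inj₂ (refl , refl)) refl = false≢true f2 (P.trans (sameTriᵇ-swap₂₃ a b d a b d) (sameTriᵇ-refl a b d))
      zb : ¬ (z ≡ b)
      zb = zb' se
    old-new-opposite {x} {y} {z} t f1 f2 (inj₂ (inj₂ (inj₁ (refl , se)))) = sign-combine (opposite-sides t (edge-resp se Tacb) zb) (sameSide-resp (se-flip se) (FlipQuadSigns.ca qs))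
      where
      se-flip : ∀ {x y p q} → SameEdge (x , y) (p , q) → SameEdge (x , y) (q , p)
      se-flip (inj₁ (e1 , e2)) = inj₂ (e1 , e2)
      se-flip (inj₂ (e1 , e2)) = inj₁ (e1 , e2)
      zb' : SameEdge (x , y) (a , c) → z ≡ b → ⊥
      zb' (inj₁ (refl , refl)) refl = false≢true f1 (P.trans (sameTriᵇ-swap₂₃ a b c a b c) (sameTriᵇ-refl a b c))
      zb' (inj₂ (refl , refl)) refl = false≢true f1 (P.trans (sameTriᵇ-rotate b c a a b c) (P.trans (sameTriᵇ-rotate a b c a b c) (sameTriᵇ-refl a b c)))
      zb : ¬ (z ≡ b)
      zb = zb' se
    old-new-opposite t f1 f2 (inj₂ (inj₂ (inj₂ (inj₁ (refl , se))))) = ⊥-elim (no-proper-cross (edge-resp⁻¹ se t) abc cd×ab)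
    old-new-opposite {x} {y} {z} t f1 f2 (inj₂ (inj₂ (inj₂ (inj₂ (inj₁ (refl , se)))))) = sign-combine (opposite-sides t (edge-resp se Tdba) za) (sameSide-resp se (FlipQuadSigns.db qs))
      where
      za' : SameEdge (x , y) (d , b) → z ≡ a → ⊥
      za' (inj₁ (refl , refl)) refl = false≢true f2 (P.trans (sameTriᵇ-swap₁₂ b d a a b d) (P.trans (sameTriᵇ-rotate a b d a b d) (sameTriᵇ-refl a b d)))
      za' (inj₂ (refl , refl)) refl = false≢true f2 (P.trans (sameTriᵇ-rotate a b d a b d) (sameTriᵇ-refl a b d))
      za : ¬ (z ≡ a)
      za = za' se
    old-new-opposite {x} {y} {z} t f1 f2 (inj₂ (inj₂ (inj₂ (inj₂ (inj₂ (refl , se)))))) = sign-combine (opposite-sides t (edge-resp se Tbca) za) (sameSide-resp (se-flip se) (FlipQuadSigns.cb qs))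
      where
      se-flip : ∀ {x y p q} → SameEdge (x , y) (p , q) → SameEdge (x , y) (q , p)
      se-flip (inj₁ (e1 , e2)) = inj₂ (e1 , e2)
      se-flip (inj₂ (e1 , e2)) = inj₁ (e1 , e2)
      za' : SameEdge (x , y) (b , c) → z ≡ a → ⊥
      za' (inj₁ (refl , refl)) refl = false≢true f1 (P.trans (sameTriᵇ-rotate a b c a b c) (sameTriᵇ-refl a b c))
      za' (inj₂ (refl , refl)) refl = false≢true f1 (P.trans (sameTriᵇ-swap₁₂ b c a a b c) (P.trans (sameTriᵇ-rotate a b c a b c) (sameTriᵇ-refl a b c)))
      za : ¬ (z ≡ a)
      za = za' se

    sameEdge-both : ∀ {x y p q r s} → SameEdge (x , y) (p , q) → SameEdge (x , y) (r , s) → (p ≡ r × q ≡ s) ⊎ (p ≡ s × q ≡ r)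
    sameEdge-both (inj₁ (refl , refl)) (inj₁ (refl , refl)) = inj₁ (refl , refl)
    sameEdge-both (inj₁ (refl , refl)) (inj₂ (refl , refl)) = inj₂ (refl , refl)
    sameEdge-both (inj₂ (refl , refl)) (inj₁ (refl , refl)) = inj₂ (refl , refl)
    sameEdge-both (inj₂ (refl , refl)) (inj₂ (refl , refl)) = inj₁ (refl , refl)

    absurd-either : ∀ {A B : Set} → A ⊎ B → (A → ⊥) → (B → ⊥) → ∀ {C : Set} → C
    absurd-either (inj₁ x) f g = ⊥-elim (f x)
    absurd-either (inj₂ x) f g = ⊥-elim (g x)

    new-new-opposite : ∀ {x y z z'} → InNewTriangles x y z → InNewTriangles x y z' → ¬ (z ≡ z') → O x y z * O x y z' < 0#
    new-new-opposite (inj₁ (refl , _)) (inj₁ (refl , _)) k = ⊥-elim (k refl)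
    new-new-opposite (inj₁ (_ , se1)) (inj₂ (inj₁ (_ , se2))) k = absurd-either (sameEdge-both se1 se2) (λ pr → cd (proj₁ pr)) (λ pr → (λ e → ac (P.sym e)) (proj₁ pr))
    new-new-opposite (inj₁ (_ , se1)) (inj₂ (inj₂ (inj₁ (_ , se2)))) k = absurd-either (sameEdge-both se1 se2) (λ pr → (λ e → ac (P.sym e)) (proj₁ pr)) (λ pr → (λ e → ad (P.sym e)) (proj₂ pr))
    new-new-opposite (inj₁ (refl , se)) (inj₂ (inj₂ (inj₂ (inj₁ (refl , _))))) k = oppositeSide-resp se (proj₂ (FlipQuadSigns.pxab qs))
    new-new-opposite (inj₁ (_ , se1)) (inj₂ (inj₂ (inj₂ (inj₂ (inj₁ (_ , se2)))))) k = absurd-either (sameEdge-both se1 se2) (λ pr → cd (proj₁ pr)) (λ pr → (λ e → bc (P.sym e)) (proj₁ pr))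
    new-new-opposite (inj₁ (_ , se1)) (inj₂ (inj₂ (inj₂ (inj₂ (inj₂ (_ , se2)))))) k = absurd-either (sameEdge-both se1 se2) (λ pr → (λ e → bc (P.sym e)) (proj₁ pr)) (λ pr → (λ e → bd (P.sym e)) (proj₂ pr))
    new-new-opposite (inj₂ (inj₁ (_ , se1))) (inj₁ (_ , se2)) k = absurd-either (sameEdge-both se1 se2) (λ pr → (λ e → cd (P.sym e)) (proj₁ pr)) (λ pr → ac (proj₂ pr))
    new-new-opposite (inj₂ (inj₁ (refl , _))) (inj₂ (inj₁ (refl , _))) k = ⊥-elim (k refl)
    new-new-opposite (inj₂ (inj₁ (_ , se1))) (inj₂ (inj₂ (inj₁ (_ , se2)))) k = absurd-either (sameEdge-both se1 se2) (λ pr → (λ e → ad (P.sym e)) (proj₁ pr)) (λ pr → (λ e → cd (P.sym e)) (proj₁ pr))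
    new-new-opposite (inj₂ (inj₁ (_ , se1))) (inj₂ (inj₂ (inj₂ (inj₁ (_ , se2))))) k = absurd-either (sameEdge-both se1 se2) (λ pr → (λ e → cd (P.sym e)) (proj₁ pr)) (λ pr → ac (proj₂ pr))
    new-new-opposite (inj₂ (inj₁ (_ , se1))) (inj₂ (inj₂ (inj₂ (inj₂ (inj₁ (_ , se2)))))) k = absurd-either (sameEdge-both se1 se2) (λ pr → ab (proj₂ pr)) (λ pr → (λ e → bd (P.sym e)) (proj₁ pr))
    new-new-opposite (inj₂ (inj₁ (_ , se1))) (inj₂ (inj₂ (inj₂ (inj₂ (inj₂ (_ , se2)))))) k = absurd-either (sameEdge-both se1 se2) (λ pr → (λ e → bd (P.sym e)) (proj₁ pr)) (λ pr → (λ e → cd (P.sym e)) (proj₁ pr))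
    new-new-opposite (inj₂ (inj₂ (inj₁ (_ , se1)))) (inj₁ (_ , se2)) k = absurd-either (sameEdge-both se1 se2) (λ pr → ac (proj₁ pr)) (λ pr → ad (proj₁ pr))
    new-new-opposite (inj₂ (inj₂ (inj₁ (_ , se1)))) (inj₂ (inj₁ (_ , se2))) k = absurd-either (sameEdge-both se1 se2) (λ pr → ad (proj₁ pr)) (λ pr → cd (proj₂ pr))
    new-new-opposite (inj₂ (inj₂ (inj₁ (refl , _)))) (inj₂ (inj₂ (inj₁ (refl , _)))) k = ⊥-elim (k refl)
    new-new-opposite (inj₂ (inj₂ (inj₁ (_ , se1)))) (inj₂ (inj₂ (inj₂ (inj₁ (_ , se2))))) k = absurd-either (sameEdge-both se1 se2) (λ pr → ac (proj₁ pr)) (λ pr → ad (proj₁ pr))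
    new-new-opposite (inj₂ (inj₂ (inj₁ (_ , se1)))) (inj₂ (inj₂ (inj₂ (inj₂ (inj₁ (_ , se2)))))) k = absurd-either (sameEdge-both se1 se2) (λ pr → ad (proj₁ pr)) (λ pr → ab (proj₁ pr))
    new-new-opposite (inj₂ (inj₂ (inj₁ (_ , se1)))) (inj₂ (inj₂ (inj₂ (inj₂ (inj₂ (_ , se2)))))) k = absurd-either (sameEdge-both se1 se2) (λ pr → ab (proj₁ pr)) (λ pr → ac (proj₁ pr))
    new-new-opposite (inj₂ (inj₂ (inj₂ (inj₁ (refl , se))))) (inj₁ (refl , _)) k = <-resp (*-comm _ _) (≈-refl) (oppositeSide-resp se (proj₂ (FlipQuadSigns.pxab qs)))
    new-new-opposite (inj₂ (inj₂ (inj₂ (inj₁ (_ , se1))))) (inj₂ (inj₁ (_ , se2))) k = absurd-either (sameEdge-both se1 se2) (λ pr → cd (proj₁ pr)) (λ pr → (λ e → ac (P.sym e)) (proj₁ pr))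
    new-new-opposite (inj₂ (inj₂ (inj₂ (inj₁ (_ , se1))))) (inj₂ (inj₂ (inj₁ (_ , se2)))) k = absurd-either (sameEdge-both se1 se2) (λ pr → (λ e → ac (P.sym e)) (proj₁ pr)) (λ pr → (λ e → ad (P.sym e)) (proj₂ pr))
    new-new-opposite (inj₂ (inj₂ (inj₂ (inj₁ (refl , _))))) (inj₂ (inj₂ (inj₂ (inj₁ (refl , _))))) k = ⊥-elim (k refl)
    new-new-opposite (inj₂ (inj₂ (inj₂ (inj₁ (_ , se1))))) (inj₂ (inj₂ (inj₂ (inj₂ (inj₁ (_ , se2)))))) k = absurd-either (sameEdge-both se1 se2) (λ pr → cd (proj₁ pr)) (λ pr → (λ e → bc (P.sym e)) (proj₁ pr))
    new-new-opposite (inj₂ (inj₂ (inj₂ (inj₁ (_ , se1))))) (inj₂ (inj₂ (inj₂ (inj₂ (inj₂ (_ , se2)))))) k = absurd-either (sameEdge-both se1 se2) (λ pr → (λ e → bc (P.sym e)) (proj₁ pr)) (λ pr → (λ e → bd (P.sym e)) (proj₂ pr))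
    new-new-opposite (inj₂ (inj₂ (inj₂ (inj₂ (inj₁ (_ , se1)))))) (inj₁ (_ , se2)) k = absurd-either (sameEdge-both se1 se2) (λ pr → (λ e → cd (P.sym e)) (proj₁ pr)) (λ pr → bc (proj₂ pr))
    new-new-opposite (inj₂ (inj₂ (inj₂ (inj₂ (inj₁ (_ , se1)))))) (inj₂ (inj₁ (_ , se2))) k = absurd-either (sameEdge-both se1 se2) (λ pr → (λ e → ab (P.sym e)) (proj₂ pr)) (λ pr → (λ e → ad (P.sym e)) (proj₁ pr))
    new-new-opposite (inj₂ (inj₂ (inj₂ (inj₂ (inj₁ (_ , se1)))))) (inj₂ (inj₂ (inj₁ (_ , se2)))) k = absurd-either (sameEdge-both se1 se2) (λ pr → (λ e → ad (P.sym e)) (proj₁ pr)) (λ pr → (λ e → cd (P.sym e)) (proj₁ pr))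
    new-new-opposite (inj₂ (inj₂ (inj₂ (inj₂ (inj₁ (_ , se1)))))) (inj₂ (inj₂ (inj₂ (inj₁ (_ , se2))))) k = absurd-either (sameEdge-both se1 se2) (λ pr → (λ e → cd (P.sym e)) (proj₁ pr)) (λ pr → bc (proj₂ pr))
    new-new-opposite (inj₂ (inj₂ (inj₂ (inj₂ (inj₁ (refl , _)))))) (inj₂ (inj₂ (inj₂ (inj₂ (inj₁ (refl , _)))))) k = ⊥-elim (k refl)
    new-new-opposite (inj₂ (inj₂ (inj₂ (inj₂ (inj₁ (_ , se1)))))) (inj₂ (inj₂ (inj₂ (inj₂ (inj₂ (_ , se2)))))) k = absurd-either (sameEdge-both se1 se2) (λ pr → (λ e → bd (P.sym e)) (proj₁ pr)) (λ pr → (λ e → cd (P.sym e)) (proj₁ pr))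
    new-new-opposite (inj₂ (inj₂ (inj₂ (inj₂ (inj₂ (_ , se1)))))) (inj₁ (_ , se2)) k = absurd-either (sameEdge-both se1 se2) (λ pr → bc (proj₁ pr)) (λ pr → bd (proj₁ pr))
    new-new-opposite (inj₂ (inj₂ (inj₂ (inj₂ (inj₂ (_ , se1)))))) (inj₂ (inj₁ (_ , se2))) k = absurd-either (sameEdge-both se1 se2) (λ pr → bd (proj₁ pr)) (λ pr → (λ e → ab (P.sym e)) (proj₁ pr))
    new-new-opposite (inj₂ (inj₂ (inj₂ (inj₂ (inj₂ (_ , se1)))))) (inj₂ (inj₂ (inj₁ (_ , se2)))) k = absurd-either (sameEdge-both se1 se2) (λ pr → (λ e → ab (P.sym e)) (proj₁ pr)) (λ pr → bc (proj₁ pr))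
    new-new-opposite (inj₂ (inj₂ (inj₂ (inj₂ (inj₂ (_ , se1)))))) (inj₂ (inj₂ (inj₂ (inj₁ (_ , se2))))) k = absurd-either (sameEdge-both se1 se2) (λ pr → bc (proj₁ pr)) (λ pr → bd (proj₁ pr))
    new-new-opposite (inj₂ (inj₂ (inj₂ (inj₂ (inj₂ (_ , se1)))))) (inj₂ (inj₂ (inj₂ (inj₂ (inj₁ (_ , se2)))))) k = absurd-either (sameEdge-both se1 se2) (λ pr → bd (proj₁ pr)) (λ pr → cd (proj₂ pr))
    new-new-opposite (inj₂ (inj₂ (inj₂ (inj₂ (inj₂ (refl , _)))))) (inj₂ (inj₂ (inj₂ (inj₂ (inj₂ (refl , _)))))) k = ⊥-elim (k refl)

    opposite-sides′ : ∀ {x y z z'} → T' x y z ≡ true → T' x y z' ≡ true → ¬ (z ≡ z') → O x y z * O x y z' < 0#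
    opposite-sides′ {x} {y} {z} {z'} e e' k with outcome e | outcome e'
    ... | inj₁ (t , f1 , f2) | inj₁ (t' , _) = opposite-sides t t' k
    ... | inj₁ (t , f1 , f2) | inj₂ nw' = old-new-opposite t f1 f2 (toInNewTriangles nw')
    ... | inj₂ nw | inj₁ (t' , f1' , f2') = <-resp (*-comm _ _) (≈-refl) (old-new-opposite t' f1' f2' (toInNewTriangles nw))
    ... | inj₂ nw | inj₂ nw' = new-new-opposite (toInNewTriangles nw) (toInNewTriangles nw') k

    -- no old edge properly crosses the new edge cd: by the crossing lemma it
    -- would cross a side of the quadrilateral, or be ab, which is gone
    new-edge-uncrossed : ∀ {p q s t w0 w} → SameEdge (p , q) (c , d) → ProperCross p q s t → T s t w0 ≡ true → T' s t w ≡ true → ⊥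
    new-edge-uncrossed {p} {q} {s} {t} {w0} {w} se px Tst T'st = fin (exits-flipQuad cv (empty abc) (empty abd) (empty Tst) (nondegenerate Tst) (pxcd se px))
      where
      pxcd : SameEdge (p , q) (c , d) → ProperCross p q s t → ProperCross c d s t
      pxcd (inj₁ (refl , refl)) x = x
      pxcd (inj₂ (refl , refl)) x = properCross-swapˡ x
      fin : ExitsFlipQuad a b c d s t → ⊥
      fin (inj₁ x) = no-proper-cross Tst Tcab x
      fin (inj₂ (inj₁ x)) = no-proper-cross Tst Tdab x
      fin (inj₂ (inj₂ (inj₁ x))) = no-proper-cross Tst Tdba x
      fin (inj₂ (inj₂ (inj₂ (inj₁ x)))) = no-proper-cross Tst Tcba x
      fin (inj₂ (inj₂ (inj₂ (inj₂ (inj₁ (refl , refl)))))) = removed-edge-gone T'st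
      fin (inj₂ (inj₂ (inj₂ (inj₂ (inj₂ (refl , refl)))))) = removed-edge-gone (P.trans (sym₁₂′ a b w) T'st)

    new-edge-self : ∀ {p q s t} → SameEdge (p , q) (c , d) → SameEdge (s , t) (c , d) → ProperCross p q s t → ⊥
    new-edge-self (inj₁ (refl , refl)) (inj₁ (refl , refl)) px = <≈⊥ (proj₁ px) (z* (orient-repeat₁₃ (P c) (P d)))
    new-edge-self (inj₁ (refl , refl)) (inj₂ (refl , refl)) px = <≈⊥ (proj₁ px) (z* (orient-repeat₂₃ (P d) (P c)))
    new-edge-self (inj₂ (refl , refl)) (inj₁ (refl , refl)) px = <≈⊥ (proj₁ px) (z* (orient-repeat₂₃ (P c) (P d)))
    new-edge-self (inj₂ (refl , refl)) (inj₂ (refl , refl)) px = <≈⊥ (proj₁ px) (z* (orient-repeat₁₃ (P d) (P c)))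

    no-proper-cross′ : ∀ {p q r s t w} → T' p q r ≡ true → T' s t w ≡ true → ProperCross p q s t → ⊥
    no-proper-cross′ e1 e2 px with edge-after-flip e1 | edge-after-flip e2
    ... | inj₁ (_ , t1) | inj₁ (_ , t2) = no-proper-cross t1 t2 px
    ... | inj₂ se | inj₁ (_ , t2) = new-edge-uncrossed se px t2 e2
    ... | inj₁ (_ , t1) | inj₂ se = new-edge-uncrossed se (properCross-sym px) t1 e1
    ... | inj₂ se1 | inj₂ se2 = new-edge-self se1 se2 px

    triangulated′ : Triangulated T'
    triangulated′ = record { sym₁₂ = sym₁₂′ ; sym₂₃ = sym₂₃′ ; nondegenerate = nondegenerate′ ; empty = empty′ ; no-proper-cross = no-proper-cross′ ; opposite-sides = opposite-sides′ }

  -- Crossing triangles, or two triangles on the same side of a common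
  -- edge, would share interior points, contradicting disjointness.
  module _ {Ti : TriSet} (isT : IsTriangulation Ti) where
    nondeg : ∀ {a b c} → Ti a b c ≡ true → ¬ (O a b c ≈ 0#)
    nondeg {a} {b} {c} = IsTriangulation.nondeg isT a b c

    triangulation-no-proper-cross : ∀ {p q r s t w} → Ti p q r ≡ true → Ti s t w ≡ true → ProperCross p q s t → ⊥
    triangulation-no-proper-cross {p} {q} {r} {s} {t} {w} pqr stw pq×st =
      IsTriangulation.disjoint isT p q r s t w pqr stw different
        (proper-cross⇒common-interior (nondeg pqr) (nondeg stw) pq×st)
      where
      on-pq : ∀ {z} → z ≡ p ⊎ z ≡ q → O p q z ≈ 0#
      on-pq (inj₁ refl) = orient-repeat₁₃ (P p) (P q)
      on-pq (inj₂ refl) = orient-repeat₂₃ (P q) (P p)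
      -- a triangle has no properly crossing sides: s, t would not both be off pq
      different : sameTriᵇ p q r s t w ≡ false
      different = ¬-not same-absurd
        where
        same-absurd : sameTriᵇ p q r s t w ≡ true → ⊥
        same-absurd same with sameTri⇒ {p} {q} {r} {s} {t} {w} same
        ... | (_ , _ , _ , inj₁ sp , _ , _) = <≈⊥ (proj₁ pq×st) (z* (on-pq (inj₁ sp)))
        ... | (_ , _ , _ , inj₂ (inj₁ sq) , _ , _) = <≈⊥ (proj₁ pq×st) (z* (on-pq (inj₂ sq)))
        ... | (_ , _ , _ , inj₂ (inj₂ sr) , inj₁ tp , _) = <≈⊥ (proj₁ pq×st) (*z (on-pq (inj₁ tp)))
        ... | (_ , _ , _ , inj₂ (inj₂ sr) , inj₂ (inj₁ tq) , _) = <≈⊥ (proj₁ pq×st) (*z (on-pq (inj₂ tq)))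
        ... | (_ , _ , _ , inj₂ (inj₂ refl) , inj₂ (inj₂ refl) , _) = <≈⊥ (proj₂ pq×st) (z* (orient-repeat₁₂ (P s) (P p)))

    triangulation-opposite-sides : ∀ {x y z z'} → Ti x y z ≡ true → Ti x y z' ≡ true → ¬ (z ≡ z') → O x y z * O x y z' < 0#
    triangulation-opposite-sides {x} {y} {z} {z'} xyz xyz' z≢z' with tri (O x y z * O x y z')
    ... | inj₁ opposite = opposite
    ... | inj₂ (inj₁ zero) with zero-prod zero
    ... | inj₁ degenerate = ⊥-elim (nondeg xyz degenerate)
    ... | inj₂ degenerate = ⊥-elim (nondeg xyz' degenerate)
    triangulation-opposite-sides {x} {y} {z} {z'} xyz xyz' z≢z' | inj₂ (inj₂ same-side) =
      ⊥-elim (IsTriangulation.disjoint isT x y z x y z' xyz xyz' different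
                (same-side⇒common-interior (nondeg xyz) (nondeg xyz') same-side))
      where
      different : sameTriᵇ x y z x y z' ≡ false
      different = ¬-not same-absurd
        where
        same-absurd : sameTriᵇ x y z x y z' ≡ true → ⊥
        same-absurd same with sameTri⇒ {x} {y} {z} {x} {y} {z'} same
        ... | (_ , _ , inj₁ refl , _) = nondeg xyz (orient-repeat₁₃ (P x) (P y))
        ... | (_ , _ , inj₂ (inj₁ refl) , _) = nondeg xyz (orient-repeat₂₃ (P y) (P x))
        ... | (_ , _ , inj₂ (inj₂ z≡z') , _) = z≢z' z≡z'

  triangulation⇒triangulated : ∀ {Ti} → IsTriangulation Ti → Triangulated Ti
  triangulation⇒triangulated isT = record
    { sym₁₂ = IsTriangulation.sym₁₂ isT
    ; sym₂₃ = IsTriangulation.sym₂₃ isT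
    ; nondegenerate = λ {a} {b} {c} → IsTriangulation.nondeg isT a b c
    ; empty = λ {a} {b} {c} → IsTriangulation.onlyVerts isT a b c
    ; no-proper-cross = triangulation-no-proper-cross isT
    ; opposite-sides = triangulation-opposite-sides isT
    }

module EdgeFacts (K : OrderedField) {n : ℕ} (P : Fin n → Geometry.Point K) where
  open import Data.Nat as ℕ using (ℕ)
  open import Data.Fin as Fin using (Fin)
  open import Data.Bool using (true)
  open import Data.Product using (_,_)
  open import Data.Sum using (inj₁; inj₂)
  open import Relation.Nullary using (¬_)
  open import Relation.Binary.PropositionalEquality as ≡ using (_≡_; refl)
  open Geometry K
  open PointSet P

  sameEdge-sym : ∀ {a b c d} → SameEdge (a , b) (c , d) → SameEdge (c , d) (a , b)
  sameEdge-sym (inj₁ (refl , refl)) = inj₁ (refl , refl)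
  sameEdge-sym (inj₂ (refl , refl)) = inj₂ (refl , refl)

  sameEdge-trans : ∀ {a b c d e f} → SameEdge (a , b) (c , d) → SameEdge (c , d) (e , f) → SameEdge (a , b) (e , f)
  sameEdge-trans (inj₁ (refl , refl)) s                   = s
  sameEdge-trans (inj₂ (refl , refl)) (inj₁ (refl , refl)) = inj₂ (refl , refl)
  sameEdge-trans (inj₂ (refl , refl)) (inj₂ (refl , refl)) = inj₁ (refl , refl)

  sideOf-resp : ∀ {a b c d x y z} → SameEdge (a , b) (c , d) → SideOf (c , d) x y z → SideOf (a , b) x y z
  sideOf-resp s (inj₁ t)        = inj₁ (sameEdge-trans s t)
  sideOf-resp s (inj₂ (inj₁ t)) = inj₂ (inj₁ (sameEdge-trans s t))
  sideOf-resp s (inj₂ (inj₂ t)) = inj₂ (inj₂ (sameEdge-trans s t))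

  shareTriangle-resp : ∀ {T a b c d e f} → SameEdge (a , b) (c , d) →
    ShareTriangle T (c , d) (e , f) → ShareTriangle T (a , b) (e , f)
  shareTriangle-resp s (differ , x , y , z , t , s₁ , s₂) =
    (λ s' → differ (sameEdge-trans (sameEdge-sym s) s')) , x , y , z , t , sideOf-resp s s₁ , s₂

  side₁-shares : ∀ {T a b w} → T a b w ≡ true → ¬ (a ≡ w) → ¬ (b ≡ w) → ShareTriangle T (w , a) (a , b)
  side₁-shares t a≢w b≢w = differ , _ , _ , _ , t , inj₂ (inj₂ (inj₂ (refl , refl))) , inj₁ (inj₁ (refl , refl))
    where
    differ : ¬ SameEdge _ _
    differ (inj₁ (w≡a , _)) = a≢w (≡.sym w≡a)
    differ (inj₂ (w≡b , _)) = b≢w (≡.sym w≡b)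

  side₂-shares : ∀ {T a b w} → T a b w ≡ true → ¬ (a ≡ w) → ¬ (b ≡ w) → ShareTriangle T (w , b) (a , b)
  side₂-shares t a≢w b≢w = differ , _ , _ , _ , t , inj₂ (inj₁ (inj₂ (refl , refl))) , inj₁ (inj₁ (refl , refl))
    where
    differ : ¬ SameEdge _ _
    differ (inj₁ (w≡a , _)) = a≢w (≡.sym w≡a)
    differ (inj₂ (w≡b , _)) = b≢w (≡.sym w≡b)

module FlipSequences (K : OrderedField) {n : ℕ} (P : Fin n → Geometry.Point K) where
  open import Data.Nat as ℕ using (ℕ; zero; suc)
  open import Data.Fin as Fin using (Fin; toℕ)
  import Data.Fin.Properties as Fin
  open import Data.List using ([]; _∷_; lookup; take)
  open import Data.Product using (_,_)
  open import Relation.Binary.PropositionalEquality as ≡ using (_≡_; refl)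
  open Geometry K
  open PointSet P
  open FlipInvariant K P

  admissible-at : ∀ T (F : List Flip) → Valid T F → (j : Fin (length F)) →
    Admissible (applyAll T (take (toℕ j) F)) (lookup F j)
  admissible-at T (f ∷ F) (adm , _)     Fin.zero    = adm
  admissible-at T (f ∷ F) (_ , valid) (Fin.suc j) = admissible-at (doFlip T f) F valid j

  apply-step : ∀ T (F : List Flip) (j : Fin (length F)) →
    applyAll T (take (suc (toℕ j)) F) ≡ doFlip (applyAll T (take (toℕ j) F)) (lookup F j)
  apply-step T (f ∷ F) Fin.zero    = refl
  apply-step T (f ∷ F) (Fin.suc j) = apply-step (doFlip T f) F j

  triangulated-along : ∀ T (F : List Flip) → Triangulated T → Valid T F → ∀ m → Triangulated (applyAll T (take m F))
  triangulated-along T []      tri _           zero    = tri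
  triangulated-along T []      tri _           (suc m) = tri
  triangulated-along T (f ∷ F) tri _           zero    = tri
  triangulated-along T (f ∷ F) tri (adm , valid) (suc m) =
    triangulated-along (doFlip T f) F (FlipPreserves.triangulated′ tri adm) valid m

-- Fix a valid flip sequence F from a
-- triangulated T₀ and a flip f_i removing the edge e = uv.  Every edge
-- that properly crosses e in a later triangulation was created after f_i
-- by a flip reachable from f_i in D_F, as long as e is not flipped again.
module CrossingPaths (K : OrderedField) {n : ℕ} (P : Fin n → Geometry.Point K)
  (Ti Tf : Geometry.PointSet.TriSet K P) (Ti-triangulated : FlipInvariant.Triangulated K P Ti)
  (F : List (Geometry.PointSet.Flip K P)) (valid : Geometry.PointSet.Valid K P Ti F)
  (i : Fin (length F)) where
  open import Data.Nat as ℕ using (ℕ; suc; s≤s)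
  import Data.Nat.Properties as ℕ
  open import Data.Fin as Fin using (Fin; toℕ; fromℕ<)
  import Data.Fin.Properties as Fin
  open import Data.List using (take)
  open import Data.Bool using (true)
  open import Data.Product using (_×_; _,_; proj₁; Σ)
  open import Data.Sum using (_⊎_; inj₁; inj₂)
  open import Data.Empty using (⊥-elim)
  open import Relation.Nullary using (¬_)
  open import Relation.Binary.PropositionalEquality as ≡ using (_≡_; refl)
  open import Relation.Binary.Construct.Closure.ReflexiveTransitive as Star using (_◅_; _◅◅_)
  open Geometry K
  open PointSet P
  open FlipDAG Ti Tf F
  open OrderedFieldProperties K using (_≈_; 0#)
  open PlaneGeometry K using (properCross-sym)
  open PointSetGeometry K P
  open FlipInvariant K P
  open EdgeFacts K P
  open FlipSequences K P

  T : ℕ → TriSet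
  T m = applyAll Ti (take m F)

  triangulated : ∀ m → Triangulated (T m)
  triangulated = triangulated-along Ti F Ti-triangulated valid

  ι : ℕ
  ι = toℕ i

  u v w : Fin n
  u = Flip.a (fl i)
  v = Flip.b (fl i)
  w = Flip.c (fl i)

  uvw : T ι u v w ≡ true
  uvw = proj₁ (admissible-at Ti F valid i)

  uvw-empty : Empty u v w
  uvw-empty = Triangulated.empty (triangulated ι) uvw

  uvw-nondegenerate : ¬ (O u v w ≈ 0#)
  uvw-nondegenerate = Triangulated.nondegenerate (triangulated ι) uvw

  -- a witness for the edge xy at time m: a flip f_q before m, reachable
  -- from f_i, that created xy, after which xy was not removed before m
  Witness : ℕ → Fin n → Fin n → Set
  Witness m x y = Σ Idx λ q → toℕ q ℕ.< m × SameEdge (φ (fl q)) (x , y) × DirectedPath i q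
    × (∀ p → toℕ q ℕ.< toℕ p → toℕ p ℕ.< m → ¬ SameEdge (ε (fl p)) (φ (fl q)))

  Witnessed : ℕ → Set
  Witnessed m = ∀ {x y z} → T m x y z ≡ true → ProperCross x y u v → Witness m x y

  witness⇒path : (m : Idx) → ∀ {x y} → Witness (toℕ m) x y →
    SameEdge (x , y) (ε (fl m)) ⊎ ShareTriangle (T (toℕ m)) (x , y) (ε (fl m)) → DirectedPath i m
  witness⇒path m (q , q<m , created , path , kept) (inj₁ same) =
    path ◅◅ ((q<m , inj₁ (sameEdge-trans created same) , kept) ◅ Star.ε)
  witness⇒path m (q , q<m , created , path , kept) (inj₂ shared) =
    path ◅◅ ((q<m , inj₂ (shareTriangle-resp created shared) , kept) ◅ Star.ε)

  module AtFlip (m : Idx) where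
    a b c d : Fin n
    a = Flip.a (fl m)
    b = Flip.b (fl m)
    c = Flip.c (fl m)
    d = Flip.d (fl m)

    open FlipPreserves (triangulated (toℕ m)) (admissible-at Ti F valid m) public
    open Distinct4 d4

    after : ∀ {x y z} → T (suc (toℕ m)) x y z ≡ true → T' x y z ≡ true
    after {x} {y} {z} t = ≡.subst (λ T → T x y z ≡ true) (apply-step Ti F m) t

    reach-via-removed : Witnessed (toℕ m) → ProperCross a b u v → DirectedPath i m
    reach-via-removed witnessed ab×e = witness⇒path m (witnessed abc ab×e) (inj₁ (inj₁ (refl , refl)))

    -- if the created edge cd properly crosses e ≠ ab, then e leaves the
    -- quadrilateral acbd through one of its sides, which shares a
    -- triangle with ab and is witnessed
    reach-via-quad : Witnessed (toℕ m) → ¬ SameEdge (a , b) (u , v) → ProperCross c d u v → DirectedPath i m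
    reach-via-quad witnessed ab≢e cd×e = through
      (exits-flipQuad cv (Triangulated.empty (triangulated (toℕ m)) abc) (Triangulated.empty (triangulated (toℕ m)) abd)
                      uvw-empty uvw-nondegenerate cd×e)
      where
      through : ExitsFlipQuad a b c d u v → DirectedPath i m
      through (inj₁ e×ca) = witness⇒path m (witnessed Tcab (properCross-sym e×ca)) (inj₂ (side₁-shares abc ac bc))
      through (inj₂ (inj₁ e×da)) = witness⇒path m (witnessed Tdab (properCross-sym e×da)) (inj₂ (side₁-shares abd ad bd))
      through (inj₂ (inj₂ (inj₁ e×db))) = witness⇒path m (witnessed Tdba (properCross-sym e×db)) (inj₂ (side₂-shares abd ad bd))
      through (inj₂ (inj₂ (inj₂ (inj₁ e×cb)))) = witness⇒path m (witnessed Tcba (properCross-sym e×cb)) (inj₂ (side₂-shares abc ac bc))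
      through (inj₂ (inj₂ (inj₂ (inj₂ (inj₁ (u≡a , v≡b)))))) = ⊥-elim (ab≢e (inj₁ (≡.sym u≡a , ≡.sym v≡b)))
      through (inj₂ (inj₂ (inj₂ (inj₂ (inj₂ (u≡b , v≡a)))))) = ⊥-elim (ab≢e (inj₂ (≡.sym v≡a , ≡.sym u≡b)))

  no-index-between : ∀ {m p} → m ℕ.< p → p ℕ.< suc m → ∀ {A : Set} → A
  no-index-between m<p p<1+m = ⊥-elim (ℕ.<-irrefl refl (ℕ.<-≤-trans m<p (ℕ.≤-pred p<1+m)))

  -- right after f_i the only edge crossing e is the new edge φ(f_i): an
  -- old edge crossing e would have crossed the edge e of T ι
  witnessed-first : Witnessed (suc ι)
  witnessed-first t x×e with AtFlip.edge-after-flip i (AtFlip.after i t)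
  ... | inj₁ (_ , old) = ⊥-elim (Triangulated.no-proper-cross (triangulated ι) old uvw x×e)
  ... | inj₂ new = i , ℕ.n<1+n ι , sameEdge-sym new , Star.ε , λ p i<p p<1+i → no-index-between i<p p<1+i

  -- one more flip f_m, not removing e, keeps every crossing edge witnessed:
  -- old edges keep their witness, and the new edge is reached through the
  -- quadrilateral of f_m
  witnessed-step : (m : Idx) → ι ℕ.< toℕ m → ¬ SameEdge (ε (fl m)) (u , v) →
    Witnessed (toℕ m) → Witnessed (suc (toℕ m))
  witnessed-step m ι<m ab≢e witnessed {x} {y} {z} t x×e with AtFlip.edge-after-flip m (AtFlip.after m t)
  ... | inj₁ (_ , old) = extend (witnessed old x×e)
    where
    open AtFlip m
    not-removed : ¬ SameEdge (a , b) (x , y)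
    not-removed (inj₁ (refl , refl)) = removed-edge-gone (after t)
    not-removed (inj₂ (refl , refl)) = removed-edge-gone (≡.trans (≡.sym (sym₁₂′ x y z)) (after t))
    extend : Witness (toℕ m) x y → Witness (suc (toℕ m)) x y
    extend (q , q<m , created , path , kept) = q , ℕ.m<n⇒m<1+n q<m , created , path , kept′
      where
      kept′ : ∀ p → toℕ q ℕ.< toℕ p → toℕ p ℕ.< suc (toℕ m) → ¬ SameEdge (ε (fl p)) (φ (fl q))
      kept′ p q<p p≤m with ℕ.m≤n⇒m<n∨m≡n (ℕ.≤-pred p≤m)
      ... | inj₁ p<m = kept p q<p p<m
      ... | inj₂ p≡m with Fin.toℕ-injective {i = p} {j = m} p≡m
      ... | refl = λ removes → not-removed (sameEdge-trans removes created)
  ... | inj₂ new = m , ℕ.n<1+n (toℕ m) , sameEdge-sym new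
                 , AtFlip.reach-via-quad m witnessed ab≢e (properCross-resp-sameEdgeˡ new x×e)
                 , λ p m<p p<1+m → no-index-between m<p p<1+m

  witnessed-until : (h : Idx) → (∀ p → ι ℕ.< toℕ p → toℕ p ℕ.< toℕ h → ¬ SameEdge (ε (fl p)) (u , v)) →
    ∀ m → ι ℕ.< m → m ℕ.≤ toℕ h → Witnessed m
  witnessed-until h untouched (suc m) (s≤s ι≤m) 1+m≤h with ℕ.m≤n⇒m<n∨m≡n ι≤m
  ... | inj₂ refl = witnessed-first
  ... | inj₁ ι<m = ≡.subst (λ k → Witnessed (suc k)) j≡m
        (witnessed-step j (≡.subst (ι ℕ.<_) (≡.sym j≡m) ι<m)
          (untouched j (≡.subst (ι ℕ.<_) (≡.sym j≡m) ι<m) (≡.subst (ℕ._< toℕ h) (≡.sym j≡m) 1+m≤h))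
          (≡.subst Witnessed (≡.sym j≡m) (witnessed-until h untouched m ι<m (ℕ.<⇒≤ 1+m≤h))))
    where
    m<length : m ℕ.< length F
    m<length = ℕ.<-trans 1+m≤h (Fin.toℕ<n h)
    j : Idx
    j = fromℕ< m<length
    j≡m : toℕ j ≡ m
    j≡m = Fin.toℕ-fromℕ< m<length

  crossing⇒directedPath : Distinct → (h : Idx) → ι ℕ.< toℕ h → ¬ SameEdge (ε (fl h)) (u , v) →
    (∀ p → ι ℕ.< toℕ p → toℕ p ℕ.< toℕ h → ¬ SameEdge (ε (fl p)) (u , v)) →
    Cross (φ (fl h)) (u , v) → DirectedPath i h
  crossing⇒directedPath distinct h ι<h ab≢e untouched cd-crosses-e =
    reach (crossing⇒proper-or-same distinct cda-empty (FlipQuadSigns.cda (flipQuad-signs cv))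
                                   uvw-empty uvw-nondegenerate cd-crosses-e)
    where
    open AtFlip h
    witnessed : Witnessed (toℕ h)
    witnessed = witnessed-until h untouched (toℕ h) ι<h ℕ.≤-refl
    cda-empty : Empty c d a
    cda-empty = proj₁ (flip-keeps-empty cv (Triangulated.empty (triangulated (toℕ h)) abc)
                                           (Triangulated.empty (triangulated (toℕ h)) abd))
    reach : ProperCross c d u v ⊎ SameEdge (c , d) (u , v) → DirectedPath i h
    reach (inj₁ cd×e) = reach-via-quad witnessed ab≢e cd×e
    reach (inj₂ cd≡e) = reach-via-removed witnessed
      (properCross-resp-sameEdgeʳ cd≡e (FlipQuadSigns.pxab (flipQuad-signs cv)))

open import Data.Nat using (_<_)
open import Data.Fin using (toℕ)
open import Data.Product using (_,_)
open import Relation.Nullary using (¬_)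

lemma3 : (K : OrderedField) (n : ℕ) (P : Fin n → Geometry.Point K) →
    let open Geometry K in
    let open PointSet P in
    Distinct →
    (Ti Tf : TriSet) → IsTriangulation Ti → IsTriangulation Tf →
    (F : List Flip) →
    let open FlipDAG Ti Tf F in
    IsNormalizedSolution →
    (i h : Idx) → SameComponent i h → toℕ i < toℕ h →
    ¬ SameEdge (ε (fl i)) (ε (fl h)) →
    Cross (φ (fl h)) (ε (fl i)) →
    (∀ p → toℕ i < toℕ p → toℕ p < toℕ h → ¬ SameEdge (ε (fl p)) (ε (fl i))) →
    DirectedPath i h
lemma3 K n P distinct Ti Tf Ti-triangulation _ F (((valid , _) , _) , _) i h _ i<h εi≢εh crosses untouched =
  crossing⇒directedPath distinct h i<h (λ same → εi≢εh (sameEdge-sym same)) untouched crosses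
  where
  open FlipInvariant K P using (triangulation⇒triangulated)
  open CrossingPaths K P Ti Tf (triangulation⇒triangulated Ti-triangulation) F valid i
  open EdgeFacts K P using (sameEdge-sym)
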